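{- Let $g\ge1$, ${\underline{n}},{\underline{r}}\in\mathbb{N}_0^g$, and let $S\subseteq(\hat0,\hat1)$ be any subset of the open interval $(\hat0,\hat1)=\{c\in P_{{\underline{n}},{\underline{r}}}:\hat0<_t c<_t\hat1\}$, with complement $S^c=(\hat0,\hat1)\setminus S$. Then \[ \sum_{C}(-1)^{|C|}W_C(\mathbf{Y})=(-1)^{N-1}K(\mathbf{Y})\cdot\sum_{C'}(-1)^{|C'|}W_{C'}(\mathbf{Y}^{ -1}), \] where the left sum is over all strict chains $C$ (including the empty chain) contained in $S$, the right sum over all strict chains $C'$ (including the empty chain) contained in $S^c$, $|C|$ is the number of elements of $C$, $N=\sum_{i=1}^g(n_i+r_i)$ and $K(\mathbf{Y})=\prod_{i=1}^{g}\Big(Y_{i,0}^{\binom{r_i}{2}}\prod_{j=1}^{n_i}Y_{i,j}^{\,r_i+j-1}\Big)$.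
   Context: $\mathbb{N}_0$ is the set of non-negative integers. $\binom{n}{k}_Y=\prod_{i=1}^{k}\frac{1-Y^{n-k+i}}{1-Y^i}$ for $0\le k\le n$, and $0$ if $k>n$. For $n,r\in\mathbb{N}_0$, $P_{n,r}$ is the set of tuples $a=(a_0,\dots,a_n)$ of non-negative integers with $a_0\le r$, $a_i\le1$ ($1\le i\le n$), ordered by $a\le_t b$ iff $\sum_{j=0}^i a_j\le\sum_{j=0}^i b_j$ for all $0\le i\le n$. Set $s_0(a)=\binom{a_0}{2}$, $s_i(a)=\sum_{k=0}^{i-1}a_k$ ($1\le i\le n+1$), $\Delta_i(a,b)=s_i(b)-s_i(a)$. Define $\theta_{a,b}(Y_0)=\binom{b_0}{a_0}_{Y_0}$; $\phi_{a,b}(Y_1,\dots,Y_n)=\prod_{i\in L_{a,b}}(1-Y_i^{\Delta_i(a,b)})$ if $a\le_t b$ and $0$ otherwise, where $L_{a,b}=\{i\ge1:a_i=1,b_i=0\}$. $P_{{\underline{n}},{\underline{r}}}=P_{n_1,r_1}\times\cdots\times P_{n_g,r_g}$ with the product order; $\hat0$ is the all-zero element, $\hat1$ has $i$-th component $(r_i,1,\dots,1)$. Variables $\mathbf{Y}=(Y_{i,j})_{i\in[g],0\le j\le n_i}$; $w_{a,b}(\mathbf{Y})=\prod_{i=1}^g\theta_{a^{(i)},b^{(i)}}(Y_{i,0})\phi_{a^{(i)},b^{(i)}}(Y_{i,1},\dots,Y_{i,n_i})$ for $a=(a^{(i)})_i$, $b=(b^{(i)})_i$. For a chain $C:c_1<_t\cdots<_t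 c_k$, with $c_0=\hat0$, $c_{k+1}=\hat1$, $W_C(\mathbf{Y})=\prod_{j=0}^k w_{c_j,c_{j+1}}(\mathbf{Y})$; $W_C(\mathbf{Y}^{ -1})$ means substituting $Y_{i,j}^{ -1}$ for each variable. -}

module Defs where

open import Data.Bool using (Bool; true; false; _∧_; _∨_; not; if_then_else_)
open import Data.Nat as ℕ using (ℕ; zero; suc; _∸_; _≤ᵇ_; _≡ᵇ_)
open import Data.Fin using (Fin; zero; suc; toℕ; inject₁)
open import Data.Vec as Vec using (Vec; []; _∷_; lookup)
open import Data.List as List using (List; []; _∷_; _++_; concatMap; upTo; allFin)
open import Data.Product using (_×_; _,_)
open import Data.Unit using (⊤; tt)
open import Data.Nat.Combinatorics using (_C_)
open import Relation.Binary.PropositionalEquality using (_≢_)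
open import Data.Integer using (+_; -[1+_])
open import Data.Rational as ℚ using (ℚ; mkℚ; 0ℚ; 1ℚ; _+_; _*_; -_; 1/_)

pow : ℚ → ℕ → ℚ
pow y zero    = 1ℚ
pow y (suc k) = y * pow y k

-- total inverse (inverse of 0 is set to 0; only used at nonzero arguments)
inv : ℚ → ℚ
inv (mkℚ (+ zero) _ _)      = 0ℚ
inv p@(mkℚ (+ suc _) _ _)   = 1/ p
inv p@(mkℚ -[1+ _ ] _ _)    = 1/ p

prodFin : (n : ℕ) → (Fin n → ℚ) → ℚ
prodFin zero    f = 1ℚ
prodFin (suc n) f = f zero * prodFin n (λ i → f (suc i))

sumList : List ℚ → ℚ
sumList = List.foldr _+_ 0ℚ

qbinom : ℚ → ℕ → ℕ → ℚ
qbinom Y n k =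
  if k ≤ᵇ n
  then prodFin k (λ i → (1ℚ + - pow Y ((n ∸ k) ℕ.+ suc (toℕ i)))
                        * inv (1ℚ + - pow Y (suc (toℕ i))))
  else 0ℚ

P : ℕ → ℕ → Set
P n r = Fin (suc r) × Vec Bool n

b2n : Bool → ℕ
b2n true  = 1
b2n false = 0

digits : ∀ {n r} → P n r → Vec ℕ (suc n)
digits (a0 , v) = toℕ a0 ∷ Vec.map b2n v

psums : ∀ {m} → Vec ℕ m → Vec ℕ m
psums []       = []
psums (x ∷ xs) = x ∷ Vec.map (x ℕ.+_) (psums xs)

allLeᵇ : ∀ {m} → Vec ℕ m → Vec ℕ m → Bool
allLeᵇ []       []       = true
allLeᵇ (x ∷ xs) (y ∷ ys) = (x ≤ᵇ y) ∧ allLeᵇ xs ys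

allEqᵇ : ∀ {m} → Vec ℕ m → Vec ℕ m → Bool
allEqᵇ []       []       = true
allEqᵇ (x ∷ xs) (y ∷ ys) = (x ≡ᵇ y) ∧ allEqᵇ xs ys

leP : ∀ {n r} → P n r → P n r → Bool
leP a b = allLeᵇ (psums (digits a)) (psums (digits b))

eqP : ∀ {n r} → P n r → P n r → Bool
eqP a b = allEqᵇ (digits a) (digits b)

allBoolVecs : (n : ℕ) → List (Vec Bool n)
allBoolVecs zero    = [] ∷ []
allBoolVecs (suc n) = concatMap (λ v → (false ∷ v) ∷ (true ∷ v) ∷ []) (allBoolVecs n)

allP : (n r : ℕ) → List (P n r)
allP n r = concatMap (λ a0 → List.map (λ v → (a0 , v)) (allBoolVecs n)) (allFin (suc r))

θ : ∀ {n r} → P n r → P n r → ℚ → ℚ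
θ (a0 , _) (b0 , _) Y0 = qbinom Y0 (toℕ b0) (toℕ a0)

-- φ_{a,b}(Y_1..Y_n) = prod_{i ∈ L_{a,b}} (1 - Y_i^{Δ_i(a,b)}) if a ≤_t b, else 0.
-- Index i ∈ Fin n stands for position i+1; s_{i+1}(a) = a_0+...+a_i is entry i of psums.
φ : ∀ {n r} → P n r → P n r → Vec ℚ (suc n) → ℚ
φ {n} a@(_ , va) b@(_ , vb) Y =
  if leP a b
  then prodFin n (λ i →
         if lookup va i ∧ not (lookup vb i)
         then 1ℚ + - pow (lookup Y (suc i))
                   (lookup (psums (digits b)) (inject₁ i) ∸ lookup (psums (digits a)) (inject₁ i))
         else 1ℚ)
  else 0ℚ

zeroP : ∀ {n r} → P n r
zeroP {n} = zero , Vec.replicate n false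

oneP : ∀ {n r} → P n r
oneP {n} {r} = Data.Fin.fromℕ r , Vec.replicate n true

Elt : ∀ {g} → Vec ℕ g → Vec ℕ g → Set
Elt []       []       = ⊤
Elt (n ∷ ns) (r ∷ rs) = P n r × Elt ns rs

Vars : ∀ {g} → Vec ℕ g → Set
Vars []       = ⊤
Vars (n ∷ ns) = Vec ℚ (suc n) × Vars ns

leE : ∀ {g} {ns rs : Vec ℕ g} → Elt ns rs → Elt ns rs → Bool
leE {ns = []}    {[]}    _ _ = true
leE {ns = _ ∷ _} {_ ∷ _} (a , as) (b , bs) = leP a b ∧ leE as bs

eqE : ∀ {g} {ns rs : Vec ℕ g} → Elt ns rs → Elt ns rs → Bool
eqE {ns = []}    {[]}    _ _ = true
eqE {ns = _ ∷ _} {_ ∷ _} (a , as) (b , bs) = eqP a b ∧ eqE as bs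

ltE : ∀ {g} {ns rs : Vec ℕ g} → Elt ns rs → Elt ns rs → Bool
ltE a b = leE a b ∧ not (eqE a b)

bot : ∀ {g} {ns rs : Vec ℕ g} → Elt ns rs
bot {ns = []}    {[]}    = tt
bot {ns = _ ∷ _} {_ ∷ _} = zeroP , bot

top : ∀ {g} {ns rs : Vec ℕ g} → Elt ns rs
top {ns = []}    {[]}    = tt
top {ns = _ ∷ _} {_ ∷ _} = oneP , top

allE : ∀ {g} (ns rs : Vec ℕ g) → List (Elt ns rs)
allE []       []       = tt ∷ []
allE (n ∷ ns) (r ∷ rs) = concatMap (λ a → List.map (λ as → (a , as)) (allE ns rs)) (allP n r)

inInterval : ∀ {g} {ns rs : Vec ℕ g} → Elt ns rs → Bool
inInterval c = ltE bot c ∧ ltE c top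

w : ∀ {g} {ns rs : Vec ℕ g} → Elt ns rs → Elt ns rs → Vars ns → ℚ
w {ns = []}    {[]}    _ _ _ = 1ℚ
w {ns = _ ∷ _} {_ ∷ _} (a , as) (b , bs) (Y , Ys) =
  θ a b (lookup Y zero) * φ a b Y * w as bs Ys

invVars : ∀ {g} {ns : Vec ℕ g} → Vars ns → Vars ns
invVars {ns = []}    _        = tt
invVars {ns = _ ∷ _} (Y , Ys) = Vec.map inv Y , invVars Ys

wPath : ∀ {g} {ns rs : Vec ℕ g} → List (Elt ns rs) → Vars ns → ℚ
wPath []            Y = 1ℚ
wPath (x ∷ [])      Y = 1ℚ
wPath (x ∷ y ∷ xs)  Y = w x y Y * wPath (y ∷ xs) Y

W : ∀ {g} {ns rs : Vec ℕ g} → List (Elt ns rs) → Vars ns → ℚ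
W ch Y = wPath (bot ∷ ch List.++ (top ∷ [])) Y

listsOfLength : ∀ {A : Set} → ℕ → List A → List (List A)
listsOfLength zero    xs = [] ∷ []
listsOfLength (suc k) xs = concatMap (λ x → List.map (x ∷_) (listsOfLength k xs)) xs

increasing : ∀ {g} {ns rs : Vec ℕ g} → List (Elt ns rs) → Bool
increasing []           = true
increasing (x ∷ [])     = true
increasing (x ∷ y ∷ xs) = ltE x y ∧ increasing (y ∷ xs)

allᵇ : ∀ {A : Set} → (A → Bool) → List A → Bool
allᵇ p []       = true
allᵇ p (x ∷ xs) = p x ∧ allᵇ p xs

-- all strict chains (each listed once, as its increasing enumeration, including the empty
-- chain) all of whose elements satisfy T.  A strict chain has at most |P| elements.
chainsIn : ∀ {g} {ns rs : Vec ℕ g} → (Elt ns rs → Bool) → List (List (Elt ns rs))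
chainsIn {ns = ns} {rs} T =
  filterᵇ (λ ch → increasing ch ∧ allᵇ T ch)
    (concatMap (λ k → listsOfLength k (allE ns rs)) (upTo (suc (List.length (allE ns rs)))))
  where
  filterᵇ : ∀ {A : Set} → (A → Bool) → List A → List A
  filterᵇ p []       = []
  filterᵇ p (x ∷ xs) = if p x then x ∷ filterᵇ p xs else filterᵇ p xs

sgn : ℕ → ℚ
sgn k = pow (- 1ℚ) k

chainSum : ∀ {g} {ns rs : Vec ℕ g} → (Elt ns rs → Bool) → Vars ns → ℚ
chainSum T Y = sumList (List.map (λ ch → sgn (List.length ch) * W ch Y) (chainsIn T))

Ntot : ∀ {g} → Vec ℕ g → Vec ℕ g → ℕ
Ntot ns rs = Vec.sum ns ℕ.+ Vec.sum rs

K : ∀ {g} (ns rs : Vec ℕ g) → Vars ns → ℚ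
K []       []       _        = 1ℚ
K (n ∷ ns) (r ∷ rs) (Y , Ys) =
  pow (lookup Y zero) (r C 2)
  * prodFin n (λ j → pow (lookup Y (suc j)) (r ℕ.+ toℕ j))
  * K ns rs Ys

complIn : ∀ {g} {ns rs : Vec ℕ g} → (Elt ns rs → Bool) → Elt ns rs → Bool
complIn S c = inInterval c ∧ not (S c)

GenericVec : ∀ {m} → Vec ℚ m → Set
GenericVec []       = ⊤
GenericVec (y ∷ ys) = (y ≢ 0ℚ) × (y ≢ 1ℚ) × (y ≢ - 1ℚ) × GenericVec ys

-- every variable is a rational number different from 0, 1, -1
-- (so that all q-binomials and Y^{-1} are defined)
Generic : ∀ {g} {ns : Vec ℕ g} → Vars ns → Set
Generic {ns = []}    _        = ⊤
Generic {ns = _ ∷ _} (Y , Ys) =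
  GenericVec Y × Generic Ys

-- w(Y) is unitriangular in the incidence algebra of P = ∏ᵢ P_{nᵢ,rᵢ}, and its inverse is
-- w(Y⁻¹) conjugated by c(a) = (-1)^|a| mₐ(Y), where |a| is the rank of a and mₐ a monomial
-- with m_1̂ = K.  This is checked on one factor P_{n,r} at a time, by induction on n: for
-- n = 0 it is the orthogonality of Gaussian binomials in q and q⁻¹ (the q-binomial theorem
-- at -1), and a new coordinate multiplies each term by a factor whose sum over the two
-- values of that coordinate does not depend on the others.
-- For mutually inverse 1 + u and 1 + v, the signed chain sums of u through S and of v
-- through (0̂,1̂) ∖ S cancel, since they satisfy the same triangular recursion up to sign.
-- Along a chain the conjugation telescopes to c(1̂)/c(0̂) = (-1)^N K, and the cancellation
-- contributes one more sign.  When N = 0, 0̂ = 1̂ and both sides are 1.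

module Submission where

open import Defs
open import Data.Bool using (Bool; true; false; _∧_; not; if_then_else_; T)
open import Data.Bool.Properties using (∧-assoc; ∧-zeroʳ; ∧-identityʳ)
open import Data.Empty using (⊥-elim)
import Data.Integer as ℤ
open import Data.Fin as Fin using (Fin; toℕ; inject₁; fromℕ)
import Data.Fin.Properties as FinP
open import Data.List as List using (List; []; _∷_; _++_; concatMap; upTo; applyUpTo; allFin; tabulate)
open import Data.List.Membership.Propositional using (_∈_)
open import Data.List.Membership.Propositional.Properties using (∈-allFin; ∈-map⁺; ∈-concatMap⁺)
open import Data.List.Relation.Unary.Any as Any using (here; there)
open import Data.Nat as ℕ using (ℕ; zero; suc; _∸_; _≤_; _<_; _≤ᵇ_; _≡ᵇ_; z≤n; s≤s)
import Data.Nat.Properties as ℕP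
import Data.Nat.Solver as ℕSolver
open import Data.Nat.Combinatorics using (_C_; nCk+nC[k+1]≡[n+1]C[k+1]; nC1≡n)
open import Data.Product using (_×_; _,_; proj₁; proj₂; ∃₂)
open import Data.Rational as ℚ using (ℚ; mkℚ; 0ℚ; 1ℚ; _+_; _*_; -_; ∣_∣)
import Data.Rational.Properties as ℚP
open import Algebra.Properties.Group ℚP.+-0-group using () renaming (∙-cancelˡ to +-cancelˡ)
open import Data.Rational.Solver using (module +-*-Solver)
open import Data.Sum using (_⊎_; inj₁; inj₂)
open import Data.Unit using (⊤; tt)
open import Data.Vec as Vec using (Vec; []; _∷_; _∷ʳ_; lookup)
import Data.Vec.Properties as VecP
open import Relation.Binary.Definitions using (tri<; tri≈; tri>)
open import Relation.Binary.PropositionalEquality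
open +-*-Solver
open ≡-Reasoning

∑ : ∀ {A : Set} → List A → (A → ℚ) → ℚ
∑ []       f = 0ℚ
∑ (x ∷ xs) f = f x + ∑ xs f

infix 5 ∑
syntax ∑ xs (λ x → e) = ∑[ x ∈ xs ] e

∑-cong : ∀ {A : Set} (xs : List A) {f g : A → ℚ} → (∀ x → f x ≡ g x) → ∑ xs f ≡ ∑ xs g
∑-cong []       e = refl
∑-cong (x ∷ xs) e = cong₂ _+_ (e x) (∑-cong xs e)

∑-zero : ∀ {A : Set} (xs : List A) {f : A → ℚ} → (∀ x → f x ≡ 0ℚ) → ∑ xs f ≡ 0ℚ
∑-zero []       e = refl
∑-zero (x ∷ xs) e = cong₂ _+_ (e x) (∑-zero xs e)

∑-++ : ∀ {A : Set} (xs ys : List A) (f : A → ℚ) → ∑ (xs ++ ys) f ≡ ∑ xs f + ∑ ys f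
∑-++ []       ys f = sym (ℚP.+-identityˡ _)
∑-++ (x ∷ xs) ys f = trans (cong (f x +_) (∑-++ xs ys f)) (sym (ℚP.+-assoc (f x) _ _))

∑-map : ∀ {A B : Set} (h : A → B) (xs : List A) (f : B → ℚ) → ∑ (List.map h xs) f ≡ ∑[ x ∈ xs ] f (h x)
∑-map h []       f = refl
∑-map h (x ∷ xs) f = cong (f (h x) +_) (∑-map h xs f)

∑-concatMap : ∀ {A B : Set} (h : A → List B) (xs : List A) (f : B → ℚ) →
  ∑ (concatMap h xs) f ≡ ∑[ x ∈ xs ] ∑ (h x) f
∑-concatMap h []       f = refl
∑-concatMap h (x ∷ xs) f = trans (∑-++ (h x) (concatMap h xs) f) (cong (∑ (h x) f +_) (∑-concatMap h xs f))

∑-+ : ∀ {A : Set} (xs : List A) (f g : A → ℚ) → (∑[ x ∈ xs ] (f x + g x)) ≡ ∑ xs f + ∑ xs g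
∑-+ []       f g = refl
∑-+ (x ∷ xs) f g = trans (cong (f x + g x +_) (∑-+ xs f g))
  (solve 4 (λ a b c d → (a :+ b) :+ (c :+ d) := (a :+ c) :+ (b :+ d)) refl (f x) (g x) (∑ xs f) (∑ xs g))

∑-*ˡ : ∀ {A : Set} (xs : List A) (c : ℚ) (f : A → ℚ) → (∑[ x ∈ xs ] c * f x) ≡ c * ∑ xs f
∑-*ˡ []       c f = sym (ℚP.*-zeroʳ c)
∑-*ˡ (x ∷ xs) c f = trans (cong (c * f x +_) (∑-*ˡ xs c f)) (sym (ℚP.*-distribˡ-+ c (f x) _))

∑-*ʳ : ∀ {A : Set} (xs : List A) (c : ℚ) (f : A → ℚ) → (∑[ x ∈ xs ] f x * c) ≡ ∑ xs f * c
∑-*ʳ xs c f = trans (∑-cong xs (λ x → ℚP.*-comm (f x) c)) (trans (∑-*ˡ xs c f) (ℚP.*-comm c _))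

∑-neg : ∀ {A : Set} (xs : List A) (f : A → ℚ) → (∑[ x ∈ xs ] - f x) ≡ - ∑ xs f
∑-neg []       f = refl
∑-neg (x ∷ xs) f = trans (cong (- f x +_) (∑-neg xs f)) (sym (ℚP.neg-distrib-+ (f x) _))

∑-comm : ∀ {A B : Set} (xs : List A) (ys : List B) (f : A → B → ℚ) →
  (∑[ x ∈ xs ] ∑[ y ∈ ys ] f x y) ≡ ∑[ y ∈ ys ] ∑[ x ∈ xs ] f x y
∑-comm []       ys f = sym (∑-zero ys (λ _ → refl))
∑-comm (x ∷ xs) ys f = begin
  ∑ ys (f x) + (∑[ x′ ∈ xs ] ∑ ys (f x′))         ≡⟨ cong (∑ ys (f x) +_) (∑-comm xs ys f) ⟩
  ∑ ys (f x) + (∑[ y ∈ ys ] ∑[ x′ ∈ xs ] f x′ y)  ≡⟨ sym (∑-+ ys (f x) _) ⟩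
  (∑[ y ∈ ys ] (f x y + (∑[ x′ ∈ xs ] f x′ y)))     ∎

∑-upTo-suc : ∀ n (h : ℕ → ℚ) → ∑ (upTo (suc n)) h ≡ h 0 + (∑[ k ∈ upTo n ] h (suc k))
∑-upTo-suc n h = cong (h 0 +_) (∑-applyUpTo suc n h)
  where
  ∑-applyUpTo : ∀ (f : ℕ → ℕ) n (h : ℕ → ℚ) → ∑ (applyUpTo f n) h ≡ ∑[ k ∈ upTo n ] h (f k)
  ∑-applyUpTo f zero    h = refl
  ∑-applyUpTo f (suc n) h = cong (h (f 0) +_)
    (trans (∑-applyUpTo (λ k → f (suc k)) n h) (sym (∑-applyUpTo suc n (λ k → h (f k)))))

∑-upTo-snoc : ∀ n (h : ℕ → ℚ) → ∑ (upTo (suc n)) h ≡ ∑ (upTo n) h + h n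
∑-upTo-snoc zero    h = ℚP.+-comm (h 0) 0ℚ
∑-upTo-snoc (suc n) h = begin
  ∑ (upTo (suc (suc n))) h                            ≡⟨ ∑-upTo-suc (suc n) h ⟩
  h 0 + (∑[ k ∈ upTo (suc n) ] h (suc k))             ≡⟨ cong (h 0 +_) (∑-upTo-snoc n (λ k → h (suc k))) ⟩
  h 0 + ((∑[ k ∈ upTo n ] h (suc k)) + h (suc n))     ≡⟨ sym (ℚP.+-assoc (h 0) _ _) ⟩
  (h 0 + (∑[ k ∈ upTo n ] h (suc k))) + h (suc n)     ≡⟨ cong (_+ h (suc n)) (sym (∑-upTo-suc n h)) ⟩
  ∑ (upTo (suc n)) h + h (suc n)                      ∎

when : Bool → ℚ → ℚ
when b x = if b then x else 0ℚ

when-0 : ∀ b → when b 0ℚ ≡ 0ℚ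
when-0 true  = refl
when-0 false = refl

*-when : ∀ b x y → x * when b y ≡ when b (x * y)
*-when true  x y = refl
*-when false x y = ℚP.*-zeroʳ x

when-∧ : ∀ a b x → when (a ∧ b) x ≡ when a (when b x)
when-∧ true  b x = refl
when-∧ false b x = refl

when-+ : ∀ b x y → when b (x + y) ≡ when b x + when b y
when-+ true  x y = refl
when-+ false x y = refl

when-neg : ∀ b x → when b (- x) ≡ - when b x
when-neg true  x = refl
when-neg false x = refl

when-1-* : ∀ b x → when b 1ℚ * x ≡ when b x
when-1-* true  x = ℚP.*-identityˡ x
when-1-* false x = ℚP.*-zeroˡ x

when-false∧ : ∀ {a} b x → a ≡ false → when (a ∧ b) x ≡ 0ℚ
when-false∧ b x refl = refl

when-∧false : ∀ a {b} x → b ≡ false → when (a ∧ b) x ≡ 0ℚ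
when-∧false a x refl = cong (λ c → when c x) (∧-zeroʳ a)

when-true∧true : ∀ {a b} x → a ≡ true → b ≡ true → when (a ∧ b) x ≡ x
when-true∧true x refl refl = refl

∑-when : ∀ {A : Set} (xs : List A) (b : Bool) (f : A → ℚ) → (∑[ x ∈ xs ] when b (f x)) ≡ when b (∑ xs f)
∑-when xs true  f = refl
∑-when xs false f = ∑-zero xs (λ _ → refl)

inv-*ˡ : ∀ x → x ≢ 0ℚ → inv x * x ≡ 1ℚ
inv-*ˡ (mkℚ (ℤ.+ zero) _ _) x≢0 = ⊥-elim (x≢0 (ℚP.≃⇒≡ (ℚ.*≡* refl)))
inv-*ˡ x@(mkℚ (ℤ.+ suc _) _ _) _ = ℚP.*-inverseˡ x
inv-*ˡ x@(mkℚ ℤ.-[1+ _ ] _ _) _ = ℚP.*-inverseˡ x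

inv-*ʳ : ∀ x → x ≢ 0ℚ → x * inv x ≡ 1ℚ
inv-*ʳ x x≢0 = trans (ℚP.*-comm x (inv x)) (inv-*ˡ x x≢0)

*-cancelʳ : ∀ x y c → c ≢ 0ℚ → x * c ≡ y * c → x ≡ y
*-cancelʳ x y c c≢0 e = begin
  x                ≡⟨ sym (ℚP.*-identityʳ x) ⟩
  x * 1ℚ           ≡⟨ cong (x *_) (sym (inv-*ʳ c c≢0)) ⟩
  x * (c * inv c)  ≡⟨ sym (ℚP.*-assoc x c (inv c)) ⟩
  (x * c) * inv c  ≡⟨ cong (_* inv c) e ⟩
  (y * c) * inv c  ≡⟨ ℚP.*-assoc y c (inv c) ⟩
  y * (c * inv c)  ≡⟨ cong (y *_) (inv-*ʳ c c≢0) ⟩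
  y * 1ℚ           ≡⟨ ℚP.*-identityʳ y ⟩
  y                ∎

*-≢0 : ∀ x y → x ≢ 0ℚ → y ≢ 0ℚ → x * y ≢ 0ℚ
*-≢0 x y x≢0 y≢0 xy≡0 = x≢0 (*-cancelʳ x 0ℚ y y≢0 (trans xy≡0 (sym (ℚP.*-zeroˡ y))))

1-x≢0 : ∀ x → x ≢ 1ℚ → 1ℚ + - x ≢ 0ℚ
1-x≢0 x x≢1 e = x≢1 (begin
  x                  ≡⟨ solve 1 (λ x → x := con 1ℚ :+ :- (con 1ℚ :+ :- x)) refl x ⟩
  1ℚ + - (1ℚ + - x)  ≡⟨ cong (λ z → 1ℚ + - z) e ⟩
  1ℚ                 ∎)

+≡0⇒≡- : ∀ a b → a + b ≡ 0ℚ → a ≡ - b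
+≡0⇒≡- a b a+b≡0 = begin
  a              ≡⟨ solve 2 (λ a b → a := (a :+ b) :+ :- b) refl a b ⟩
  (a + b) + - b  ≡⟨ cong (_+ - b) a+b≡0 ⟩
  0ℚ + - b       ≡⟨ ℚP.+-identityˡ (- b) ⟩
  - b            ∎

*-inv-cross : ∀ a b c d → b ≢ 0ℚ → d ≢ 0ℚ → a * d ≡ c * b → a * inv b ≡ c * inv d
*-inv-cross a b c d b≢0 d≢0 e = begin
  a * inv b                          ≡⟨ solve 2 (λ a ib → a :* ib := (a :* ib) :* con 1ℚ) refl a (inv b) ⟩
  (a * inv b) * 1ℚ                   ≡⟨ cong ((a * inv b) *_) (sym (inv-*ʳ d d≢0)) ⟩
  (a * inv b) * (d * inv d)          ≡⟨ solve 4 (λ a ib d id → (a :* ib) :* (d :* id) := ((a :* d) :* ib) :* id) refl a (inv b) d (inv d) ⟩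
  ((a * d) * inv b) * inv d          ≡⟨ cong (λ z → (z * inv b) * inv d) e ⟩
  ((c * b) * inv b) * inv d          ≡⟨ solve 4 (λ c b ib id → ((c :* b) :* ib) :* id := (c :* id) :* (b :* ib)) refl c b (inv b) (inv d) ⟩
  (c * inv d) * (b * inv b)          ≡⟨ cong ((c * inv d) *_) (inv-*ʳ b b≢0) ⟩
  (c * inv d) * 1ℚ                   ≡⟨ ℚP.*-identityʳ _ ⟩
  c * inv d                          ∎

pow-+ : ∀ x a b → pow x (a ℕ.+ b) ≡ pow x a * pow x b
pow-+ x zero    b = sym (ℚP.*-identityˡ _)
pow-+ x (suc a) b = trans (cong (x *_) (pow-+ x a b)) (sym (ℚP.*-assoc x _ _))

pow-* : ∀ x a b → pow (pow x a) b ≡ pow x (a ℕ.* b)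
pow-* x a zero    = cong (pow x) (sym (ℕP.*-zeroʳ a))
pow-* x a (suc b) = begin
  pow x a * pow (pow x a) b  ≡⟨ cong (pow x a *_) (pow-* x a b) ⟩
  pow x a * pow x (a ℕ.* b)  ≡⟨ sym (pow-+ x a (a ℕ.* b)) ⟩
  pow x (a ℕ.+ a ℕ.* b)      ≡⟨ cong (pow x) (sym (ℕP.*-suc a b)) ⟩
  pow x (a ℕ.* suc b)        ∎

pow-inverse : ∀ y y′ → y′ * y ≡ 1ℚ → ∀ m → pow y′ m * pow y m ≡ 1ℚ
pow-inverse y y′ y′y≡1 zero    = refl
pow-inverse y y′ y′y≡1 (suc m) = begin
  (y′ * pow y′ m) * (y * pow y m)  ≡⟨ solve 4 (λ a b c d → (a :* b) :* (c :* d) := (a :* c) :* (b :* d)) refl y′ (pow y′ m) y (pow y m) ⟩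
  (y′ * y) * (pow y′ m * pow y m)  ≡⟨ cong₂ _*_ y′y≡1 (pow-inverse y y′ y′y≡1 m) ⟩
  1ℚ                               ∎

pow-∸ : ∀ y y′ → y′ * y ≡ 1ℚ → ∀ {u v} → u ≤ v → pow y v * pow y′ u ≡ pow y (v ∸ u)
pow-∸ y y′ y′y≡1 {u} {v} u≤v = begin
  pow y v * pow y′ u                      ≡⟨ cong (λ z → pow y z * pow y′ u) (sym (ℕP.m+[n∸m]≡n u≤v)) ⟩
  pow y (u ℕ.+ (v ∸ u)) * pow y′ u        ≡⟨ cong (_* pow y′ u) (pow-+ y u (v ∸ u)) ⟩
  (pow y u * pow y (v ∸ u)) * pow y′ u    ≡⟨ solve 3 (λ a b c → (a :* b) :* c := b :* (c :* a)) refl (pow y u) (pow y (v ∸ u)) (pow y′ u) ⟩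
  pow y (v ∸ u) * (pow y′ u * pow y u)    ≡⟨ cong (pow y (v ∸ u) *_) (pow-inverse y y′ y′y≡1 u) ⟩
  pow y (v ∸ u) * 1ℚ                      ≡⟨ ℚP.*-identityʳ _ ⟩
  pow y (v ∸ u)                           ∎

sgn-+ : ∀ a b → sgn (a ℕ.+ b) ≡ sgn a * sgn b
sgn-+ = pow-+ (- 1ℚ)

sgn-square : ∀ a → sgn a * sgn a ≡ 1ℚ
sgn-square = pow-inverse (- 1ℚ) (- 1ℚ) refl

∣pow∣ : ∀ q k → ∣ pow q k ∣ ≡ pow ∣ q ∣ k
∣pow∣ q zero    = refl
∣pow∣ q (suc k) = trans (ℚP.∣p*q∣≡∣p∣*∣q∣ q (pow q k)) (cong (∣ q ∣ *_) (∣pow∣ q k))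

module _ (a : ℚ) .{{a≥0 : ℚ.NonNegative a}} where

  pow-suc<1 : a ℚ.< 1ℚ → ∀ k → pow a (suc k) ℚ.< 1ℚ
  pow-suc<1 a<1 zero    = subst (ℚ._< 1ℚ) (sym (ℚP.*-identityʳ a)) a<1
  pow-suc<1 a<1 (suc k) = ℚP.≤-<-trans
    (ℚP.≤-trans (ℚP.*-monoˡ-≤-nonNeg a (ℚP.<⇒≤ (pow-suc<1 a<1 k))) (ℚP.≤-reflexive (ℚP.*-identityʳ a))) a<1

  1<pow-suc : 1ℚ ℚ.< a → ∀ k → 1ℚ ℚ.< pow a (suc k)
  1<pow-suc 1<a zero    = subst (1ℚ ℚ.<_) (sym (ℚP.*-identityʳ a)) 1<a
  1<pow-suc 1<a (suc k) = ℚP.<-≤-trans 1<a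
    (ℚP.≤-trans (ℚP.≤-reflexive (sym (ℚP.*-identityʳ a))) (ℚP.*-monoˡ-≤-nonNeg a (ℚP.<⇒≤ (1<pow-suc 1<a k))))

pow-≢1 : ∀ q → q ≢ 1ℚ → q ≢ - 1ℚ → ∀ i → pow q (suc i) ≢ 1ℚ
pow-≢1 q q≢1 q≢-1 i qⁱ⁺¹≡1 with ℚP.<-cmp ∣ q ∣ 1ℚ
... | tri< ∣q∣<1 _ _ = ℚP.<-irrefl ∣q∣ⁱ⁺¹≡1 (pow-suc<1 ∣ q ∣ {{ℚP.∣-∣-nonNeg q}} ∣q∣<1 i)
  where ∣q∣ⁱ⁺¹≡1 = trans (sym (∣pow∣ q (suc i))) (cong ∣_∣ qⁱ⁺¹≡1)
... | tri> _ _ 1<∣q∣ = ℚP.<-irrefl (sym ∣q∣ⁱ⁺¹≡1) (1<pow-suc ∣ q ∣ {{ℚP.∣-∣-nonNeg q}} 1<∣q∣ i)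
  where ∣q∣ⁱ⁺¹≡1 = trans (sym (∣pow∣ q (suc i))) (cong ∣_∣ qⁱ⁺¹≡1)
... | tri≈ _ ∣q∣≡1 _ with ℚP.∣p∣≡p∨∣p∣≡-p q
...   | inj₁ ∣q∣≡q  = q≢1 (trans (sym ∣q∣≡q) ∣q∣≡1)
...   | inj₂ ∣q∣≡-q = q≢-1 (trans (solve 1 (λ q → q := :- (:- q)) refl q) (cong -_ (trans (sym ∣q∣≡-q) ∣q∣≡1)))

∑-cong-upTo : ∀ n {f g : ℕ → ℚ} → (∀ d → d < n → f d ≡ g d) → ∑ (upTo n) f ≡ ∑ (upTo n) g
∑-cong-upTo zero    e = refl
∑-cong-upTo (suc n) {f} {g} e = begin
  ∑ (upTo (suc n)) f   ≡⟨ ∑-upTo-snoc n f ⟩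
  ∑ (upTo n) f + f n   ≡⟨ cong₂ _+_ (∑-cong-upTo n (λ d d<n → e d (ℕP.m<n⇒m<1+n d<n))) (e n (ℕP.n<1+n n)) ⟩
  ∑ (upTo n) g + g n   ≡⟨ sym (∑-upTo-snoc n g) ⟩
  ∑ (upTo (suc n)) g   ∎

∑-upTo-+ : ∀ n k (f : ℕ → ℚ) → (∀ t → n ≤ t → f t ≡ 0ℚ) → ∑ (upTo (n ℕ.+ k)) f ≡ ∑ (upTo n) f
∑-upTo-+ n zero    f f≡0 = cong (λ m → ∑ (upTo m) f) (ℕP.+-identityʳ n)
∑-upTo-+ n (suc k) f f≡0 = begin
  ∑ (upTo (n ℕ.+ suc k)) f             ≡⟨ cong (λ m → ∑ (upTo m) f) (ℕP.+-suc n k) ⟩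
  ∑ (upTo (suc (n ℕ.+ k))) f           ≡⟨ ∑-upTo-snoc (n ℕ.+ k) f ⟩
  ∑ (upTo (n ℕ.+ k)) f + f (n ℕ.+ k)   ≡⟨ cong₂ _+_ (∑-upTo-+ n k f f≡0) (f≡0 (n ℕ.+ k) (ℕP.m≤m+n n k)) ⟩
  ∑ (upTo n) f + 0ℚ                    ≡⟨ ℚP.+-identityʳ _ ⟩
  ∑ (upTo n) f                         ∎

∑-upTo-reverse : ∀ n (f : ℕ → ℚ) → ∑ (upTo (suc n)) f ≡ ∑[ d ∈ upTo (suc n) ] f (n ∸ d)
∑-upTo-reverse zero    f = refl
∑-upTo-reverse (suc n) f = begin
  ∑ (upTo (suc (suc n))) f                                 ≡⟨ ∑-upTo-snoc (suc n) f ⟩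
  ∑ (upTo (suc n)) f + f (suc n)                           ≡⟨ cong (_+ f (suc n)) (∑-upTo-reverse n f) ⟩
  (∑[ d ∈ upTo (suc n) ] f (n ∸ d)) + f (suc n)            ≡⟨ ℚP.+-comm _ (f (suc n)) ⟩
  f (suc n) + (∑[ d ∈ upTo (suc n) ] f (n ∸ d))            ≡⟨ sym (∑-upTo-suc (suc n) (λ d → f (suc n ∸ d))) ⟩
  (∑[ d ∈ upTo (suc (suc n)) ] f (suc n ∸ d))              ∎

∏upTo : ℕ → (ℕ → ℚ) → ℚ
∏upTo zero    h = 1ℚ
∏upTo (suc k) h = ∏upTo k h * h k

∏upTo-cong : ∀ k {f g : ℕ → ℚ} → (∀ i → f i ≡ g i) → ∏upTo k f ≡ ∏upTo k g
∏upTo-cong zero    e = refl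
∏upTo-cong (suc k) e = cong₂ _*_ (∏upTo-cong k e) (e k)

∏upTo-* : ∀ k (f g : ℕ → ℚ) → ∏upTo k (λ i → f i * g i) ≡ ∏upTo k f * ∏upTo k g
∏upTo-* zero    f g = refl
∏upTo-* (suc k) f g = trans (cong (_* (f k * g k)) (∏upTo-* k f g))
  (solve 4 (λ a b c d → (a :* b) :* (c :* d) := (a :* c) :* (b :* d)) refl (∏upTo k f) (∏upTo k g) (f k) (g k))

∏upTo-1 : ∀ k → ∏upTo k (λ _ → 1ℚ) ≡ 1ℚ
∏upTo-1 zero    = refl
∏upTo-1 (suc k) = cong (_* 1ℚ) (∏upTo-1 k)

∏upTo-const : ∀ k c → ∏upTo k (λ _ → c) ≡ pow c k
∏upTo-const zero    c = refl
∏upTo-const (suc k) c = trans (cong (_* c) (∏upTo-const k c)) (ℚP.*-comm _ c)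

∏upTo-≢0 : ∀ k (h : ℕ → ℚ) → (∀ i → h i ≢ 0ℚ) → ∏upTo k h ≢ 0ℚ
∏upTo-≢0 zero    h h≢0 ()
∏upTo-≢0 (suc k) h h≢0 = *-≢0 _ _ (∏upTo-≢0 k h h≢0) (h≢0 k)

prodFin≡∏upTo : ∀ k (h : ℕ → ℚ) → prodFin k (λ i → h (toℕ i)) ≡ ∏upTo k h
prodFin≡∏upTo zero    h = refl
prodFin≡∏upTo (suc k) h = trans (cong (h 0 *_) (prodFin≡∏upTo k (λ i → h (suc i)))) (shift k h)
  where
  shift : ∀ k (h : ℕ → ℚ) → h 0 * ∏upTo k (λ i → h (suc i)) ≡ ∏upTo k h * h k
  shift zero    h = trans (ℚP.*-identityʳ (h 0)) (sym (ℚP.*-identityˡ (h 0)))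
  shift (suc k) h = trans (sym (ℚP.*-assoc (h 0) _ _)) (cong (_* h (suc k)) (shift k h))

prodFin-cong : ∀ k {f g : Fin k → ℚ} → (∀ i → f i ≡ g i) → prodFin k f ≡ prodFin k g
prodFin-cong zero    e = refl
prodFin-cong (suc k) e = cong₂ _*_ (e Fin.zero) (prodFin-cong k (λ i → e (Fin.suc i)))

prodFin-* : ∀ k (f g : Fin k → ℚ) → prodFin k (λ i → f i * g i) ≡ prodFin k f * prodFin k g
prodFin-* zero    f g = refl
prodFin-* (suc k) f g = trans (cong (f Fin.zero * g Fin.zero *_) (prodFin-* k _ _))
  (solve 4 (λ a b c d → (a :* b) :* (c :* d) := (a :* c) :* (b :* d)) refl (f Fin.zero) (g Fin.zero) _ _)

prodFin-1 : ∀ k → prodFin k (λ _ → 1ℚ) ≡ 1ℚ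
prodFin-1 zero    = refl
prodFin-1 (suc k) = trans (cong (1ℚ *_) (prodFin-1 k)) (ℚP.*-identityˡ 1ℚ)

prodFin-snoc : ∀ k (f : Fin (suc k) → ℚ) → prodFin (suc k) f ≡ prodFin k (λ i → f (inject₁ i)) * f (fromℕ k)
prodFin-snoc zero    f = trans (ℚP.*-identityʳ (f Fin.zero)) (sym (ℚP.*-identityˡ (f Fin.zero)))
prodFin-snoc (suc k) f = trans (cong (f Fin.zero *_) (prodFin-snoc k (λ i → f (Fin.suc i))))
  (sym (ℚP.*-assoc (f Fin.zero) _ _))

C2-suc : ∀ n → suc n C 2 ≡ n ℕ.+ n C 2
C2-suc n = trans (sym (nCk+nC[k+1]≡[n+1]C[k+1] n 1)) (cong (ℕ._+ n C 2) (nC1≡n n))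

C2-+ : ∀ t d → (t ℕ.+ d) C 2 ≡ t C 2 ℕ.+ d C 2 ℕ.+ t ℕ.* d
C2-+ t zero    rewrite ℕP.+-identityʳ t | ℕP.*-zeroʳ t = sym (trans (ℕP.+-identityʳ _) (ℕP.+-identityʳ _))
C2-+ t (suc d) = begin
  (t ℕ.+ suc d) C 2                               ≡⟨ cong (_C 2) (ℕP.+-suc t d) ⟩
  suc (t ℕ.+ d) C 2                               ≡⟨ C2-suc (t ℕ.+ d) ⟩
  (t ℕ.+ d) ℕ.+ (t ℕ.+ d) C 2                     ≡⟨ cong ((t ℕ.+ d) ℕ.+_) (C2-+ t d) ⟩
  (t ℕ.+ d) ℕ.+ (t C 2 ℕ.+ d C 2 ℕ.+ t ℕ.* d)     ≡⟨ rearrange t d (t C 2) (d C 2) ⟩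
  t C 2 ℕ.+ (d ℕ.+ d C 2) ℕ.+ t ℕ.* suc d         ≡⟨ cong (λ z → t C 2 ℕ.+ z ℕ.+ t ℕ.* suc d) (sym (C2-suc d)) ⟩
  t C 2 ℕ.+ suc d C 2 ℕ.+ t ℕ.* suc d             ∎
  where
  open ℕSolver.+-*-Solver using () renaming (solve to solveℕ; _:+_ to _⊕_; _:*_ to _⊗_; _:=_ to _≐_; con to conℕ)
  rearrange : ∀ t d x y → (t ℕ.+ d) ℕ.+ (x ℕ.+ y ℕ.+ t ℕ.* d) ≡ x ℕ.+ (d ℕ.+ y) ℕ.+ t ℕ.* suc d
  rearrange = solveℕ 4 (λ t d x y → (t ⊕ d) ⊕ (x ⊕ y ⊕ t ⊗ d) ≐ x ⊕ (d ⊕ y) ⊕ t ⊗ (conℕ 1 ⊕ d)) refl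

T⇒≡true : ∀ {b} → T b → b ≡ true
T⇒≡true {true} _ = refl

≡true⇒T : ∀ {b} → b ≡ true → T b
≡true⇒T refl = tt

∧-true⁻ : ∀ {a b} → (a ∧ b) ≡ true → a ≡ true × b ≡ true
∧-true⁻ {true} {true} _ = refl , refl

∧-true⁺ : ∀ {a b} → a ≡ true → b ≡ true → (a ∧ b) ≡ true
∧-true⁺ refl refl = refl

≤ᵇ⇒≤ : ∀ m n → (m ≤ᵇ n) ≡ true → m ≤ n
≤ᵇ⇒≤ m n e = ℕP.≤ᵇ⇒≤ m n (≡true⇒T e)

≤⇒≤ᵇ : ∀ {m n} → m ≤ n → (m ≤ᵇ n) ≡ true
≤⇒≤ᵇ m≤n = T⇒≡true (ℕP.≤⇒≤ᵇ m≤n)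

>⇒≤ᵇ-false : ∀ {m n} → n < m → (m ≤ᵇ n) ≡ false
>⇒≤ᵇ-false {m} {n} n<m with m ≤ᵇ n in e
... | false = refl
... | true  = ⊥-elim (ℕP.<⇒≱ n<m (≤ᵇ⇒≤ m n e))

≡ᵇ⇒≡ : ∀ m n → (m ≡ᵇ n) ≡ true → m ≡ n
≡ᵇ⇒≡ m n e = ℕP.≡ᵇ⇒≡ m n (≡true⇒T e)

≡ᵇ-refl : ∀ m → (m ≡ᵇ m) ≡ true
≡ᵇ-refl m = T⇒≡true (ℕP.≡⇒≡ᵇ m m refl)

≢⇒≡ᵇ-false : ∀ {m n} → m ≢ n → (m ≡ᵇ n) ≡ false
≢⇒≡ᵇ-false {m} {n} m≢n with m ≡ᵇ n in e
... | false = refl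
... | true  = ⊥-elim (m≢n (≡ᵇ⇒≡ m n e))

-- Gaussian binomial coefficients

qbinom-unfold : ∀ x n k → k ≤ n →
  qbinom x n k ≡ ∏upTo k (λ i → (1ℚ + - pow x ((n ∸ k) ℕ.+ suc i)) * inv (1ℚ + - pow x (suc i)))
qbinom-unfold x n k k≤n rewrite ≤⇒≤ᵇ k≤n = prodFin≡∏upTo k _

qbinom-over : ∀ x n k → n < k → qbinom x n k ≡ 0ℚ
qbinom-over x n k n<k rewrite >⇒≤ᵇ-false n<k = refl

qbinom-diag′ : ∀ x k → (∀ i → 1ℚ + - pow x (suc i) ≢ 0ℚ) → qbinom x k k ≡ 1ℚ
qbinom-diag′ x k 1-xⁱ⁺¹≢0 = begin
  qbinom x k k
    ≡⟨ qbinom-unfold x k k ℕP.≤-refl ⟩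
  ∏upTo k (λ i → (1ℚ + - pow x ((k ∸ k) ℕ.+ suc i)) * inv (1ℚ + - pow x (suc i)))
    ≡⟨ ∏upTo-cong k (λ i → trans (cong (λ z → (1ℚ + - pow x (z ℕ.+ suc i)) * inv (1ℚ + - pow x (suc i))) (ℕP.n∸n≡0 k))
                                  (inv-*ʳ _ (1-xⁱ⁺¹≢0 i))) ⟩
  ∏upTo k (λ _ → 1ℚ)
    ≡⟨ ∏upTo-1 k ⟩
  1ℚ ∎

module QBinomial (q q′ : ℚ) (q′q≡1 : q′ * q ≡ 1ℚ) (qⁱ⁺¹≢1 : ∀ i → pow q (suc i) ≢ 1ℚ) where

  q′ⁱ⁺¹≢1 : ∀ i → pow q′ (suc i) ≢ 1ℚ
  q′ⁱ⁺¹≢1 i q′ⁱ⁺¹≡1 = qⁱ⁺¹≢1 i (begin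
    pow q (suc i)                   ≡⟨ sym (ℚP.*-identityˡ _) ⟩
    1ℚ * pow q (suc i)              ≡⟨ cong (_* pow q (suc i)) (sym q′ⁱ⁺¹≡1) ⟩
    pow q′ (suc i) * pow q (suc i)  ≡⟨ pow-inverse q q′ q′q≡1 (suc i) ⟩
    1ℚ                              ∎)

  [_]! : ℕ → ℚ
  [ n ]! = ∏upTo n (λ i → 1ℚ + - pow q (suc i))

  []!-≢0 : ∀ n → [ n ]! ≢ 0ℚ
  []!-≢0 n = ∏upTo-≢0 n _ (λ i → 1-x≢0 _ (qⁱ⁺¹≢1 i))

  []!-+ : ∀ m k → ∏upTo k (λ i → 1ℚ + - pow q (m ℕ.+ suc i)) * [ m ]! ≡ [ m ℕ.+ k ]!
  []!-+ m zero    = trans (ℚP.*-identityˡ _) (cong [_]! (sym (ℕP.+-identityʳ m)))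
  []!-+ m (suc k) = begin
    (∏upTo k f * f k) * [ m ]!  ≡⟨ solve 3 (λ a b c → (a :* b) :* c := (a :* c) :* b) refl (∏upTo k f) (f k) [ m ]! ⟩
    (∏upTo k f * [ m ]!) * f k  ≡⟨ cong (_* f k) ([]!-+ m k) ⟩
    [ m ℕ.+ k ]! * f k          ≡⟨ cong (λ z → [ m ℕ.+ k ]! * (1ℚ + - pow q z)) (ℕP.+-suc m k) ⟩
    [ suc (m ℕ.+ k) ]!          ≡⟨ cong [_]! (sym (ℕP.+-suc m k)) ⟩
    [ m ℕ.+ suc k ]!            ∎
    where
    f : ℕ → ℚ
    f i = 1ℚ + - pow q (m ℕ.+ suc i)

  qbinom-[]! : ∀ n k → k ≤ n → qbinom q n k * ([ k ]! * [ n ∸ k ]!) ≡ [ n ]!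
  qbinom-[]! n k k≤n = begin
    qbinom q n k * ([ k ]! * [ m ]!)                 ≡⟨ cong (_* ([ k ]! * [ m ]!)) (trans (qbinom-unfold q n k k≤n) (∏upTo-* k num den)) ⟩
    (∏upTo k num * ∏upTo k den) * ([ k ]! * [ m ]!)  ≡⟨ solve 4 (λ a b c d → (a :* b) :* (c :* d) := (a :* d) :* (b :* c)) refl (∏upTo k num) (∏upTo k den) [ k ]! [ m ]! ⟩
    (∏upTo k num * [ m ]!) * (∏upTo k den * [ k ]!)  ≡⟨ cong₂ _*_ ([]!-+ m k) den-cancel ⟩
    [ m ℕ.+ k ]! * 1ℚ                                ≡⟨ ℚP.*-identityʳ _ ⟩
    [ m ℕ.+ k ]!                                     ≡⟨ cong [_]! (ℕP.m∸n+n≡m k≤n) ⟩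
    [ n ]!                                           ∎
    where
    m = n ∸ k
    num den : ℕ → ℚ
    num i = 1ℚ + - pow q (m ℕ.+ suc i)
    den i = inv (1ℚ + - pow q (suc i))
    den-cancel : ∏upTo k den * [ k ]! ≡ 1ℚ
    den-cancel = trans (sym (∏upTo-* k den _))
      (trans (∏upTo-cong k (λ i → inv-*ˡ _ (1-x≢0 _ (qⁱ⁺¹≢1 i)))) (∏upTo-1 k))

  qbinom-+-[]! : ∀ k m → qbinom q (k ℕ.+ m) k * ([ k ]! * [ m ]!) ≡ [ k ℕ.+ m ]!
  qbinom-+-[]! k m = trans (cong (λ z → qbinom q (k ℕ.+ m) k * ([ k ]! * [ z ]!)) (sym (ℕP.m+n∸m≡n k m)))
    (qbinom-[]! (k ℕ.+ m) k (ℕP.m≤m+n k m))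

  qbinom-diag : ∀ n → qbinom q n n ≡ 1ℚ
  qbinom-diag n = qbinom-diag′ q n (λ i → 1-x≢0 _ (qⁱ⁺¹≢1 i))

  private
    qbinom-factor-inverse : ∀ m i →
      (1ℚ + - pow q′ (m ℕ.+ suc i)) * inv (1ℚ + - pow q′ (suc i))
        ≡ pow q′ m * ((1ℚ + - pow q (m ℕ.+ suc i)) * inv (1ℚ + - pow q (suc i)))
    qbinom-factor-inverse m i = begin
      (1ℚ + - pow q′ (m ℕ.+ suc i)) * inv (1ℚ + - x′)
        ≡⟨ cong (λ z → (1ℚ + - z) * inv (1ℚ + - x′)) (pow-+ q′ m (suc i)) ⟩
      (1ℚ + - (z′ * x′)) * inv (1ℚ + - x′)
        ≡⟨ *-inv-cross (1ℚ + - (z′ * x′)) (1ℚ + - x′) (z′ * (1ℚ + - (z * x))) (1ℚ + - x) (1-x≢0 _ (q′ⁱ⁺¹≢1 i)) (1-x≢0 _ (qⁱ⁺¹≢1 i)) cross ⟩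
      (z′ * (1ℚ + - (z * x))) * inv (1ℚ + - x)
        ≡⟨ ℚP.*-assoc z′ _ _ ⟩
      z′ * ((1ℚ + - (z * x)) * inv (1ℚ + - x))
        ≡⟨ cong (λ w → z′ * ((1ℚ + - w) * inv (1ℚ + - x))) (sym (pow-+ q m (suc i))) ⟩
      z′ * ((1ℚ + - pow q (m ℕ.+ suc i)) * inv (1ℚ + - x)) ∎
      where
      x  = pow q (suc i)
      x′ = pow q′ (suc i)
      z  = pow q m
      z′ = pow q′ m
      x′x≡1 : x′ * x ≡ 1ℚ
      x′x≡1 = pow-inverse q q′ q′q≡1 (suc i)
      z′z≡1 : z′ * z ≡ 1ℚ
      z′z≡1 = pow-inverse q q′ q′q≡1 m
      cross : (1ℚ + - (z′ * x′)) * (1ℚ + - x) ≡ (z′ * (1ℚ + - (z * x))) * (1ℚ + - x′)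
      cross = begin
        (1ℚ + - (z′ * x′)) * (1ℚ + - x)
          ≡⟨ solve 3 (λ z′ x′ x → (con 1ℚ :+ :- (z′ :* x′)) :* (con 1ℚ :+ :- x) := (con 1ℚ :+ :- x :+ :- (z′ :* x′)) :+ z′ :* (x′ :* x)) refl z′ x′ x ⟩
        (1ℚ + - x + - (z′ * x′)) + z′ * (x′ * x)
          ≡⟨ cong (λ w → (1ℚ + - x + - (z′ * x′)) + z′ * w) x′x≡1 ⟩
        (1ℚ + - x + - (z′ * x′)) + z′ * 1ℚ
          ≡⟨ solve 3 (λ z′ x′ x → (con 1ℚ :+ :- x :+ :- (z′ :* x′)) :+ z′ :* con 1ℚ := (z′ :+ :- (con 1ℚ :* x) :+ :- (z′ :* x′)) :+ con 1ℚ :* con 1ℚ) refl z′ x′ x ⟩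
        (z′ + - (1ℚ * x) + - (z′ * x′)) + 1ℚ * 1ℚ
          ≡⟨ cong₂ (λ a b → (z′ + - (a * x) + - (z′ * x′)) + a * b) (sym z′z≡1) (sym (trans (ℚP.*-comm x x′) x′x≡1)) ⟩
        (z′ + - ((z′ * z) * x) + - (z′ * x′)) + (z′ * z) * (x * x′)
          ≡⟨ solve 4 (λ z′ z x′ x → (z′ :+ :- ((z′ :* z) :* x) :+ :- (z′ :* x′)) :+ (z′ :* z) :* (x :* x′) := (z′ :* (con 1ℚ :+ :- (z :* x))) :* (con 1ℚ :+ :- x′)) refl z′ z x′ x ⟩
        (z′ * (1ℚ + - (z * x))) * (1ℚ + - x′) ∎

  qbinom-inverse : ∀ n k → k ≤ n → qbinom q′ n k ≡ pow (pow q′ (n ∸ k)) k * qbinom q n k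
  qbinom-inverse n k k≤n = begin
    qbinom q′ n k
      ≡⟨ qbinom-unfold q′ n k k≤n ⟩
    ∏upTo k (λ i → (1ℚ + - pow q′ ((n ∸ k) ℕ.+ suc i)) * inv (1ℚ + - pow q′ (suc i)))
      ≡⟨ ∏upTo-cong k (qbinom-factor-inverse (n ∸ k)) ⟩
    ∏upTo k (λ i → pow q′ (n ∸ k) * ((1ℚ + - pow q ((n ∸ k) ℕ.+ suc i)) * inv (1ℚ + - pow q (suc i))))
      ≡⟨ ∏upTo-* k _ _ ⟩
    ∏upTo k (λ _ → pow q′ (n ∸ k)) * ∏upTo k (λ i → (1ℚ + - pow q ((n ∸ k) ℕ.+ suc i)) * inv (1ℚ + - pow q (suc i)))
      ≡⟨ cong₂ _*_ (∏upTo-const k _) (sym (qbinom-unfold q n k k≤n)) ⟩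
    pow (pow q′ (n ∸ k)) k * qbinom q n k ∎

  qbinom-trinomial : ∀ a p d →
    qbinom q (a ℕ.+ p) a * qbinom q ((a ℕ.+ p) ℕ.+ d) (a ℕ.+ p) ≡ qbinom q ((a ℕ.+ p) ℕ.+ d) a * qbinom q (p ℕ.+ d) d
  qbinom-trinomial a p d = *-cancelʳ _ _ facs facs≢0 (begin
    (b₁ * b₂) * facs                                  ≡⟨ solve 5 (λ x y fa fp fd → (x :* y) :* (fa :* (fp :* fd)) := (x :* (fa :* fp)) :* (y :* fd)) refl b₁ b₂ [ a ]! [ p ]! [ d ]! ⟩
    (b₁ * ([ a ]! * [ p ]!)) * (b₂ * [ d ]!)          ≡⟨ cong (_* (b₂ * [ d ]!)) (qbinom-+-[]! a p) ⟩
    [ a ℕ.+ p ]! * (b₂ * [ d ]!)                      ≡⟨ solve 3 (λ x y z → x :* (y :* z) := y :* (x :* z)) refl [ a ℕ.+ p ]! b₂ [ d ]! ⟩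
    b₂ * ([ a ℕ.+ p ]! * [ d ]!)                      ≡⟨ qbinom-+-[]! (a ℕ.+ p) d ⟩
    [ (a ℕ.+ p) ℕ.+ d ]!                              ≡⟨ cong [_]! (ℕP.+-assoc a p d) ⟩
    [ a ℕ.+ (p ℕ.+ d) ]!                              ≡⟨ sym (qbinom-+-[]! a (p ℕ.+ d)) ⟩
    qbinom q (a ℕ.+ (p ℕ.+ d)) a * ([ a ]! * [ p ℕ.+ d ]!)
                                                      ≡⟨ cong (λ z → qbinom q z a * ([ a ]! * [ p ℕ.+ d ]!)) (sym (ℕP.+-assoc a p d)) ⟩
    b₃ * ([ a ]! * [ p ℕ.+ d ]!)                      ≡⟨ cong (λ z → b₃ * ([ a ]! * [ z ]!)) (ℕP.+-comm p d) ⟩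
    b₃ * ([ a ]! * [ d ℕ.+ p ]!)                      ≡⟨ cong (λ z → b₃ * ([ a ]! * z)) (sym (qbinom-+-[]! d p)) ⟩
    b₃ * ([ a ]! * (qbinom q (d ℕ.+ p) d * ([ d ]! * [ p ]!)))
                                                      ≡⟨ cong (λ z → b₃ * ([ a ]! * (qbinom q z d * ([ d ]! * [ p ]!)))) (ℕP.+-comm d p) ⟩
    b₃ * ([ a ]! * (b₄ * ([ d ]! * [ p ]!)))          ≡⟨ solve 5 (λ x y fa fp fd → x :* (fa :* (y :* (fd :* fp))) := (x :* y) :* (fa :* (fp :* fd))) refl b₃ b₄ [ a ]! [ p ]! [ d ]! ⟩
    (b₃ * b₄) * facs                                  ∎)
    where
    facs = [ a ]! * ([ p ]! * [ d ]!)
    facs≢0 = *-≢0 _ _ ([]!-≢0 a) (*-≢0 _ _ ([]!-≢0 p) ([]!-≢0 d))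
    b₁ = qbinom q (a ℕ.+ p) a
    b₂ = qbinom q ((a ℕ.+ p) ℕ.+ d) (a ℕ.+ p)
    b₃ = qbinom q ((a ℕ.+ p) ℕ.+ d) a
    b₄ = qbinom q (p ℕ.+ d) d

  private
    qbinom-pascal-< : ∀ d e → qbinom q (suc (d ℕ.+ suc e)) (suc d) ≡ qbinom q (d ℕ.+ suc e) d + pow q (suc d) * qbinom q (d ℕ.+ suc e) (suc d)
    qbinom-pascal-< d e = *-cancelʳ _ _ facs (*-≢0 _ _ ([]!-≢0 (suc d)) ([]!-≢0 (suc e))) (begin
      qbinom q (suc M) (suc d) * facs
        ≡⟨ qbinom-+-[]! (suc d) (suc e) ⟩
      [ suc M ]!
        ≡⟨ cong (λ z → [ M ]! * (1ℚ + - z)) (pow-+ q (suc d) (suc e)) ⟩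
      [ M ]! * (1ℚ + - (x * y))
        ≡⟨ solve 3 (λ f x y → f :* (con 1ℚ :+ :- (x :* y)) := f :* (con 1ℚ :+ :- x) :+ x :* (f :* (con 1ℚ :+ :- y))) refl [ M ]! x y ⟩
      [ M ]! * (1ℚ + - x) + x * ([ M ]! * (1ℚ + - y))
        ≡⟨ cong₂ (λ u v → u * (1ℚ + - x) + x * (v * (1ℚ + - y))) (sym (qbinom-+-[]! d (suc e))) (sym upper) ⟩
      (b₁ * ([ d ]! * [ suc e ]!)) * (1ℚ + - x) + x * ((b₂ * ([ suc d ]! * [ e ]!)) * (1ℚ + - y))
        ≡⟨ solve 6 (λ b₁ b₂ x y fd fe → (b₁ :* (fd :* (fe :* (con 1ℚ :+ :- y)))) :* (con 1ℚ :+ :- x) :+ x :* ((b₂ :* ((fd :* (con 1ℚ :+ :- x)) :* fe)) :* (con 1ℚ :+ :- y)) := (b₁ :+ x :* b₂) :* ((fd :* (con 1ℚ :+ :- x)) :* (fe :* (con 1ℚ :+ :- y)))) refl b₁ b₂ x y [ d ]! [ e ]! ⟩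
      (b₁ + x * b₂) * facs ∎)
      where
      M = d ℕ.+ suc e
      x = pow q (suc d)
      y = pow q (suc e)
      facs = [ suc d ]! * [ suc e ]!
      b₁ = qbinom q M d
      b₂ = qbinom q M (suc d)
      upper : b₂ * ([ suc d ]! * [ e ]!) ≡ [ M ]!
      upper = begin
        qbinom q M (suc d) * ([ suc d ]! * [ e ]!)             ≡⟨ cong (λ z → qbinom q z (suc d) * ([ suc d ]! * [ e ]!)) (ℕP.+-suc d e) ⟩
        qbinom q (suc d ℕ.+ e) (suc d) * ([ suc d ]! * [ e ]!) ≡⟨ qbinom-+-[]! (suc d) e ⟩
        [ suc d ℕ.+ e ]!                                       ≡⟨ cong [_]! (sym (ℕP.+-suc d e)) ⟩
        [ M ]!                                                 ∎

  qbinom-pascal : ∀ m d → qbinom q (suc m) (suc d) ≡ qbinom q m d + pow q (suc d) * qbinom q m (suc d)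
  qbinom-pascal m d with ℕP.<-cmp d m
  ... | tri< d<m _ _ = subst (λ z → qbinom q (suc z) (suc d) ≡ qbinom q z d + pow q (suc d) * qbinom q z (suc d))
                         (trans (ℕP.+-suc d (m ∸ suc d)) (ℕP.m+[n∸m]≡n d<m)) (qbinom-pascal-< d (m ∸ suc d))
  ... | tri≈ _ refl _ = begin
    qbinom q (suc d) (suc d)                           ≡⟨ qbinom-diag (suc d) ⟩
    1ℚ                                                 ≡⟨ sym (ℚP.+-identityʳ 1ℚ) ⟩
    1ℚ + 0ℚ                                            ≡⟨ cong₂ _+_ (sym (qbinom-diag d)) (sym (ℚP.*-zeroʳ (pow q (suc d)))) ⟩
    qbinom q d d + pow q (suc d) * 0ℚ                  ≡⟨ cong (λ z → qbinom q d d + pow q (suc d) * z) (sym (qbinom-over q d (suc d) (ℕP.n<1+n d))) ⟩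
    qbinom q d d + pow q (suc d) * qbinom q d (suc d)  ∎
  ... | tri> _ _ m<d = begin
    qbinom q (suc m) (suc d)                           ≡⟨ qbinom-over q (suc m) (suc d) (s≤s m<d) ⟩
    0ℚ                                                 ≡⟨ sym (ℚP.*-zeroʳ (pow q (suc d))) ⟩
    pow q (suc d) * 0ℚ                                 ≡⟨ sym (ℚP.+-identityˡ _) ⟩
    0ℚ + pow q (suc d) * 0ℚ                            ≡⟨ cong₂ (λ u v → u + pow q (suc d) * v) (sym (qbinom-over q m d m<d)) (sym (qbinom-over q m (suc d) (ℕP.m<n⇒m<1+n m<d))) ⟩
    qbinom q m d + pow q (suc d) * qbinom q m (suc d)  ∎

  altTerm : ℕ → ℕ → ℚ
  altTerm m d = qbinom q m d * (sgn d * pow q (d C 2))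

  private
    altTerm′ : ℕ → ℕ → ℚ
    altTerm′ m d = qbinom q m d * (sgn d * pow q (suc d C 2))

    altTerm-suc : ∀ m d → altTerm (suc m) (suc d) ≡ - altTerm′ m d + altTerm′ m (suc d)
    altTerm-suc m d = begin
      qbinom q (suc m) (suc d) * ((- 1ℚ * sgn d) * c)
        ≡⟨ cong (_* ((- 1ℚ * sgn d) * c)) (qbinom-pascal m d) ⟩
      (b₁ + x * b₂) * ((- 1ℚ * sgn d) * c)
        ≡⟨ solve 5 (λ b₁ b₂ x s c → (b₁ :+ x :* b₂) :* ((:- con 1ℚ :* s) :* c) := :- (b₁ :* (s :* c)) :+ b₂ :* ((:- con 1ℚ :* s) :* (x :* c))) refl b₁ b₂ x (sgn d) c ⟩
      - (b₁ * (sgn d * c)) + b₂ * ((- 1ℚ * sgn d) * (x * c))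
        ≡⟨ cong (λ z → - (b₁ * (sgn d * c)) + b₂ * ((- 1ℚ * sgn d) * z)) (sym (trans (cong (pow q) (C2-suc (suc d))) (pow-+ q (suc d) (suc d C 2)))) ⟩
      - altTerm′ m d + altTerm′ m (suc d) ∎
      where
      b₁ = qbinom q m d
      b₂ = qbinom q m (suc d)
      x  = pow q (suc d)
      c  = pow q (suc d C 2)

  qbinom-alternating-sum : ∀ m → ∑ (upTo (suc m)) (altTerm m) ≡ when (m ≡ᵇ 0) 1ℚ
  qbinom-alternating-sum zero    = refl
  qbinom-alternating-sum (suc m) = begin
    ∑ (upTo (suc (suc m))) (altTerm (suc m))
      ≡⟨ ∑-upTo-suc (suc m) (altTerm (suc m)) ⟩
    1ℚ + (∑[ d ∈ upTo (suc m) ] altTerm (suc m) (suc d))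
      ≡⟨ cong (1ℚ +_) (∑-cong (upTo (suc m)) (altTerm-suc m)) ⟩
    1ℚ + (∑[ d ∈ upTo (suc m) ] (- altTerm′ m d + altTerm′ m (suc d)))
      ≡⟨ cong (1ℚ +_) (trans (∑-+ (upTo (suc m)) (λ d → - altTerm′ m d) (λ d → altTerm′ m (suc d))) (cong₂ _+_ (∑-neg (upTo (suc m)) (altTerm′ m)) shifted)) ⟩
    1ℚ + (- Σ′ + (Σ′ + - 1ℚ))
      ≡⟨ solve 1 (λ s → con 1ℚ :+ (:- s :+ (s :+ :- con 1ℚ)) := con 0ℚ) refl Σ′ ⟩
    0ℚ ∎
    where
    Σ′ = ∑ (upTo (suc m)) (altTerm′ m)
    shifted : (∑[ d ∈ upTo (suc m) ] altTerm′ m (suc d)) ≡ Σ′ + - 1ℚ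
    shifted = begin
      (∑[ d ∈ upTo (suc m) ] altTerm′ m (suc d))
        ≡⟨ solve 1 (λ a → a := (con 1ℚ :+ a) :+ :- con 1ℚ) refl (∑[ d ∈ upTo (suc m) ] altTerm′ m (suc d)) ⟩
      (1ℚ + (∑[ d ∈ upTo (suc m) ] altTerm′ m (suc d))) + - 1ℚ
        ≡⟨ cong (_+ - 1ℚ) (trans (sym (∑-upTo-suc (suc m) (altTerm′ m))) (∑-upTo-snoc (suc m) (altTerm′ m))) ⟩
      (Σ′ + altTerm′ m (suc m)) + - 1ℚ
        ≡⟨ cong (λ z → (Σ′ + z) + - 1ℚ) (trans (cong (_* (sgn (suc m) * pow q (suc (suc m) C 2))) (qbinom-over q m (suc m) (ℕP.n<1+n m))) (ℚP.*-zeroˡ (sgn (suc m) * pow q (suc (suc m) C 2)))) ⟩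
      (Σ′ + 0ℚ) + - 1ℚ
        ≡⟨ cong (_+ - 1ℚ) (ℚP.+-identityʳ Σ′) ⟩
      Σ′ + - 1ℚ ∎

  orthoTerm : ℕ → ℕ → ℕ → ℚ
  orthoTerm a b t = when ((a ≤ᵇ t) ∧ (t ≤ᵇ b))
    (qbinom q t a * qbinom q′ b t * ((sgn b * sgn t) * (pow q (b C 2) * pow q′ (t C 2))))

  private
    orthoTerm-split : ∀ a p d → orthoTerm a ((a ℕ.+ p) ℕ.+ d) (a ℕ.+ p) ≡ qbinom q ((a ℕ.+ p) ℕ.+ d) a * altTerm (p ℕ.+ d) d
    orthoTerm-split a p d = trans (when-true∧true _ (≤⇒≤ᵇ (ℕP.m≤m+n a p)) (≤⇒≤ᵇ (ℕP.m≤m+n (a ℕ.+ p) d))) (begin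
      A * qbinom q′ b t * ((sgn b * sgn t) * (pow q (b C 2) * ct′))
        ≡⟨ cong₂ (λ u v → A * u * ((v * sgn t) * (pow q (b C 2) * ct′))) inverse (sgn-+ t d) ⟩
      A * (G * B) * ((st * sd * st) * (pow q (b C 2) * ct′))
        ≡⟨ cong (λ u → A * (G * B) * ((st * sd * st) * (u * ct′))) (trans (cong (pow q) (C2-+ t d)) (trans (pow-+ q (t C 2 ℕ.+ d C 2) (t ℕ.* d)) (cong (_* H) (pow-+ q (t C 2) (d C 2))))) ⟩
      A * (G * B) * ((st * sd * st) * ((ct * cd * H) * ct′))
        ≡⟨ solve 9 (λ A B G H st sd ct cd ct′ → A :* (G :* B) :* ((st :* sd :* st) :* ((ct :* cd :* H) :* ct′)) := (A :* B) :* (sd :* cd) :* (G :* H) :* (st :* st) :* (ct′ :* ct)) refl A B G H st sd ct cd ct′ ⟩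
      (A * B) * (sd * cd) * (G * H) * (st * st) * (ct′ * ct)
        ≡⟨ cong₂ (λ u v → u * (sd * cd) * v * (st * st) * (ct′ * ct)) (qbinom-trinomial a p d) GH≡1 ⟩
      (qbinom q b a * qbinom q (p ℕ.+ d) d) * (sd * cd) * 1ℚ * (st * st) * (ct′ * ct)
        ≡⟨ cong₂ (λ u v → (qbinom q b a * qbinom q (p ℕ.+ d) d) * (sd * cd) * 1ℚ * u * v) (sgn-square t) (pow-inverse q q′ q′q≡1 (t C 2)) ⟩
      (qbinom q b a * qbinom q (p ℕ.+ d) d) * (sd * cd) * 1ℚ * 1ℚ * 1ℚ
        ≡⟨ solve 4 (λ x y s c → (x :* y) :* (s :* c) :* con 1ℚ :* con 1ℚ :* con 1ℚ := x :* (y :* (s :* c))) refl (qbinom q b a) (qbinom q (p ℕ.+ d) d) sd cd ⟩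
      qbinom q b a * altTerm (p ℕ.+ d) d ∎)
      where
      t = a ℕ.+ p
      b = t ℕ.+ d
      A = qbinom q t a
      B = qbinom q b t
      st = sgn t
      sd = sgn d
      ct = pow q (t C 2)
      cd = pow q (d C 2)
      ct′ = pow q′ (t C 2)
      G = pow q′ (d ℕ.* t)
      H = pow q (t ℕ.* d)
      inverse : qbinom q′ b t ≡ G * B
      inverse = trans (qbinom-inverse b t (ℕP.m≤m+n t d))
        (trans (cong (λ z → pow (pow q′ z) t * B) (ℕP.m+n∸m≡n t d)) (cong (_* B) (pow-* q′ d t)))
      GH≡1 : G * H ≡ 1ℚ
      GH≡1 = trans (cong (λ z → G * pow q z) (ℕP.*-comm t d)) (pow-inverse q q′ q′q≡1 (d ℕ.* t))

    orthoTerm-reversed : ∀ a m d → d < suc (a ℕ.+ m) → orthoTerm a (a ℕ.+ m) ((a ℕ.+ m) ∸ d) ≡ qbinom q (a ℕ.+ m) a * altTerm m d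
    orthoTerm-reversed a m d d≤a+m with ℕP.≤-<-connex d m
    ... | inj₁ d≤m = subst (λ z → orthoTerm a (a ℕ.+ z) ((a ℕ.+ z) ∸ d) ≡ qbinom q (a ℕ.+ z) a * altTerm z d) (ℕP.m∸n+n≡m d≤m)
                       (split (m ∸ d))
      where
      split : ∀ p → orthoTerm a (a ℕ.+ (p ℕ.+ d)) ((a ℕ.+ (p ℕ.+ d)) ∸ d) ≡ qbinom q (a ℕ.+ (p ℕ.+ d)) a * altTerm (p ℕ.+ d) d
      split p rewrite sym (ℕP.+-assoc a p d) | ℕP.m+n∸n≡m (a ℕ.+ p) d = orthoTerm-split a p d
    ... | inj₂ m<d = begin
      orthoTerm a (a ℕ.+ m) t                 ≡⟨ when-false∧ (t ≤ᵇ (a ℕ.+ m)) (qbinom q t a * qbinom q′ (a ℕ.+ m) t * ((sgn (a ℕ.+ m) * sgn t) * (pow q ((a ℕ.+ m) C 2) * pow q′ (t C 2)))) (>⇒≤ᵇ-false t<a) ⟩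
      0ℚ                                      ≡⟨ sym (ℚP.*-zeroʳ (qbinom q (a ℕ.+ m) a)) ⟩
      qbinom q (a ℕ.+ m) a * 0ℚ               ≡⟨ cong (qbinom q (a ℕ.+ m) a *_) (sym (trans (cong (_* (sgn d * pow q (d C 2))) (qbinom-over q m d m<d)) (ℚP.*-zeroˡ (sgn d * pow q (d C 2))))) ⟩
      qbinom q (a ℕ.+ m) a * altTerm m d      ∎
      where
      t = (a ℕ.+ m) ∸ d
      t<a : t < a
      t<a = subst (t <_) (ℕP.m+n∸n≡m a m) (ℕP.∸-monoʳ-< m<d (ℕP.≤-pred d≤a+m))

    qbinom-orthogonality-≤ : ∀ a m r → a ℕ.+ m ≤ r → ∑ (upTo (suc r)) (orthoTerm a (a ℕ.+ m)) ≡ when (a ≡ᵇ (a ℕ.+ m)) 1ℚ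
    qbinom-orthogonality-≤ a m r b≤r = begin
      ∑ (upTo (suc r)) (orthoTerm a b)                     ≡⟨ cong (λ z → ∑ (upTo (suc z)) (orthoTerm a b)) (sym (ℕP.m+[n∸m]≡n b≤r)) ⟩
      ∑ (upTo (suc b ℕ.+ (r ∸ b))) (orthoTerm a b)         ≡⟨ ∑-upTo-+ (suc b) (r ∸ b) (orthoTerm a b) beyond-b ⟩
      ∑ (upTo (suc b)) (orthoTerm a b)                     ≡⟨ ∑-upTo-reverse b (orthoTerm a b) ⟩
      (∑[ d ∈ upTo (suc b) ] orthoTerm a b (b ∸ d))        ≡⟨ ∑-cong-upTo (suc b) (orthoTerm-reversed a m) ⟩
      (∑[ d ∈ upTo (suc b) ] qbinom q b a * altTerm m d)   ≡⟨ ∑-*ˡ (upTo (suc b)) (qbinom q b a) (altTerm m) ⟩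
      qbinom q b a * ∑ (upTo (suc b)) (altTerm m)          ≡⟨ cong (λ z → qbinom q b a * ∑ (upTo (suc z)) (altTerm m)) (ℕP.+-comm a m) ⟩
      qbinom q b a * ∑ (upTo (suc m ℕ.+ a)) (altTerm m)    ≡⟨ cong (qbinom q b a *_) (∑-upTo-+ (suc m) a (altTerm m) beyond-m) ⟩
      qbinom q b a * ∑ (upTo (suc m)) (altTerm m)          ≡⟨ cong (qbinom q b a *_) (qbinom-alternating-sum m) ⟩
      qbinom q b a * when (m ≡ᵇ 0) 1ℚ                      ≡⟨ diagonal m ⟩
      when (a ≡ᵇ b) 1ℚ                                     ∎
      where
      b = a ℕ.+ m
      beyond-b : ∀ t → suc b ≤ t → orthoTerm a b t ≡ 0ℚ
      beyond-b t b<t = when-∧false (a ≤ᵇ t) (qbinom q t a * qbinom q′ b t * ((sgn b * sgn t) * (pow q (b C 2) * pow q′ (t C 2)))) (>⇒≤ᵇ-false b<t)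
      beyond-m : ∀ d → suc m ≤ d → altTerm m d ≡ 0ℚ
      beyond-m d m<d = trans (cong (_* (sgn d * pow q (d C 2))) (qbinom-over q m d m<d)) (ℚP.*-zeroˡ (sgn d * pow q (d C 2)))
      diagonal : ∀ m → qbinom q (a ℕ.+ m) a * when (m ≡ᵇ 0) 1ℚ ≡ when (a ≡ᵇ (a ℕ.+ m)) 1ℚ
      diagonal zero rewrite ℕP.+-identityʳ a | ≡ᵇ-refl a = trans (ℚP.*-identityʳ _) (qbinom-diag a)
      diagonal (suc m) = trans (ℚP.*-zeroʳ (qbinom q (a ℕ.+ suc m) a))
        (cong (λ c → when c 1ℚ) (sym (≢⇒≡ᵇ-false (λ a≡a+1+m → ℕP.m≢1+m+n a (trans a≡a+1+m (ℕP.+-suc a m))))))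

  qbinom-orthogonality : ∀ a b r → a ≤ r → b ≤ r → ∑ (upTo (suc r)) (orthoTerm a b) ≡ when (a ≡ᵇ b) 1ℚ
  qbinom-orthogonality a b r a≤r b≤r with ℕP.≤-<-connex a b
  ... | inj₁ a≤b = subst (λ z → ∑ (upTo (suc r)) (orthoTerm a z) ≡ when (a ≡ᵇ z) 1ℚ) (ℕP.m+[n∸m]≡n a≤b)
                     (qbinom-orthogonality-≤ a (b ∸ a) r (subst (_≤ r) (sym (ℕP.m+[n∸m]≡n a≤b)) b≤r))
  ... | inj₂ b<a = trans (∑-zero (upTo (suc r)) vanish)
                     (cong (λ c → when c 1ℚ) (sym (≢⇒≡ᵇ-false (λ a≡b → ℕP.<-irrefl (sym a≡b) b<a))))
    where
    vanish : ∀ t → orthoTerm a b t ≡ 0ℚ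
    vanish t = by-cases (a ≤ᵇ t) refl
      where
      v = qbinom q t a * qbinom q′ b t * ((sgn b * sgn t) * (pow q (b C 2) * pow q′ (t C 2)))
      by-cases : ∀ x → (a ≤ᵇ t) ≡ x → orthoTerm a b t ≡ 0ℚ
      by-cases false a≰t = when-false∧ (t ≤ᵇ b) v a≰t
      by-cases true  a≤t = when-∧false (a ≤ᵇ t) v (>⇒≤ᵇ-false (ℕP.<-≤-trans b<a (≤ᵇ⇒≤ a t a≤t)))

-- Chain sums in the incidence algebra of a finite poset

count : ∀ {A : Set} → (A → Bool) → List A → ℕ
count p []       = 0
count p (x ∷ xs) = b2n (p x) ℕ.+ count p xs

count≤length : ∀ {A : Set} (p : A → Bool) xs → count p xs ≤ List.length xs
count≤length p []       = z≤n
count≤length p (x ∷ xs) with p x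
... | true  = s≤s (count≤length p xs)
... | false = ℕP.m≤n⇒m≤1+n (count≤length p xs)

module _ {A : Set} (p q : A → Bool) (p⇒q : ∀ x → p x ≡ true → q x ≡ true) where

  count-mono : ∀ xs → count p xs ≤ count q xs
  count-mono []       = z≤n
  count-mono (x ∷ xs) with p x in px | q x in qx
  ... | true  | true  = s≤s (count-mono xs)
  ... | false | true  = ℕP.m≤n⇒m≤1+n (count-mono xs)
  ... | false | false = count-mono xs
  ... | true  | false with () ← trans (sym (p⇒q x px)) qx

  count-mono-< : ∀ {y} xs → y ∈ xs → p y ≡ false → q y ≡ true → count p xs < count q xs
  count-mono-< (x ∷ xs) (here refl) py qy rewrite py | qy = s≤s (count-mono xs)
  count-mono-< (x ∷ xs) (there y∈xs) py qy with p x in px | q x in qx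
  ... | true  | true  = s≤s (count-mono-< xs y∈xs py qy)
  ... | false | true  = ℕP.m≤n⇒m≤1+n (count-mono-< xs y∈xs py qy)
  ... | false | false = count-mono-< xs y∈xs py qy
  ... | true  | false with () ← trans (sym (p⇒q x px)) qx

-- Chains are taken as arbitrary sequences of elements; the non-increasing ones are
-- killed by weights supported on x <ᵇ y.
module ChainSums {E : Set} (Es : List E) (∈Es : ∀ x → x ∈ Es) (_<ᵇ_ : E → E → Bool)
  (<ᵇ-irrefl : ∀ x → (x <ᵇ x) ≡ false)
  (<ᵇ-trans : ∀ x y z → (x <ᵇ y) ≡ true → (y <ᵇ z) ≡ true → (x <ᵇ z) ≡ true) where

  L : ℕ
  L = List.length Es

  rank : E → ℕ
  rank x = count (_<ᵇ x) Es

  rank≤L : ∀ x → rank x ≤ L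
  rank≤L x = count≤length (_<ᵇ x) Es

  rank-< : ∀ x t → (x <ᵇ t) ≡ true → rank x < rank t
  rank-< x t x<t = count-mono-< (_<ᵇ x) (_<ᵇ t) (λ s s<x → <ᵇ-trans s x t s<x x<t) Es (∈Es x) (<ᵇ-irrefl x) x<t

  Supported : (E → E → ℚ) → Set
  Supported u = ∀ x y → (x <ᵇ y) ≡ false → u x y ≡ 0ℚ

  strict : (E → E → ℚ) → E → E → ℚ
  strict f x y = when (x <ᵇ y) (f x y)

  strict-supported : ∀ f → Supported (strict f)
  strict-supported f x y x≮y = cong (λ b → when b (f x y)) x≮y

  pathWeight : (E → E → ℚ) → List E → ℚ
  pathWeight u []           = 1ℚ
  pathWeight u (x ∷ [])     = 1ℚ
  pathWeight u (x ∷ y ∷ xs) = u x y * pathWeight u (y ∷ xs)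

  pathSumOfLength : (E → E → ℚ) → (E → Bool) → ℕ → E → E → ℚ
  pathSumOfLength u S k x y =
    ∑[ l ∈ listsOfLength k Es ] when (allᵇ S l) (sgn k * pathWeight u (x ∷ l ++ y ∷ []))

  -- Cutting off at length L loses nothing once u is supported (pathSumOfLength-long).
  pathSum : (E → E → ℚ) → (E → Bool) → E → E → ℚ
  pathSum u S x y = ∑[ k ∈ upTo (suc L) ] pathSumOfLength u S k x y

  between : E → E → E → Bool
  between x₀ x₁ t = (x₀ <ᵇ t) ∧ (t <ᵇ x₁)

  pathSumOfLength-suc : ∀ u S k x y →
    pathSumOfLength u S (suc k) x y ≡ - (∑[ t ∈ Es ] when (S t) (u x t * pathSumOfLength u S k t y))
  pathSumOfLength-suc u S k x y = begin
    pathSumOfLength u S (suc k) x y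
      ≡⟨ ∑-concatMap _ Es _ ⟩
    (∑[ t ∈ Es ] ∑[ l ∈ List.map (t ∷_) (listsOfLength k Es) ] when (allᵇ S l) (sgn (suc k) * pathWeight u (x ∷ l ++ y ∷ [])))
      ≡⟨ ∑-cong Es (λ t → ∑-map (t ∷_) (listsOfLength k Es) _) ⟩
    (∑[ t ∈ Es ] ∑[ l ∈ listsOfLength k Es ] when (S t ∧ allᵇ S l) ((- 1ℚ * sgn k) * (u x t * pathWeight u (t ∷ l ++ y ∷ []))))
      ≡⟨ ∑-cong Es (λ t → ∑-cong (listsOfLength k Es) (λ l → peel (S t) (allᵇ S l) (sgn k) (u x t) _)) ⟩
    (∑[ t ∈ Es ] ∑[ l ∈ listsOfLength k Es ] - when (S t) (u x t * when (allᵇ S l) (sgn k * pathWeight u (t ∷ l ++ y ∷ []))))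
      ≡⟨ ∑-cong Es (λ t → trans (∑-neg (listsOfLength k Es) _) (cong -_ (trans (∑-when (listsOfLength k Es) (S t) _) (cong (when (S t)) (∑-*ˡ (listsOfLength k Es) (u x t) _))))) ⟩
    (∑[ t ∈ Es ] - when (S t) (u x t * pathSumOfLength u S k t y))
      ≡⟨ ∑-neg Es _ ⟩
    - (∑[ t ∈ Es ] when (S t) (u x t * pathSumOfLength u S k t y)) ∎
    where
    peel : ∀ b c s a z → when (b ∧ c) ((- 1ℚ * s) * (a * z)) ≡ - when b (a * when c (s * z))
    peel true  true  s a z = solve 3 (λ s a z → (:- con 1ℚ :* s) :* (a :* z) := :- (a :* (s :* z))) refl s a z
    peel true  false s a z = cong -_ (sym (ℚP.*-zeroʳ a))
    peel false c     s a z = refl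

  pathSum-conjugate : ∀ (v z : E → E → ℚ) (c c′ : E → ℚ) → (∀ m → c′ m * c m ≡ 1ℚ) →
    (∀ x y → v x y ≡ (c y * c′ x) * z x y) → ∀ S x y → pathSum v S x y ≡ (c y * c′ x) * pathSum z S x y
  pathSum-conjugate v z c c′ c′c≡1 v≡czc′ S x y =
    trans (∑-cong (upTo (suc L)) (λ k → trans (∑-cong (listsOfLength k Es) (term k)) (∑-*ˡ (listsOfLength k Es) κ _)))
          (∑-*ˡ (upTo (suc L)) κ _)
    where
    κ = c y * c′ x
    -- the inner factors c′ m * c m of consecutive edges cancel
    telescope : ∀ x l → pathWeight v (x ∷ l ++ y ∷ []) ≡ (c y * c′ x) * pathWeight z (x ∷ l ++ y ∷ [])
    telescope x []      = trans (cong (_* 1ℚ) (v≡czc′ x y)) (ℚP.*-assoc (c y * c′ x) (z x y) 1ℚ)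
    telescope x (m ∷ l) = begin
      v x m * pathWeight v (m ∷ l ++ y ∷ [])                 ≡⟨ cong₂ _*_ (v≡czc′ x m) (telescope m l) ⟩
      ((c m * c′ x) * z x m) * ((c y * c′ m) * Z)            ≡⟨ solve 6 (λ cm c′x zz cy c′m Z → ((cm :* c′x) :* zz) :* ((cy :* c′m) :* Z) := ((cy :* c′x) :* (zz :* Z)) :* (c′m :* cm)) refl (c m) (c′ x) (z x m) (c y) (c′ m) Z ⟩
      ((c y * c′ x) * (z x m * Z)) * (c′ m * c m)            ≡⟨ cong (((c y * c′ x) * (z x m * Z)) *_) (c′c≡1 m) ⟩
      ((c y * c′ x) * (z x m * Z)) * 1ℚ                      ≡⟨ ℚP.*-identityʳ _ ⟩
      (c y * c′ x) * pathWeight z (x ∷ m ∷ l ++ y ∷ [])      ∎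
      where Z = pathWeight z (m ∷ l ++ y ∷ [])
    term : ∀ k l → when (allᵇ S l) (sgn k * pathWeight v (x ∷ l ++ y ∷ []))
                 ≡ κ * when (allᵇ S l) (sgn k * pathWeight z (x ∷ l ++ y ∷ []))
    term k l = trans (cong (λ w → when (allᵇ S l) (sgn k * w)) (telescope x l))
      (trans (cong (when (allᵇ S l)) (solve 3 (λ s a b → s :* (a :* b) := a :* (s :* b)) refl (sgn k) κ (pathWeight z (x ∷ l ++ y ∷ []))))
        (sym (*-when (allᵇ S l) κ _)))

  module _ (u : E → E → ℚ) (u-supp : Supported u) (S : E → Bool) where

    ∑-vanishing-above : ∀ x (f : E → ℚ) → (∀ t → (x <ᵇ t) ≡ true → f t ≡ 0ℚ) →
      (∑[ t ∈ Es ] when (S t) (u x t * f t)) ≡ 0ℚ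
    ∑-vanishing-above x f f≡0 = ∑-zero Es term
      where
      term : ∀ t → when (S t) (u x t * f t) ≡ 0ℚ
      term t with x <ᵇ t in x<t
      ... | false = trans (cong (λ a → when (S t) (a * f t)) (u-supp x t x<t))
                      (trans (cong (when (S t)) (ℚP.*-zeroˡ (f t))) (when-0 (S t)))
      ... | true  = trans (cong (λ a → when (S t) (u x t * a)) (f≡0 t x<t))
                      (trans (cong (when (S t)) (ℚP.*-zeroʳ (u x t))) (when-0 (S t)))

    private
      rank-step : ∀ {x t} k → (x <ᵇ t) ≡ true → L < rank x ℕ.+ suc k → L < rank t ℕ.+ k
      rank-step {x} {t} k x<t L<x+k = ℕP.<-≤-trans L<x+k
        (ℕP.≤-trans (ℕP.≤-reflexive (ℕP.+-suc (rank x) k)) (ℕP.+-monoˡ-≤ k (rank-< x t x<t)))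

    pathSumOfLength-long : ∀ k x y → L < rank x ℕ.+ k → pathSumOfLength u S k x y ≡ 0ℚ
    pathSumOfLength-long zero    x y L<x = ⊥-elim (ℕP.<⇒≱ L<x (subst (_≤ L) (sym (ℕP.+-identityʳ (rank x))) (rank≤L x)))
    pathSumOfLength-long (suc k) x y L<x+k = trans (pathSumOfLength-suc u S k x y)
      (cong -_ (∑-vanishing-above x _ (λ t x<t → pathSumOfLength-long k t y (rank-step k x<t L<x+k))))

    pathSumOfLength-supported : ∀ k → Supported (pathSumOfLength u S k)
    pathSumOfLength-supported zero    x y x≮y =
      trans (ℚP.+-identityʳ _) (trans (ℚP.*-identityˡ _) (trans (ℚP.*-identityʳ _) (u-supp x y x≮y)))
    pathSumOfLength-supported (suc k) x y x≮y = trans (pathSumOfLength-suc u S k x y)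
      (cong -_ (∑-vanishing-above x _ (λ t x<t → pathSumOfLength-supported k t y (t≮y t x<t))))
      where
      t≮y : ∀ t → (x <ᵇ t) ≡ true → (t <ᵇ y) ≡ false
      t≮y t x<t with t <ᵇ y in t<y
      ... | false = refl
      ... | true with () ← trans (sym (<ᵇ-trans x t y x<t t<y)) x≮y

    pathSum-supported : Supported (pathSum u S)
    pathSum-supported x y x≮y = ∑-zero (upTo (suc L)) (λ k → pathSumOfLength-supported k x y x≮y)

    pathSum-rec : ∀ x y → pathSum u S x y + (∑[ t ∈ Es ] when (S t) (u x t * pathSum u S t y)) ≡ u x y
    pathSum-rec x y = begin
      pathSum u S x y + R
        ≡⟨ cong (_+ R) (∑-upTo-suc L (λ k → pathSumOfLength u S k x y)) ⟩
      (P₀ + (∑[ k ∈ upTo L ] pathSumOfLength u S (suc k) x y)) + R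
        ≡⟨ cong (λ z → (P₀ + z) + R) (∑-cong (upTo L) (λ k → pathSumOfLength-suc u S k x y)) ⟩
      (P₀ + (∑[ k ∈ upTo L ] - (∑[ t ∈ Es ] when (S t) (u x t * pathSumOfLength u S k t y)))) + R
        ≡⟨ cong (λ z → (P₀ + z) + R) (trans (∑-neg (upTo L) _) (cong -_ (∑-comm (upTo L) Es _))) ⟩
      (P₀ + - (∑[ t ∈ Es ] ∑[ k ∈ upTo L ] when (S t) (u x t * pathSumOfLength u S k t y))) + R
        ≡⟨ cong (λ z → (P₀ + - z) + R) (∑-cong Es resum) ⟩
      (P₀ + - R) + R
        ≡⟨ solve 2 (λ a r → (a :+ :- r) :+ r := a) refl P₀ R ⟩
      P₀
        ≡⟨ trans (ℚP.+-identityʳ _) (trans (ℚP.*-identityˡ _) (ℚP.*-identityʳ _)) ⟩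
      u x y ∎
      where
      P₀ = pathSumOfLength u S 0 x y
      R = ∑[ t ∈ Es ] when (S t) (u x t * pathSum u S t y)
      -- for x < t the longest term, of length L, vanishes since rank t ≥ 1
      drop-last : ∀ t → u x t * (∑[ k ∈ upTo L ] pathSumOfLength u S k t y) ≡ u x t * pathSum u S t y
      drop-last t with x <ᵇ t in x<t
      ... | false rewrite u-supp x t x<t = trans (ℚP.*-zeroˡ (∑[ k ∈ upTo L ] pathSumOfLength u S k t y)) (sym (ℚP.*-zeroˡ (pathSum u S t y)))
      ... | true  = cong (u x t *_) (sym (trans (∑-upTo-snoc L (λ k → pathSumOfLength u S k t y))
                      (trans (cong ((∑[ k ∈ upTo L ] pathSumOfLength u S k t y) +_) (pathSumOfLength-long L t y L<t+L)) (ℚP.+-identityʳ _))))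
        where
        L<t+L : L < rank t ℕ.+ L
        L<t+L = ℕP.<-≤-trans (ℕP.n<1+n L) (ℕP.+-monoˡ-≤ L (ℕP.<-≤-trans (s≤s z≤n) (rank-< x t x<t)))
      resum : ∀ t → (∑[ k ∈ upTo L ] when (S t) (u x t * pathSumOfLength u S k t y)) ≡ when (S t) (u x t * pathSum u S t y)
      resum t = trans (∑-when (upTo L) (S t) _) (cong (when (S t)) (trans (∑-*ˡ (upTo L) (u x t) _) (drop-last t)))

    homogeneous-solution-zero : (f : E → ℚ) → (∀ x → f x + (∑[ t ∈ Es ] when (S t) (u x t * f t)) ≡ 0ℚ) → ∀ x → f x ≡ 0ℚ
    homogeneous-solution-zero f eq x = bounded (suc L) x (ℕP.m≤n+m (suc L) (rank x))
      where
      bounded : ∀ m x → L < rank x ℕ.+ m → f x ≡ 0ℚ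
      bounded zero    x L<x = ⊥-elim (ℕP.<⇒≱ L<x (subst (_≤ L) (sym (ℕP.+-identityʳ (rank x))) (rank≤L x)))
      bounded (suc m) x L<x+m = begin
        f x                                               ≡⟨ sym (ℚP.+-identityʳ (f x)) ⟩
        f x + 0ℚ                                          ≡⟨ cong (f x +_) (sym (∑-vanishing-above x f (λ t x<t → bounded m t (rank-step m x<t L<x+m)))) ⟩
        f x + (∑[ t ∈ Es ] when (S t) (u x t * f t))      ≡⟨ eq x ⟩
        0ℚ                                                ∎

  -- g = pathSum u S (-) x₁ and h = pathSum v Sᶜ (-) x₁ satisfy
  -- f x + ∑[ t ∈ S ] u x t * f t = ± u x x₁ with opposite signs (pathSum-rec, h-equation),
  -- so g + h = 0 by homogeneous-solution-zero.
  module Complement (u v : E → E → ℚ) (u-supp : Supported u) (v-supp : Supported v)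
    (inverse : ∀ x y → (x <ᵇ y) ≡ true → v x y + (∑[ t ∈ Es ] u x t * v t y) ≡ - u x y)
    (x₀ x₁ : E) (x₀-least : ∀ t → x₀ ≡ t ⊎ (x₀ <ᵇ t) ≡ true) (S : E → Bool) where

    Sᶜ : E → Bool
    Sᶜ t = between x₀ x₁ t ∧ not (S t)

    ∑-u-v : ∀ x y → (∑[ t ∈ Es ] u x t * v t y) ≡ - u x y + - v x y
    ∑-u-v x y = begin
      (∑[ t ∈ Es ] u x t * v t y)                  ≡⟨ solve 2 (λ a b → a := (b :+ a) :+ :- b) refl _ (v x y) ⟩
      (v x y + (∑[ t ∈ Es ] u x t * v t y)) + - v x y ≡⟨ cong (_+ - v x y) (inverse-all x y) ⟩
      - u x y + - v x y                              ∎
      where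
      inverse-all : ∀ x y → v x y + (∑[ t ∈ Es ] u x t * v t y) ≡ - u x y
      inverse-all x y with x <ᵇ y in x<y
      ... | true  = inverse x y x<y
      ... | false rewrite u-supp x y x<y | v-supp x y x<y = trans (ℚP.+-identityˡ _) (∑-zero Es term)
        where
        term : ∀ t → u x t * v t y ≡ 0ℚ
        term t with x <ᵇ t in x<t | t <ᵇ y in t<y
        ... | false | _     rewrite u-supp x t x<t = ℚP.*-zeroˡ (v t y)
        ... | true  | false rewrite v-supp t y t<y = ℚP.*-zeroʳ (u x t)
        ... | true  | true  with () ← trans (sym (<ᵇ-trans x t y x<t t<y)) x<y

    h : E → ℚ
    h x = pathSum v Sᶜ x x₁

    ∑-u-h : ∀ x → (∑[ t ∈ Es ] u x t * h t) ≡ (- u x x₁ + - v x x₁) + (∑[ s ∈ Es ] when (Sᶜ s) ((u x s + v x s) * h s))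
    ∑-u-h x = begin
      (∑[ t ∈ Es ] u x t * h t)
        ≡⟨ ∑-cong Es (λ t → trans (cong (u x t *_) (h-rec t)) (solve 3 (λ a b c → a :* (b :+ :- c) := a :* b :+ :- (a :* c)) refl (u x t) (v t x₁) (H t))) ⟩
      (∑[ t ∈ Es ] (u x t * v t x₁ + - (u x t * H t)))
        ≡⟨ trans (∑-+ Es _ _) (cong ((∑[ t ∈ Es ] u x t * v t x₁) +_) (∑-neg Es _)) ⟩
      (∑[ t ∈ Es ] u x t * v t x₁) + - (∑[ t ∈ Es ] u x t * H t)
        ≡⟨ cong₂ (λ a b → a + - b) (∑-u-v x x₁) ∑-u-H ⟩
      (- u x x₁ + - v x x₁) + - (∑[ s ∈ Es ] when (Sᶜ s) ((- u x s + - v x s) * h s))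
        ≡⟨ cong ((- u x x₁ + - v x x₁) +_) (trans (sym (∑-neg Es _)) (∑-cong Es (λ s → trans (sym (when-neg (Sᶜ s) _))
             (cong (when (Sᶜ s)) (solve 3 (λ a b c → :- ((:- a :+ :- b) :* c) := (a :+ b) :* c) refl (u x s) (v x s) (h s)))))) ⟩
      (- u x x₁ + - v x x₁) + (∑[ s ∈ Es ] when (Sᶜ s) ((u x s + v x s) * h s)) ∎
      where
      H : E → ℚ
      H t = ∑[ s ∈ Es ] when (Sᶜ s) (v t s * h s)
      h-rec : ∀ t → h t ≡ v t x₁ + - H t
      h-rec t = begin
        h t                  ≡⟨ solve 2 (λ a b → a := (a :+ b) :+ :- b) refl (h t) (H t) ⟩
        (h t + H t) + - H t  ≡⟨ cong (_+ - H t) (pathSum-rec v v-supp Sᶜ t x₁) ⟩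
        v t x₁ + - H t       ∎
      ∑-u-H : (∑[ t ∈ Es ] u x t * H t) ≡ (∑[ s ∈ Es ] when (Sᶜ s) ((- u x s + - v x s) * h s))
      ∑-u-H = begin
        (∑[ t ∈ Es ] u x t * H t)
          ≡⟨ ∑-cong Es (λ t → trans (sym (∑-*ˡ Es (u x t) _)) (∑-cong Es (λ s → *-when (Sᶜ s) (u x t) _))) ⟩
        (∑[ t ∈ Es ] ∑[ s ∈ Es ] when (Sᶜ s) (u x t * (v t s * h s)))
          ≡⟨ ∑-comm Es Es _ ⟩
        (∑[ s ∈ Es ] ∑[ t ∈ Es ] when (Sᶜ s) (u x t * (v t s * h s)))
          ≡⟨ ∑-cong Es (λ s → trans (∑-when Es (Sᶜ s) _) (cong (when (Sᶜ s))
               (trans (∑-cong Es (λ t → sym (ℚP.*-assoc (u x t) (v t s) (h s)))) (∑-*ʳ Es (h s) _)))) ⟩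
        (∑[ s ∈ Es ] when (Sᶜ s) ((∑[ t ∈ Es ] u x t * v t s) * h s))
          ≡⟨ ∑-cong Es (λ s → cong (λ z → when (Sᶜ s) (z * h s)) (∑-u-v x s)) ⟩
        (∑[ s ∈ Es ] when (Sᶜ s) ((- u x s + - v x s) * h s)) ∎

    x₀<-above : ∀ {x t} → (x <ᵇ t) ≡ true → (x₀ <ᵇ t) ≡ true
    x₀<-above {x} {t} x<t with x₀-least t | x₀-least x
    ... | inj₂ x₀<t | _         = x₀<t
    ... | inj₁ refl | inj₁ refl = x<t
    ... | inj₁ refl | inj₂ x₀<x with () ← trans (sym (<ᵇ-trans x₀ x x₀ x₀<x x<t)) (<ᵇ-irrefl x₀)

    -- A term u x t * h t survives only for x < t < x₁, and then t is in exactly one of S, Sᶜ.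
    vanishes-or-complementary : ∀ x t → (u x t * h t ≡ 0ℚ) ⊎ (Sᶜ t ≡ not (S t))
    vanishes-or-complementary x t with x <ᵇ t in x<t
    ... | false = inj₁ (trans (cong (_* h t) (u-supp x t x<t)) (ℚP.*-zeroˡ (h t)))
    ... | true  = by-cases (t <ᵇ x₁) refl
      where
      by-cases : ∀ b → (t <ᵇ x₁) ≡ b → (u x t * h t ≡ 0ℚ) ⊎ (Sᶜ t ≡ not (S t))
      by-cases false t≮x₁ = inj₁ (trans (cong (u x t *_) (pathSum-supported v v-supp Sᶜ t x₁ t≮x₁)) (ℚP.*-zeroʳ (u x t)))
      by-cases true  t<x₁ = inj₂ (cong₂ (λ a b → (a ∧ b) ∧ not (S t)) (x₀<-above x<t) t<x₁)

    split-S-Sᶜ : ∀ x t → u x t * h t ≡ when (S t) (u x t * h t) + when (Sᶜ t) (u x t * h t)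
    split-S-Sᶜ x t = split (S t) (Sᶜ t) (u x t * h t) (vanishes-or-complementary x t)
      where
      split : ∀ a b z → (z ≡ 0ℚ) ⊎ (b ≡ not a) → z ≡ when a z + when b z
      split a     b      z (inj₁ refl) = sym (cong₂ _+_ (when-0 a) (when-0 b))
      split true  .false z (inj₂ refl) = sym (ℚP.+-identityʳ z)
      split false .true  z (inj₂ refl) = sym (ℚP.+-identityˡ z)

    h-equation : ∀ x → h x + (∑[ t ∈ Es ] when (S t) (u x t * h t)) ≡ - u x x₁
    h-equation x = begin
      h x + A                                                ≡⟨ solve 4 (λ hx a b c → hx :+ a := ((hx :+ c) :+ (a :+ b)) :+ :- c :+ :- b) refl (h x) A B C ⟩
      ((h x + C) + (A + B)) + - C + - B                      ≡⟨ cong₂ (λ p q → (p + q) + - C + - B) (pathSum-rec v v-supp Sᶜ x x₁) A+B ⟩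
      (v x x₁ + ((- u x x₁ + - v x x₁) + (B + C))) + - C + - B ≡⟨ solve 4 (λ v₁ u₁ b c → (v₁ :+ ((:- u₁ :+ :- v₁) :+ (b :+ c))) :+ :- c :+ :- b := :- u₁) refl (v x x₁) (u x x₁) B C ⟩
      - u x x₁                                               ∎
      where
      A = ∑[ t ∈ Es ] when (S t) (u x t * h t)
      B = ∑[ t ∈ Es ] when (Sᶜ t) (u x t * h t)
      C = ∑[ t ∈ Es ] when (Sᶜ t) (v x t * h t)
      A+B : A + B ≡ (- u x x₁ + - v x x₁) + (B + C)
      A+B = begin
        A + B                                                ≡⟨ sym (∑-+ Es _ _) ⟩
        (∑[ t ∈ Es ] (when (S t) (u x t * h t) + when (Sᶜ t) (u x t * h t))) ≡⟨ sym (∑-cong Es (split-S-Sᶜ x)) ⟩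
        (∑[ t ∈ Es ] u x t * h t)                            ≡⟨ ∑-u-h x ⟩
        (- u x x₁ + - v x x₁) + (∑[ s ∈ Es ] when (Sᶜ s) ((u x s + v x s) * h s))
          ≡⟨ cong ((- u x x₁ + - v x x₁) +_) (trans (∑-cong Es (λ s → trans (cong (when (Sᶜ s)) (ℚP.*-distribʳ-+ (h s) (u x s) (v x s))) (when-+ (Sᶜ s) _ _))) (∑-+ Es _ _)) ⟩
        (- u x x₁ + - v x x₁) + (B + C)                      ∎

    pathSum-complement : pathSum u S x₀ x₁ + pathSum v Sᶜ x₀ x₁ ≡ 0ℚ
    pathSum-complement = homogeneous-solution-zero u u-supp S f f-equation x₀
      where
      g : E → ℚ
      g x = pathSum u S x x₁
      f : E → ℚ
      f x = g x + h x
      f-equation : ∀ x → f x + (∑[ t ∈ Es ] when (S t) (u x t * f t)) ≡ 0ℚ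
      f-equation x = begin
        f x + (∑[ t ∈ Es ] when (S t) (u x t * f t))
          ≡⟨ cong (f x +_) (trans (∑-cong Es (λ t → trans (cong (when (S t)) (ℚP.*-distribˡ-+ (u x t) (g t) (h t))) (when-+ (S t) _ _))) (∑-+ Es _ _)) ⟩
        (g x + h x) + (Σg + Σh)
          ≡⟨ solve 4 (λ a b c d → (a :+ b) :+ (c :+ d) := (a :+ c) :+ (b :+ d)) refl (g x) (h x) Σg Σh ⟩
        (g x + Σg) + (h x + Σh)
          ≡⟨ cong₂ _+_ (pathSum-rec u u-supp S x x₁) (h-equation x) ⟩
        u x x₁ + - u x x₁
          ≡⟨ ℚP.+-inverseʳ (u x x₁) ⟩
        0ℚ ∎
        where
        Σg = ∑[ t ∈ Es ] when (S t) (u x t * g t)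
        Σh = ∑[ t ∈ Es ] when (S t) (u x t * h t)

-- The order on P_{n,r} and on products

allLeᵇ-refl : ∀ {m} (v : Vec ℕ m) → allLeᵇ v v ≡ true
allLeᵇ-refl []      = refl
allLeᵇ-refl (x ∷ v) = ∧-true⁺ (≤⇒≤ᵇ (ℕP.≤-refl {x})) (allLeᵇ-refl v)

allLeᵇ-trans : ∀ {m} (u v w : Vec ℕ m) → allLeᵇ u v ≡ true → allLeᵇ v w ≡ true → allLeᵇ u w ≡ true
allLeᵇ-trans []      []      []      _ _ = refl
allLeᵇ-trans (x ∷ u) (y ∷ v) (z ∷ w) uv vw with ∧-true⁻ {x ≤ᵇ y} uv | ∧-true⁻ {y ≤ᵇ z} vw
... | x≤y , u≤v | y≤z , v≤w = ∧-true⁺ (≤⇒≤ᵇ (ℕP.≤-trans (≤ᵇ⇒≤ x y x≤y) (≤ᵇ⇒≤ y z y≤z))) (allLeᵇ-trans u v w u≤v v≤w)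

allLeᵇ-antisym : ∀ {m} (u v : Vec ℕ m) → allLeᵇ u v ≡ true → allLeᵇ v u ≡ true → u ≡ v
allLeᵇ-antisym []      []      _ _ = refl
allLeᵇ-antisym (x ∷ u) (y ∷ v) uv vu with ∧-true⁻ {x ≤ᵇ y} uv | ∧-true⁻ {y ≤ᵇ x} vu
... | x≤y , u≤v | y≤x , v≤u = cong₂ _∷_ (ℕP.≤-antisym (≤ᵇ⇒≤ x y x≤y) (≤ᵇ⇒≤ y x y≤x)) (allLeᵇ-antisym u v u≤v v≤u)

allEqᵇ-refl : ∀ {m} (v : Vec ℕ m) → allEqᵇ v v ≡ true
allEqᵇ-refl []      = refl
allEqᵇ-refl (x ∷ v) = ∧-true⁺ (≡ᵇ-refl x) (allEqᵇ-refl v)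

allEqᵇ⇒≡ : ∀ {m} (u v : Vec ℕ m) → allEqᵇ u v ≡ true → u ≡ v
allEqᵇ⇒≡ []      []      _ = refl
allEqᵇ⇒≡ (x ∷ u) (y ∷ v) e with ∧-true⁻ {x ≡ᵇ y} e
... | x≡y , u≡v = cong₂ _∷_ (≡ᵇ⇒≡ x y x≡y) (allEqᵇ⇒≡ u v u≡v)

map-injective : ∀ {A B : Set} {f : A → B} → (∀ {a b} → f a ≡ f b → a ≡ b) →
  ∀ {m} {u v : Vec A m} → Vec.map f u ≡ Vec.map f v → u ≡ v
map-injective f-inj {u = []}    {[]}    _ = refl
map-injective f-inj {u = x ∷ u} {y ∷ v} e = cong₂ _∷_ (f-inj (cong Vec.head e)) (map-injective f-inj (cong Vec.tail e))

psums-injective : ∀ {m} (u v : Vec ℕ m) → psums u ≡ psums v → u ≡ v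
psums-injective []      []      _ = refl
psums-injective (x ∷ u) (y ∷ v) e with cong Vec.head e
... | refl = cong (x ∷_) (psums-injective u v (map-injective (ℕP.+-cancelˡ-≡ x _ _) (cong Vec.tail e)))

digits-injective : ∀ {n r} (a b : P n r) → digits a ≡ digits b → a ≡ b
digits-injective (a₀ , u) (b₀ , v) e =
  cong₂ _,_ (FinP.toℕ-injective (cong Vec.head e)) (map-injective b2n-injective (cong Vec.tail e))
  where
  b2n-injective : ∀ {a b} → b2n a ≡ b2n b → a ≡ b
  b2n-injective {true}  {true}  _ = refl
  b2n-injective {false} {false} _ = refl

leP-refl : ∀ {n r} (a : P n r) → leP a a ≡ true
leP-refl a = allLeᵇ-refl (psums (digits a))

leP-trans : ∀ {n r} (a b c : P n r) → leP a b ≡ true → leP b c ≡ true → leP a c ≡ true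
leP-trans a b c = allLeᵇ-trans (psums (digits a)) (psums (digits b)) (psums (digits c))

leP-antisym : ∀ {n r} (a b : P n r) → leP a b ≡ true → leP b a ≡ true → a ≡ b
leP-antisym a b ab ba = digits-injective a b (psums-injective _ _ (allLeᵇ-antisym (psums (digits a)) (psums (digits b)) ab ba))

eqP⇒≡ : ∀ {n r} (a b : P n r) → eqP a b ≡ true → a ≡ b
eqP⇒≡ a b e = digits-injective a b (allEqᵇ⇒≡ (digits a) (digits b) e)

eqP-refl : ∀ {n r} (a : P n r) → eqP a a ≡ true
eqP-refl a = allEqᵇ-refl (digits a)

psums-replicate-0 : ∀ m → psums (Vec.replicate m 0) ≡ Vec.replicate m 0
psums-replicate-0 zero    = refl
psums-replicate-0 (suc m) = cong (0 ∷_) (trans (VecP.map-id _) (psums-replicate-0 m))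

psums-digits-zeroP : ∀ {n r} → psums (digits (zeroP {n} {r})) ≡ Vec.replicate (suc n) 0
psums-digits-zeroP {n} = trans (cong (λ v → psums (0 ∷ v)) (VecP.map-replicate b2n false n)) (psums-replicate-0 (suc n))

leP-zeroP : ∀ {n r} (a : P n r) → leP zeroP a ≡ true
leP-zeroP {n} {r} a = subst (λ v → allLeᵇ v (psums (digits a)) ≡ true)
  (sym (psums-digits-zeroP {n} {r})) (allLeᵇ-zero (psums (digits a)))
  where
  allLeᵇ-zero : ∀ {m} (v : Vec ℕ m) → allLeᵇ (Vec.replicate m 0) v ≡ true
  allLeᵇ-zero []      = refl
  allLeᵇ-zero (x ∷ v) = ∧-true⁺ (≤⇒≤ᵇ (z≤n {x})) (allLeᵇ-zero v)

leE-refl : ∀ {g} {ns rs : Vec ℕ g} (a : Elt ns rs) → leE a a ≡ true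
leE-refl {ns = []}    {[]}    _        = refl
leE-refl {ns = _ ∷ _} {_ ∷ _} (a , as) = ∧-true⁺ (leP-refl a) (leE-refl as)

leE-trans : ∀ {g} {ns rs : Vec ℕ g} (a b c : Elt ns rs) → leE a b ≡ true → leE b c ≡ true → leE a c ≡ true
leE-trans {ns = []}    {[]}    _ _ _ _ _ = refl
leE-trans {ns = _ ∷ _} {_ ∷ _} (a , as) (b , bs) (c , cs) ab bc with ∧-true⁻ {leP a b} ab | ∧-true⁻ {leP b c} bc
... | a≤b , as≤bs | b≤c , bs≤cs = ∧-true⁺ (leP-trans a b c a≤b b≤c) (leE-trans as bs cs as≤bs bs≤cs)

leE-antisym : ∀ {g} {ns rs : Vec ℕ g} (a b : Elt ns rs) → leE a b ≡ true → leE b a ≡ true → a ≡ b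
leE-antisym {ns = []}    {[]}    tt tt _ _ = refl
leE-antisym {ns = _ ∷ _} {_ ∷ _} (a , as) (b , bs) ab ba with ∧-true⁻ {leP a b} ab | ∧-true⁻ {leP b a} ba
... | a≤b , as≤bs | b≤a , bs≤as = cong₂ _,_ (leP-antisym a b a≤b b≤a) (leE-antisym as bs as≤bs bs≤as)

eqE⇒≡ : ∀ {g} {ns rs : Vec ℕ g} (a b : Elt ns rs) → eqE a b ≡ true → a ≡ b
eqE⇒≡ {ns = []}    {[]}    tt tt _ = refl
eqE⇒≡ {ns = _ ∷ _} {_ ∷ _} (a , as) (b , bs) e with ∧-true⁻ {eqP a b} e
... | a≡b , as≡bs = cong₂ _,_ (eqP⇒≡ a b a≡b) (eqE⇒≡ as bs as≡bs)

eqE-refl : ∀ {g} {ns rs : Vec ℕ g} (a : Elt ns rs) → eqE a a ≡ true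
eqE-refl {ns = []}    {[]}    _        = refl
eqE-refl {ns = _ ∷ _} {_ ∷ _} (a , as) = ∧-true⁺ (eqP-refl a) (eqE-refl as)

eqE-sym : ∀ {g} {ns rs : Vec ℕ g} (a b : Elt ns rs) → eqE a b ≡ eqE b a
eqE-sym a b with eqE a b in ab | eqE b a in ba
... | true  | true  = refl
... | false | false = refl
... | true  | false rewrite eqE⇒≡ a b ab = trans (sym (eqE-refl b)) ba
... | false | true  rewrite eqE⇒≡ b a ba = trans (sym ab) (eqE-refl a)

leE-bot : ∀ {g} {ns rs : Vec ℕ g} (a : Elt ns rs) → leE bot a ≡ true
leE-bot {ns = []}    {[]}    _        = refl
leE-bot {ns = _ ∷ _} {_ ∷ _} (a , as) = ∧-true⁺ (leP-zeroP a) (leE-bot as)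

module _ {g} {ns rs : Vec ℕ g} where

  ltE-irrefl : (a : Elt ns rs) → ltE a a ≡ false
  ltE-irrefl a rewrite leE-refl a | eqE-refl a = refl

  ltE⇒leE : (a b : Elt ns rs) → ltE a b ≡ true → leE a b ≡ true
  ltE⇒leE a b a<b = proj₁ (∧-true⁻ {leE a b} a<b)

  ltE⇒≢ : (a b : Elt ns rs) → ltE a b ≡ true → a ≢ b
  ltE⇒≢ a .a a<a refl with () ← trans (sym a<a) (ltE-irrefl a)

  leE∧≢⇒ltE : (a b : Elt ns rs) → leE a b ≡ true → a ≢ b → ltE a b ≡ true
  leE∧≢⇒ltE a b a≤b a≢b with eqE a b in a≡b
  ... | true  = ⊥-elim (a≢b (eqE⇒≡ a b a≡b))
  ... | false rewrite a≤b = refl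

  ltE-trans : (a b c : Elt ns rs) → ltE a b ≡ true → ltE b c ≡ true → ltE a c ≡ true
  ltE-trans a b c a<b b<c = leE∧≢⇒ltE a c (leE-trans a b c (ltE⇒leE a b a<b) (ltE⇒leE b c b<c)) a≢c
    where
    a≢c : a ≢ c
    a≢c refl = ltE⇒≢ a b a<b (leE-antisym a b (ltE⇒leE a b a<b) (ltE⇒leE b a b<c))

  bot-least : (a : Elt ns rs) → bot ≡ a ⊎ ltE bot a ≡ true
  bot-least a with eqE bot a in bot≡a
  ... | true  = inj₁ (eqE⇒≡ bot a bot≡a)
  ... | false rewrite leE-bot a = inj₂ refl

pairs : ∀ {A B : Set} → List A → List B → List (A × B)
pairs xs ys = concatMap (λ a → List.map (λ b → (a , b)) ys) xs

∑-pairs : ∀ {A B : Set} (xs : List A) (ys : List B) (f : A × B → ℚ) →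
  ∑ (pairs xs ys) f ≡ ∑[ a ∈ xs ] ∑[ b ∈ ys ] f (a , b)
∑-pairs xs ys f = trans (∑-concatMap _ xs f) (∑-cong xs (λ a → ∑-map _ ys f))

∈-pairs : ∀ {A B : Set} {a : A} {b : B} {xs ys} → a ∈ xs → b ∈ ys → (a , b) ∈ pairs xs ys
∈-pairs {a = a} {b} {xs} {ys} a∈xs b∈ys =
  ∈-concatMap⁺ (λ c → List.map (λ d → (c , d)) ys) (Any.map (λ { refl → ∈-map⁺ (λ d → (a , d)) b∈ys }) a∈xs)

∈-allBoolVecs : ∀ {n} (v : Vec Bool n) → v ∈ allBoolVecs n
∈-allBoolVecs []          = here refl
∈-allBoolVecs (false ∷ v) = ∈-concatMap⁺ (λ u → (false ∷ u) ∷ (true ∷ u) ∷ []) (Any.map (λ { refl → here refl }) (∈-allBoolVecs v))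
∈-allBoolVecs (true ∷ v)  = ∈-concatMap⁺ (λ u → (false ∷ u) ∷ (true ∷ u) ∷ []) (Any.map (λ { refl → there (here refl) }) (∈-allBoolVecs v))

∈-allE : ∀ {g} {ns rs : Vec ℕ g} (x : Elt ns rs) → x ∈ allE ns rs
∈-allE {ns = []}    {[]}    tt                      = here refl
∈-allE {ns = _ ∷ _} {_ ∷ _} ((a₀ , v) , as) = ∈-pairs (∈-pairs (∈-allFin a₀) (∈-allBoolVecs v)) (∈-allE as)

∑-tabulate : ∀ {A : Set} m (h : Fin m → A) (f : A → ℚ) → ∑ (tabulate h) f ≡ ∑[ i ∈ allFin m ] f (h i)
∑-tabulate zero    h f = refl
∑-tabulate (suc m) h f = cong (f (h Fin.zero) +_)
  (trans (∑-tabulate m (λ i → h (Fin.suc i)) f) (sym (∑-tabulate m Fin.suc (λ i → f (h i)))))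

∑-allFin-toℕ : ∀ m (f : ℕ → ℚ) → (∑[ i ∈ allFin m ] f (toℕ i)) ≡ ∑ (upTo m) f
∑-allFin-toℕ zero    f = refl
∑-allFin-toℕ (suc m) f = trans (cong (f 0 +_) (trans (∑-tabulate m Fin.suc (λ i → f (toℕ i))) (∑-allFin-toℕ m (λ k → f (suc k)))))
  (sym (∑-upTo-suc m f))

∑-when-≡ᵇ : ∀ m (a : Fin m) (f : Fin m → ℚ) → (∑[ t ∈ allFin m ] when (toℕ a ≡ᵇ toℕ t) (f t)) ≡ f a
∑-when-≡ᵇ (suc m) Fin.zero    f = trans (cong (f Fin.zero +_) (trans (∑-tabulate m Fin.suc _) (∑-zero (allFin m) (λ _ → refl)))) (ℚP.+-identityʳ _)
∑-when-≡ᵇ (suc m) (Fin.suc a) f = trans (ℚP.+-identityˡ _) (trans (∑-tabulate m Fin.suc _) (∑-when-≡ᵇ m a (λ i → f (Fin.suc i))))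

∑-when-allEqᵇ : ∀ n (v : Vec Bool n) (f : Vec Bool n → ℚ) →
  (∑[ t ∈ allBoolVecs n ] when (allEqᵇ (Vec.map b2n v) (Vec.map b2n t)) (f t)) ≡ f v
∑-when-allEqᵇ zero    []          f = ℚP.+-identityʳ _
∑-when-allEqᵇ (suc n) (false ∷ v) f = trans (∑-concatMap _ (allBoolVecs n) _)
  (trans (∑-cong (allBoolVecs n) (λ u → trans (cong (when (allEqᵇ (Vec.map b2n v) (Vec.map b2n u)) (f (false ∷ u)) +_) (ℚP.+-identityʳ 0ℚ)) (ℚP.+-identityʳ _)))
    (∑-when-allEqᵇ n v (λ u → f (false ∷ u))))
∑-when-allEqᵇ (suc n) (true ∷ v)  f = trans (∑-concatMap _ (allBoolVecs n) _)
  (trans (∑-cong (allBoolVecs n) (λ u → trans (ℚP.+-identityˡ _) (ℚP.+-identityʳ _)))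
    (∑-when-allEqᵇ n v (λ u → f (true ∷ u))))

∑-when-eqP : ∀ {n r} (a : P n r) (f : P n r → ℚ) → (∑[ t ∈ allP n r ] when (eqP a t) (f t)) ≡ f a
∑-when-eqP {n} {r} (a₀ , va) f = begin
  (∑[ t ∈ allP n r ] when (eqP (a₀ , va) t) (f t))
    ≡⟨ ∑-pairs (allFin (suc r)) (allBoolVecs n) _ ⟩
  (∑[ t₀ ∈ allFin (suc r) ] ∑[ vt ∈ allBoolVecs n ] when (eqP (a₀ , va) (t₀ , vt)) (f (t₀ , vt)))
    ≡⟨ ∑-cong (allFin (suc r)) (λ t₀ → trans (∑-cong (allBoolVecs n) (λ vt → when-∧ (toℕ a₀ ≡ᵇ toℕ t₀) _ _)) (∑-when (allBoolVecs n) (toℕ a₀ ≡ᵇ toℕ t₀) _)) ⟩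
  (∑[ t₀ ∈ allFin (suc r) ] when (toℕ a₀ ≡ᵇ toℕ t₀) (∑[ vt ∈ allBoolVecs n ] when (allEqᵇ (Vec.map b2n va) (Vec.map b2n vt)) (f (t₀ , vt))))
    ≡⟨ ∑-cong (allFin (suc r)) (λ t₀ → cong (when (toℕ a₀ ≡ᵇ toℕ t₀)) (∑-when-allEqᵇ n va (λ vt → f (t₀ , vt)))) ⟩
  (∑[ t₀ ∈ allFin (suc r) ] when (toℕ a₀ ≡ᵇ toℕ t₀) (f (t₀ , va)))
    ≡⟨ ∑-when-≡ᵇ (suc r) a₀ (λ t₀ → f (t₀ , va)) ⟩
  f (a₀ , va) ∎

∑-when-eqE : ∀ {g} {ns rs : Vec ℕ g} (x : Elt ns rs) (f : Elt ns rs → ℚ) → (∑[ t ∈ allE ns rs ] when (eqE x t) (f t)) ≡ f x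
∑-when-eqE {ns = []}     {[]}     tt       f = ℚP.+-identityʳ _
∑-when-eqE {ns = n ∷ ns} {r ∷ rs} (a , as) f = begin
  (∑[ t ∈ allE (n ∷ ns) (r ∷ rs) ] when (eqE (a , as) t) (f t))
    ≡⟨ ∑-pairs (allP n r) (allE ns rs) _ ⟩
  (∑[ t ∈ allP n r ] ∑[ ts ∈ allE ns rs ] when (eqP a t ∧ eqE as ts) (f (t , ts)))
    ≡⟨ ∑-cong (allP n r) (λ t → trans (∑-cong (allE ns rs) (λ ts → when-∧ (eqP a t) _ _)) (∑-when (allE ns rs) (eqP a t) _)) ⟩
  (∑[ t ∈ allP n r ] when (eqP a t) (∑[ ts ∈ allE ns rs ] when (eqE as ts) (f (t , ts))))
    ≡⟨ ∑-cong (allP n r) (λ t → cong (when (eqP a t)) (∑-when-eqE as (λ ts → f (t , ts)))) ⟩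
  (∑[ t ∈ allP n r ] when (eqP a t) (f (t , as)))
    ≡⟨ ∑-when-eqP a (λ t → f (t , as)) ⟩
  f (a , as) ∎

∑-δ-* : ∀ {g} {ns rs : Vec ℕ g} (x : Elt ns rs) (f : Elt ns rs → ℚ) → (∑[ t ∈ allE ns rs ] when (eqE x t) 1ℚ * f t) ≡ f x
∑-δ-* {ns = ns} {rs} x f = trans (∑-cong (allE ns rs) (λ t → when-1-* (eqE x t) (f t))) (∑-when-eqE x f)

∑-*-δ : ∀ {g} {ns rs : Vec ℕ g} (y : Elt ns rs) (f : Elt ns rs → ℚ) → (∑[ t ∈ allE ns rs ] f t * when (eqE t y) 1ℚ) ≡ f y
∑-*-δ {ns = ns} {rs} y f = trans (∑-cong (allE ns rs) (λ t → trans (ℚP.*-comm (f t) (when (eqE t y) 1ℚ)) (trans (when-1-* (eqE t y) (f t)) (cong (λ c → when c (f t)) (eqE-sym t y)))))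
                  (∑-when-eqE y f)

-- Inverting w on one factor P_{n,r}

height : ∀ {n r} → P n r → ℕ
height a = Vec.sum (digits a)

-- Y₀^(a₀ choose 2) ∏ⱼ Yⱼ^sⱼ(a); at a = 1̂ this is the i-th factor of K.
monomial : ∀ {n r} → P n r → Vec ℚ (suc n) → ℚ
monomial {n} a Y = pow (lookup Y Fin.zero) (toℕ (proj₁ a) C 2)
                 * prodFin n (λ j → pow (lookup Y (Fin.suc j)) (lookup (psums (digits a)) (inject₁ j)))

w₁ : ∀ {n r} → P n r → P n r → Vec ℚ (suc n) → ℚ
w₁ a b Y = θ a b (lookup Y Fin.zero) * φ a b Y

lookup-∷ʳ-inject₁ : ∀ {A : Set} {m} (v : Vec A m) x (i : Fin m) → lookup (v ∷ʳ x) (inject₁ i) ≡ lookup v i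
lookup-∷ʳ-inject₁ (y ∷ v) x Fin.zero    = refl
lookup-∷ʳ-inject₁ (y ∷ v) x (Fin.suc i) = lookup-∷ʳ-inject₁ v x i

lookup-∷ʳ-last : ∀ {A : Set} {m} (v : Vec A m) x → lookup (v ∷ʳ x) (fromℕ m) ≡ x
lookup-∷ʳ-last []      x = refl
lookup-∷ʳ-last (y ∷ v) x = lookup-∷ʳ-last v x

sum-∷ʳ : ∀ {m} (u : Vec ℕ m) x → Vec.sum (u ∷ʳ x) ≡ Vec.sum u ℕ.+ x
sum-∷ʳ []      x = ℕP.+-comm x 0
sum-∷ʳ (y ∷ u) x = trans (cong (y ℕ.+_) (sum-∷ʳ u x)) (sym (ℕP.+-assoc y _ x))

psums-∷ʳ : ∀ {m} (u : Vec ℕ m) x → psums (u ∷ʳ x) ≡ psums u ∷ʳ (Vec.sum u ℕ.+ x)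
psums-∷ʳ []      x = refl
psums-∷ʳ (y ∷ u) x = cong (y ∷_) (begin
  Vec.map (y ℕ.+_) (psums (u ∷ʳ x))                          ≡⟨ cong (Vec.map (y ℕ.+_)) (psums-∷ʳ u x) ⟩
  Vec.map (y ℕ.+_) (psums u ∷ʳ (Vec.sum u ℕ.+ x))            ≡⟨ VecP.map-∷ʳ (y ℕ.+_) _ (psums u) ⟩
  Vec.map (y ℕ.+_) (psums u) ∷ʳ (y ℕ.+ (Vec.sum u ℕ.+ x))    ≡⟨ cong (Vec.map (y ℕ.+_) (psums u) ∷ʳ_) (sym (ℕP.+-assoc y _ x)) ⟩
  Vec.map (y ℕ.+_) (psums u) ∷ʳ (y ℕ.+ Vec.sum u ℕ.+ x)      ∎)

lookup-psums-last : ∀ {m} (u : Vec ℕ (suc m)) → lookup (psums u) (fromℕ m) ≡ Vec.sum u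
lookup-psums-last {zero}  (y ∷ []) = sym (ℕP.+-identityʳ y)
lookup-psums-last {suc m} (y ∷ u)  = trans (VecP.lookup-map (fromℕ m) (y ℕ.+_) (psums u)) (cong (y ℕ.+_) (lookup-psums-last u))

allLeᵇ-∷ʳ : ∀ {m} (u v : Vec ℕ m) x y → allLeᵇ (u ∷ʳ x) (v ∷ʳ y) ≡ allLeᵇ u v ∧ (x ≤ᵇ y)
allLeᵇ-∷ʳ []      []      x y = ∧-identityʳ (x ≤ᵇ y)
allLeᵇ-∷ʳ (a ∷ u) (b ∷ v) x y = trans (cong ((a ≤ᵇ b) ∧_) (allLeᵇ-∷ʳ u v x y)) (sym (∧-assoc (a ≤ᵇ b) _ _))

allEqᵇ-∷ʳ : ∀ {m} (u v : Vec ℕ m) x y → allEqᵇ (u ∷ʳ x) (v ∷ʳ y) ≡ allEqᵇ u v ∧ (x ≡ᵇ y)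
allEqᵇ-∷ʳ []      []      x y = ∧-identityʳ (x ≡ᵇ y)
allEqᵇ-∷ʳ (a ∷ u) (b ∷ v) x y = trans (cong ((a ≡ᵇ b) ∧_) (allEqᵇ-∷ʳ u v x y)) (sym (∧-assoc (a ≡ᵇ b) _ _))

allLeᵇ-lookup : ∀ {m} (u v : Vec ℕ m) → allLeᵇ u v ≡ true → ∀ i → lookup u i ≤ lookup v i
allLeᵇ-lookup (a ∷ u) (b ∷ v) u≤v Fin.zero    = ≤ᵇ⇒≤ a b (proj₁ (∧-true⁻ {a ≤ᵇ b} u≤v))
allLeᵇ-lookup (a ∷ u) (b ∷ v) u≤v (Fin.suc i) = allLeᵇ-lookup u v (proj₂ (∧-true⁻ {a ≤ᵇ b} u≤v)) i

snocP : ∀ {n r} → P n r → Bool → P (suc n) r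
snocP (a₀ , v) ε = a₀ , v ∷ʳ ε

snocP-view : ∀ {n r} (a : P (suc n) r) → ∃₂ λ a′ ε → a ≡ snocP a′ ε
snocP-view (a₀ , v) with Vec.initLast v
... | v′ , ε , refl = (a₀ , v′) , ε , refl

digits-snocP : ∀ {n r} (a : P n r) ε → digits (snocP a ε) ≡ digits a ∷ʳ b2n ε
digits-snocP (a₀ , v) ε = cong (toℕ a₀ ∷_) (VecP.map-∷ʳ b2n ε v)

height-snocP : ∀ {n r} (a : P n r) ε → height (snocP a ε) ≡ height a ℕ.+ b2n ε
height-snocP a ε = trans (cong Vec.sum (digits-snocP a ε)) (sum-∷ʳ (digits a) (b2n ε))

psums-snocP : ∀ {n r} (a : P n r) ε → psums (digits (snocP a ε)) ≡ psums (digits a) ∷ʳ (height a ℕ.+ b2n ε)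
psums-snocP a ε = trans (cong psums (digits-snocP a ε)) (psums-∷ʳ (digits a) (b2n ε))

lookup-psums-snocP : ∀ {n r} (a : P n r) ε (j : Fin (suc n)) → lookup (psums (digits (snocP a ε))) (inject₁ j) ≡ lookup (psums (digits a)) j
lookup-psums-snocP a ε j = trans (cong (λ v → lookup v (inject₁ j)) (psums-snocP a ε)) (lookup-∷ʳ-inject₁ (psums (digits a)) _ j)

lookup-psums-snocP-last : ∀ {n r} (a : P n r) ε → lookup (psums (digits (snocP a ε))) (inject₁ (fromℕ n)) ≡ height a
lookup-psums-snocP-last {n} a ε = trans (lookup-psums-snocP a ε (fromℕ n)) (lookup-psums-last (digits a))

leP-snocP : ∀ {n r} (a b : P n r) ε τ → leP (snocP a ε) (snocP b τ) ≡ leP a b ∧ (height a ℕ.+ b2n ε ≤ᵇ height b ℕ.+ b2n τ)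
leP-snocP a b ε τ = trans (cong₂ allLeᵇ (psums-snocP a ε) (psums-snocP b τ)) (allLeᵇ-∷ʳ (psums (digits a)) (psums (digits b)) _ _)

eqP-snocP : ∀ {n r} (a b : P n r) ε τ → eqP (snocP a ε) (snocP b τ) ≡ eqP a b ∧ (b2n ε ≡ᵇ b2n τ)
eqP-snocP a b ε τ = trans (cong₂ allEqᵇ (digits-snocP a ε) (digits-snocP b τ)) (allEqᵇ-∷ʳ (digits a) (digits b) _ _)

leP⇒height-≤ : ∀ {n r} (a b : P n r) → leP a b ≡ true → height a ≤ height b
leP⇒height-≤ {n} a b a≤b = subst₂ _≤_ (lookup-psums-last (digits a)) (lookup-psums-last (digits b))
  (allLeᵇ-lookup _ _ a≤b (fromℕ n))

lastFactor : Bool → Bool → ℕ → ℚ → ℚ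
lastFactor ε τ d y = if ε ∧ not τ then 1ℚ + - pow y d else 1ℚ

φ-snocP : ∀ {n r} (a b : P n r) ε τ (Y : Vec ℚ (suc n)) y →
  φ (snocP a ε) (snocP b τ) (Y ∷ʳ y) ≡ when (height a ℕ.+ b2n ε ≤ᵇ height b ℕ.+ b2n τ) (φ a b Y * lastFactor ε τ (height b ∸ height a) y)
φ-snocP {n} a@(_ , va) b@(_ , vb) ε τ Y y = begin
  (if leP (snocP a ε) (snocP b τ) then prodFin (suc n) F else 0ℚ)
    ≡⟨ cong (λ c → if c then prodFin (suc n) F else 0ℚ) (leP-snocP a b ε τ) ⟩
  (if leP a b ∧ last≤ then prodFin (suc n) F else 0ℚ)
    ≡⟨ cong (λ z → if leP a b ∧ last≤ then z else 0ℚ) (trans (prodFin-snoc n F) (cong₂ _*_ (prodFin-cong n F-inject₁) F-last)) ⟩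
  (if leP a b ∧ last≤ then prodFin n F′ * lastFactor ε τ (height b ∸ height a) y else 0ℚ)
    ≡⟨ reassociate (leP a b) last≤ (prodFin n F′) _ ⟩
  when last≤ (φ a b Y * lastFactor ε τ (height b ∸ height a) y) ∎
  where
  last≤ = height a ℕ.+ b2n ε ≤ᵇ height b ℕ.+ b2n τ
  F : Fin (suc n) → ℚ
  F i = if lookup (va ∷ʳ ε) i ∧ not (lookup (vb ∷ʳ τ) i)
        then 1ℚ + - pow (lookup (Y ∷ʳ y) (Fin.suc i)) (lookup (psums (digits (snocP b τ))) (inject₁ i) ∸ lookup (psums (digits (snocP a ε))) (inject₁ i))
        else 1ℚ
  F′ : Fin n → ℚ
  F′ i = if lookup va i ∧ not (lookup vb i)
         then 1ℚ + - pow (lookup Y (Fin.suc i)) (lookup (psums (digits b)) (inject₁ i) ∸ lookup (psums (digits a)) (inject₁ i))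
         else 1ℚ
  F-inject₁ : ∀ i → F (inject₁ i) ≡ F′ i
  F-inject₁ i rewrite lookup-∷ʳ-inject₁ va ε i | lookup-∷ʳ-inject₁ vb τ i | lookup-∷ʳ-inject₁ Y y (Fin.suc i)
                    | lookup-psums-snocP a ε (inject₁ i) | lookup-psums-snocP b τ (inject₁ i) = refl
  F-last : F (fromℕ n) ≡ lastFactor ε τ (height b ∸ height a) y
  F-last rewrite lookup-∷ʳ-last va ε | lookup-∷ʳ-last vb τ | lookup-∷ʳ-last Y y
               | lookup-psums-snocP-last a ε | lookup-psums-snocP-last b τ = refl
  reassociate : ∀ c d (x z : ℚ) → (if c ∧ d then x * z else 0ℚ) ≡ when d ((if c then x else 0ℚ) * z)
  reassociate true  d     x z = refl
  reassociate false true  x z = sym (ℚP.*-zeroˡ z)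
  reassociate false false x z = refl

monomial-snocP : ∀ {n r} (a : P n r) ε (Y : Vec ℚ (suc n)) y → monomial (snocP a ε) (Y ∷ʳ y) ≡ monomial a Y * pow y (height a)
monomial-snocP {n} a@(a₀ , _) ε Y y = begin
  pow (lookup (Y ∷ʳ y) Fin.zero) (toℕ a₀ C 2) * prodFin (suc n) M
    ≡⟨ cong₂ _*_ (cong (λ z → pow z (toℕ a₀ C 2)) (lookup-∷ʳ-inject₁ Y y Fin.zero)) (trans (prodFin-snoc n M) (cong₂ _*_ (prodFin-cong n M-inject₁) M-last)) ⟩
  pow (lookup Y Fin.zero) (toℕ a₀ C 2) * (prodFin n M′ * pow y (height a))
    ≡⟨ sym (ℚP.*-assoc (pow (lookup Y Fin.zero) (toℕ a₀ C 2)) (prodFin n M′) (pow y (height a))) ⟩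
  monomial a Y * pow y (height a) ∎
  where
  M : Fin (suc n) → ℚ
  M j = pow (lookup (Y ∷ʳ y) (Fin.suc j)) (lookup (psums (digits (snocP a ε))) (inject₁ j))
  M′ : Fin n → ℚ
  M′ j = pow (lookup Y (Fin.suc j)) (lookup (psums (digits a)) (inject₁ j))
  M-inject₁ : ∀ j → M (inject₁ j) ≡ M′ j
  M-inject₁ j rewrite lookup-∷ʳ-inject₁ Y y (Fin.suc j) | lookup-psums-snocP a ε (inject₁ j) = refl
  M-last : M (fromℕ n) ≡ pow y (height a)
  M-last rewrite lookup-∷ʳ-last Y y | lookup-psums-snocP-last a ε = refl

w₁-snocP : ∀ {n r} (a b : P n r) ε τ (Y : Vec ℚ (suc n)) y →
  w₁ (snocP a ε) (snocP b τ) (Y ∷ʳ y) ≡ when (height a ℕ.+ b2n ε ≤ᵇ height b ℕ.+ b2n τ) (w₁ a b Y * lastFactor ε τ (height b ∸ height a) y)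
w₁-snocP a b ε τ Y y = begin
  θ a b (lookup (Y ∷ʳ y) Fin.zero) * φ (snocP a ε) (snocP b τ) (Y ∷ʳ y)
    ≡⟨ cong₂ _*_ (cong (θ a b) (lookup-∷ʳ-inject₁ Y y Fin.zero)) (φ-snocP a b ε τ Y y) ⟩
  θ a b (lookup Y Fin.zero) * when last≤ (φ a b Y * f)
    ≡⟨ *-when last≤ (θ a b (lookup Y Fin.zero)) (φ a b Y * f) ⟩
  when last≤ (θ a b (lookup Y Fin.zero) * (φ a b Y * f))
    ≡⟨ cong (when last≤) (sym (ℚP.*-assoc (θ a b (lookup Y Fin.zero)) (φ a b Y) f)) ⟩
  when last≤ (w₁ a b Y * f) ∎
  where
  last≤ = height a ℕ.+ b2n ε ≤ᵇ height b ℕ.+ b2n τ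
  f = lastFactor ε τ (height b ∸ height a) y

w₁-≰ : ∀ {n r} (a b : P n r) (Y : Vec ℚ (suc n)) → leP a b ≡ false → w₁ a b Y ≡ 0ℚ
w₁-≰ a b Y a≰b rewrite a≰b = ℚP.*-zeroʳ (θ a b (lookup Y Fin.zero))

twist : ∀ {n r} → P n r → Vec ℚ (suc n) → ℚ
twist a Y = sgn (height a) * monomial a Y

twist⁻ : ∀ {n r} → P n r → Vec ℚ (suc n) → ℚ
twist⁻ a Y = sgn (height a) * monomial a (Vec.map inv Y)

w₁⁻ : ∀ {n r} → P n r → P n r → Vec ℚ (suc n) → ℚ
w₁⁻ t b Y = twist b Y * twist⁻ t Y * w₁ t b (Vec.map inv Y)

RightInverse₁ : ℕ → ℕ → Set
RightInverse₁ n r = ∀ (Y : Vec ℚ (suc n)) → GenericVec Y → ∀ (a b : P n r) →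
  (∑[ t ∈ allP n r ] w₁ a t Y * w₁⁻ t b Y) ≡ when (eqP a b) 1ℚ

lastSum : Bool → Bool → ℕ → ℚ → ℚ
lastSum false false d y = 1ℚ
lastSum true  true  d y = pow y d
lastSum true  false d y = 1ℚ + - pow y d
lastSum false true  d y = 0ℚ

lastTerm : (ε ε′ τ : Bool) (p q : ℕ) (y y′ : ℚ) → ℚ
lastTerm ε ε′ τ p q y y′ = when (b2n ε ≤ᵇ p ℕ.+ b2n τ) (when (b2n τ ≤ᵇ q ℕ.+ b2n ε′)
  (lastFactor ε τ p y * lastFactor τ ε′ q y′ * (sgn (b2n ε′) * sgn (b2n τ)) * pow y q))

lastTerm-sum : ∀ ε ε′ p q y y′ → y′ * y ≡ 1ℚ → lastTerm ε ε′ false p q y y′ + lastTerm ε ε′ true p q y y′ ≡ lastSum ε ε′ (p ℕ.+ q) y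
lastTerm-sum false false p zero    y y′ y′y≡1 = refl
lastTerm-sum false false p (suc q) y y′ y′y≡1 = begin
  1ℚ * 1ℚ * (1ℚ * 1ℚ) * z + 1ℚ * (1ℚ + - z′) * (1ℚ * (- 1ℚ * 1ℚ)) * z
    ≡⟨ solve 2 (λ z z′ → con 1ℚ :* con 1ℚ :* (con 1ℚ :* con 1ℚ) :* z :+ con 1ℚ :* (con 1ℚ :+ :- z′) :* (con 1ℚ :* (:- con 1ℚ :* con 1ℚ)) :* z := z′ :* z) refl z z′ ⟩
  z′ * z ≡⟨ pow-inverse y y′ y′y≡1 (suc q) ⟩
  1ℚ ∎
  where
  z  = pow y (suc q)
  z′ = pow y′ (suc q)
lastTerm-sum false true p zero    y y′ _ = solve 1 (λ z → con 1ℚ :* con 1ℚ :* ((:- con 1ℚ :* con 1ℚ) :* con 1ℚ) :* z :+ con 1ℚ :* con 1ℚ :* ((:- con 1ℚ :* con 1ℚ) :* (:- con 1ℚ :* con 1ℚ)) :* z := con 0ℚ) refl (pow y zero)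
lastTerm-sum false true p (suc q) y y′ _ = solve 1 (λ z → con 1ℚ :* con 1ℚ :* ((:- con 1ℚ :* con 1ℚ) :* con 1ℚ) :* z :+ con 1ℚ :* con 1ℚ :* ((:- con 1ℚ :* con 1ℚ) :* (:- con 1ℚ :* con 1ℚ)) :* z := con 0ℚ) refl (pow y (suc q))
lastTerm-sum true true zero    zero    y y′ _ = refl
lastTerm-sum true true zero    (suc q) y y′ _ = solve 1 (λ z → con 0ℚ :+ con 1ℚ :* con 1ℚ :* ((:- con 1ℚ :* con 1ℚ) :* (:- con 1ℚ :* con 1ℚ)) :* z := z) refl (pow y (suc q))
lastTerm-sum true true (suc p) zero    y y′ _ = begin
  (1ℚ + - x) * 1ℚ * ((- 1ℚ * 1ℚ) * 1ℚ) * z + 1ℚ * 1ℚ * ((- 1ℚ * 1ℚ) * (- 1ℚ * 1ℚ)) * z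
    ≡⟨ solve 2 (λ x z → (con 1ℚ :+ :- x) :* con 1ℚ :* ((:- con 1ℚ :* con 1ℚ) :* con 1ℚ) :* z :+ con 1ℚ :* con 1ℚ :* ((:- con 1ℚ :* con 1ℚ) :* (:- con 1ℚ :* con 1ℚ)) :* z := x :* z) refl x z ⟩
  x * z ≡⟨ sym (pow-+ y (suc p) zero) ⟩
  pow y (suc p ℕ.+ zero) ∎
  where
  x = pow y (suc p)
  z = pow y zero
lastTerm-sum true true (suc p) (suc q) y y′ _ = begin
  (1ℚ + - x) * 1ℚ * ((- 1ℚ * 1ℚ) * 1ℚ) * z + 1ℚ * 1ℚ * ((- 1ℚ * 1ℚ) * (- 1ℚ * 1ℚ)) * z
    ≡⟨ solve 2 (λ x z → (con 1ℚ :+ :- x) :* con 1ℚ :* ((:- con 1ℚ :* con 1ℚ) :* con 1ℚ) :* z :+ con 1ℚ :* con 1ℚ :* ((:- con 1ℚ :* con 1ℚ) :* (:- con 1ℚ :* con 1ℚ)) :* z := x :* z) refl x z ⟩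
  x * z ≡⟨ sym (pow-+ y (suc p) (suc q)) ⟩
  pow y (suc p ℕ.+ suc q) ∎
  where
  x = pow y (suc p)
  z = pow y (suc q)
lastTerm-sum true false zero    zero    y y′ _ = refl
lastTerm-sum true false zero    (suc q) y y′ y′y≡1 = begin
  0ℚ + 1ℚ * (1ℚ + - z′) * (1ℚ * (- 1ℚ * 1ℚ)) * z
    ≡⟨ solve 2 (λ z z′ → con 0ℚ :+ con 1ℚ :* (con 1ℚ :+ :- z′) :* (con 1ℚ :* (:- con 1ℚ :* con 1ℚ)) :* z := z′ :* z :+ :- z) refl z z′ ⟩
  z′ * z + - z ≡⟨ cong (_+ - z) (pow-inverse y y′ y′y≡1 (suc q)) ⟩
  1ℚ + - z ∎
  where
  z  = pow y (suc q)
  z′ = pow y′ (suc q)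
lastTerm-sum true false (suc p) zero    y y′ _ = begin
  (1ℚ + - x) * 1ℚ * (1ℚ * 1ℚ) * 1ℚ + 0ℚ
    ≡⟨ solve 1 (λ x → (con 1ℚ :+ :- x) :* con 1ℚ :* (con 1ℚ :* con 1ℚ) :* con 1ℚ :+ con 0ℚ := con 1ℚ :+ :- (x :* con 1ℚ)) refl x ⟩
  1ℚ + - (x * 1ℚ) ≡⟨ cong (λ z → 1ℚ + - z) (sym (pow-+ y (suc p) zero)) ⟩
  1ℚ + - pow y (suc p ℕ.+ zero) ∎
  where
  x = pow y (suc p)
lastTerm-sum true false (suc p) (suc q) y y′ y′y≡1 = begin
  (1ℚ + - x) * 1ℚ * (1ℚ * 1ℚ) * z + 1ℚ * (1ℚ + - z′) * (1ℚ * (- 1ℚ * 1ℚ)) * z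
    ≡⟨ solve 3 (λ x z z′ → (con 1ℚ :+ :- x) :* con 1ℚ :* (con 1ℚ :* con 1ℚ) :* z :+ con 1ℚ :* (con 1ℚ :+ :- z′) :* (con 1ℚ :* (:- con 1ℚ :* con 1ℚ)) :* z := z′ :* z :+ :- (x :* z)) refl x z z′ ⟩
  z′ * z + - (x * z) ≡⟨ cong₂ (λ a b → a + - b) (pow-inverse y y′ y′y≡1 (suc q)) (sym (pow-+ y (suc p) (suc q))) ⟩
  1ℚ + - pow y (suc p ℕ.+ suc q) ∎
  where
  x  = pow y (suc p)
  z  = pow y (suc q)
  z′ = pow y′ (suc q)

lastSum-diagonal : ∀ y c d ε ε′ → (c ≡ true → d ≡ 0) → when c 1ℚ * lastSum ε ε′ d y ≡ when (c ∧ (b2n ε ≡ᵇ b2n ε′)) 1ℚ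
lastSum-diagonal y false d ε     ε′    _   = ℚP.*-zeroˡ (lastSum ε ε′ d y)
lastSum-diagonal y true  d false false _   = refl
lastSum-diagonal y true  d false true  _   = refl
lastSum-diagonal y true  d true  true  d≡0 rewrite d≡0 refl = refl
lastSum-diagonal y true  d true  false d≡0 rewrite d≡0 refl = refl

∑-allBoolVecs-∷ʳ : ∀ n (f : Vec Bool (suc n) → ℚ) → ∑ (allBoolVecs (suc n)) f ≡ ∑[ v ∈ allBoolVecs n ] (f (v ∷ʳ false) + f (v ∷ʳ true))
∑-allBoolVecs-∷ʳ zero    f = solve 2 (λ a b → a :+ (b :+ con 0ℚ) := (a :+ b) :+ con 0ℚ) refl (f (false ∷ [])) (f (true ∷ []))
∑-allBoolVecs-∷ʳ (suc n) f = begin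
  ∑ (allBoolVecs (suc (suc n))) f
    ≡⟨ ∑-concatMap extend (allBoolVecs (suc n)) f ⟩
  (∑[ u ∈ allBoolVecs (suc n) ] ∑ (extend u) f)
    ≡⟨ ∑-allBoolVecs-∷ʳ n (λ u → ∑ (extend u) f) ⟩
  (∑[ v ∈ allBoolVecs n ] (∑ (extend (v ∷ʳ false)) f + ∑ (extend (v ∷ʳ true)) f))
    ≡⟨ ∑-cong (allBoolVecs n) (λ v → solve 4 (λ a b c d → (a :+ (b :+ con 0ℚ)) :+ (c :+ (d :+ con 0ℚ)) := (a :+ c) :+ ((b :+ d) :+ con 0ℚ)) refl
         (f (false ∷ (v ∷ʳ false))) (f (true ∷ (v ∷ʳ false))) (f (false ∷ (v ∷ʳ true))) (f (true ∷ (v ∷ʳ true)))) ⟩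
  (∑[ v ∈ allBoolVecs n ] ∑[ u ∈ extend v ] (f (u ∷ʳ false) + f (u ∷ʳ true)))
    ≡⟨ sym (∑-concatMap extend (allBoolVecs n) _) ⟩
  (∑[ u ∈ allBoolVecs (suc n) ] (f (u ∷ʳ false) + f (u ∷ʳ true))) ∎
  where
  extend : ∀ {k} → Vec Bool k → List (Vec Bool (suc k))
  extend v = (false ∷ v) ∷ (true ∷ v) ∷ []

∑-allP-snocP : ∀ n r (f : P (suc n) r → ℚ) → ∑ (allP (suc n) r) f ≡ ∑[ t ∈ allP n r ] (f (snocP t false) + f (snocP t true))
∑-allP-snocP n r f = begin
  ∑ (allP (suc n) r) f
    ≡⟨ ∑-pairs (allFin (suc r)) (allBoolVecs (suc n)) f ⟩
  (∑[ a₀ ∈ allFin (suc r) ] ∑[ v ∈ allBoolVecs (suc n) ] f (a₀ , v))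
    ≡⟨ ∑-cong (allFin (suc r)) (λ a₀ → ∑-allBoolVecs-∷ʳ n (λ v → f (a₀ , v))) ⟩
  (∑[ a₀ ∈ allFin (suc r) ] ∑[ v ∈ allBoolVecs n ] (f (a₀ , v ∷ʳ false) + f (a₀ , v ∷ʳ true)))
    ≡⟨ sym (∑-pairs (allFin (suc r)) (allBoolVecs n) _) ⟩
  (∑[ t ∈ allP n r ] (f (snocP t false) + f (snocP t true))) ∎

+-≤ᵇ-cancelˡ : ∀ x m n → (x ℕ.+ m ≤ᵇ x ℕ.+ n) ≡ (m ≤ᵇ n)
+-≤ᵇ-cancelˡ zero    m n = refl
+-≤ᵇ-cancelˡ (suc x) m n = trans (<ᵇ-suc (x ℕ.+ m) (x ℕ.+ n)) (+-≤ᵇ-cancelˡ x m n)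
  where
  <ᵇ-suc : ∀ m n → (m ℕ.<ᵇ suc n) ≡ (m ≤ᵇ n)
  <ᵇ-suc zero    n = refl
  <ᵇ-suc (suc m) n = refl

≤ᵇ-shift : ∀ {x u} m n → x ≤ u → (x ℕ.+ m ≤ᵇ u ℕ.+ n) ≡ (m ≤ᵇ (u ∸ x) ℕ.+ n)
≤ᵇ-shift {x} {u} m n x≤u = trans (cong (x ℕ.+ m ≤ᵇ_) u+n≡x+[u∸x+n]) (+-≤ᵇ-cancelˡ x m _)
  where
  u+n≡x+[u∸x+n] : u ℕ.+ n ≡ x ℕ.+ ((u ∸ x) ℕ.+ n)
  u+n≡x+[u∸x+n] = trans (cong (ℕ._+ n) (sym (ℕP.m+[n∸m]≡n x≤u))) (ℕP.+-assoc x (u ∸ x) n)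

∸-split : ∀ {x u v} → x ≤ u → u ≤ v → v ∸ x ≡ (u ∸ x) ℕ.+ (v ∸ u)
∸-split {x} {u} {v} x≤u u≤v = trans (cong (_∸ x) v≡) (ℕP.m+n∸m≡n x _)
  where
  v≡ : v ≡ x ℕ.+ ((u ∸ x) ℕ.+ (v ∸ u))
  v≡ = trans (sym (ℕP.m+[n∸m]≡n u≤v)) (trans (cong (ℕ._+ (v ∸ u)) (sym (ℕP.m+[n∸m]≡n x≤u))) (ℕP.+-assoc x (u ∸ x) (v ∸ u)))

GenericVec-∷ʳ⁻ : ∀ {m} (Y : Vec ℚ (suc m)) y → GenericVec (Y ∷ʳ y) → GenericVec Y × (y ≢ 0ℚ)
GenericVec-∷ʳ⁻ {zero}  (y₀ ∷ []) y (g₀ , g₁ , g₂ , (h₀ , _)) = (g₀ , g₁ , g₂ , tt) , h₀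
GenericVec-∷ʳ⁻ {suc m} (y₀ ∷ Y)  y (g₀ , g₁ , g₂ , gs) with GenericVec-∷ʳ⁻ Y y gs
... | gY , y≢0 = (g₀ , g₁ , g₂ , gY) , y≢0

-- Adding the last coordinate multiplies w₁ w₁⁻ by a factor depending only on that
-- coordinate; summed over its two values it gives lastSum, whatever the rest is.
module InversionStep {n r} (a b : P n r) (ε ε′ : Bool) (Y : Vec ℚ (suc n)) (y : ℚ) (y≢0 : y ≢ 0ℚ) where

  private
    y′ = inv y
    Y′ = Vec.map inv Y

    weight : P n r → ℚ
    weight t = w₁ a t Y * w₁⁻ t b Y

    last : P n r → Bool → ℚ
    last t τ = when (height a ℕ.+ b2n ε ≤ᵇ height t ℕ.+ b2n τ) (when (height t ℕ.+ b2n τ ≤ᵇ height b ℕ.+ b2n ε′)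
      (lastFactor ε τ (height t ∸ height a) y * lastFactor τ ε′ (height b ∸ height t) y′ * (sgn (b2n ε′) * sgn (b2n τ))
        * (pow y (height b) * pow y′ (height t))))

    separate : ∀ c d w lf s sε k pk s′ sτ k′ pk′ w′ lf′ →
      when c (w * lf) * (((s * sε) * (k * pk)) * ((s′ * sτ) * (k′ * pk′)) * when d (w′ * lf′))
      ≡ (w * (((s * k) * (s′ * k′)) * w′)) * when c (when d (lf * lf′ * (sε * sτ) * (pk * pk′)))
    separate true true w lf s sε k pk s′ sτ k′ pk′ w′ lf′ =
      solve 12 (λ w lf s sε k pk s′ sτ k′ pk′ w′ lf′ →
        (w :* lf) :* (((s :* sε) :* (k :* pk)) :* ((s′ :* sτ) :* (k′ :* pk′)) :* (w′ :* lf′))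
        := (w :* (((s :* k) :* (s′ :* k′)) :* w′)) :* (lf :* lf′ :* (sε :* sτ) :* (pk :* pk′)))
        refl w lf s sε k pk s′ sτ k′ pk′ w′ lf′
    separate true false w lf s sε k pk s′ sτ k′ pk′ w′ lf′ =
      trans (cong ((w * lf) *_) (ℚP.*-zeroʳ (((s * sε) * (k * pk)) * ((s′ * sτ) * (k′ * pk′)))))
        (trans (ℚP.*-zeroʳ (w * lf)) (sym (ℚP.*-zeroʳ (w * (((s * k) * (s′ * k′)) * w′)))))
    separate false d w lf s sε k pk s′ sτ k′ pk′ w′ lf′ =
      trans (ℚP.*-zeroˡ (((s * sε) * (k * pk)) * ((s′ * sτ) * (k′ * pk′)) * when d (w′ * lf′)))
        (sym (ℚP.*-zeroʳ (w * (((s * k) * (s′ * k′)) * w′))))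

    w₁w₁⁻-snocP : ∀ t τ → w₁ (snocP a ε) (snocP t τ) (Y ∷ʳ y) * w₁⁻ (snocP t τ) (snocP b ε′) (Y ∷ʳ y) ≡ weight t * last t τ
    w₁w₁⁻-snocP t τ = begin
      w₁ (snocP a ε) (snocP t τ) (Y ∷ʳ y) * ((twist (snocP b ε′) (Y ∷ʳ y) * twist⁻ (snocP t τ) (Y ∷ʳ y)) * w₁ (snocP t τ) (snocP b ε′) (Vec.map inv (Y ∷ʳ y)))
        ≡⟨ cong₂ _*_ (w₁-snocP a t ε τ Y y) (cong₂ _*_ (cong₂ _*_ twist-b twist⁻-t) w₁-t-b) ⟩
      when (height a ℕ.+ b2n ε ≤ᵇ height t ℕ.+ b2n τ) (w₁ a t Y * f)
        * (((sgn (height b) * sgn (b2n ε′)) * (monomial b Y * pow y (height b)))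
          * ((sgn (height t) * sgn (b2n τ)) * (monomial t Y′ * pow y′ (height t)))
          * when (height t ℕ.+ b2n τ ≤ᵇ height b ℕ.+ b2n ε′) (w₁ t b Y′ * f′))
        ≡⟨ separate (height a ℕ.+ b2n ε ≤ᵇ height t ℕ.+ b2n τ) (height t ℕ.+ b2n τ ≤ᵇ height b ℕ.+ b2n ε′) (w₁ a t Y) f (sgn (height b)) (sgn (b2n ε′)) (monomial b Y) (pow y (height b))
                        (sgn (height t)) (sgn (b2n τ)) (monomial t Y′) (pow y′ (height t)) (w₁ t b Y′) f′ ⟩
      weight t * last t τ ∎
      where
      f  = lastFactor ε τ (height t ∸ height a) y
      f′ = lastFactor τ ε′ (height b ∸ height t) y′
      twist-b : twist (snocP b ε′) (Y ∷ʳ y) ≡ (sgn (height b) * sgn (b2n ε′)) * (monomial b Y * pow y (height b))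
      twist-b = cong₂ _*_ (trans (cong sgn (height-snocP b ε′)) (sgn-+ (height b) (b2n ε′))) (monomial-snocP b ε′ Y y)
      twist⁻-t : twist⁻ (snocP t τ) (Y ∷ʳ y) ≡ (sgn (height t) * sgn (b2n τ)) * (monomial t Y′ * pow y′ (height t))
      twist⁻-t = cong₂ _*_ (trans (cong sgn (height-snocP t τ)) (sgn-+ (height t) (b2n τ)))
                           (trans (cong (monomial (snocP t τ)) (VecP.map-∷ʳ inv y Y)) (monomial-snocP t τ Y′ y′))
      w₁-t-b : w₁ (snocP t τ) (snocP b ε′) (Vec.map inv (Y ∷ʳ y)) ≡ when (height t ℕ.+ b2n τ ≤ᵇ height b ℕ.+ b2n ε′) (w₁ t b Y′ * f′)
      w₁-t-b = trans (cong (w₁ (snocP t τ) (snocP b ε′)) (VecP.map-∷ʳ inv y Y)) (w₁-snocP t b τ ε′ Y′ y′)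

    last≡lastTerm : ∀ t → height a ≤ height t → height t ≤ height b → ∀ τ →
      last t τ ≡ lastTerm ε ε′ τ (height t ∸ height a) (height b ∸ height t) y y′
    last≡lastTerm t a≤t t≤b τ = cong₃ (λ c d z → when c (when d (lastFactor ε τ (height t ∸ height a) y
                                                  * lastFactor τ ε′ (height b ∸ height t) y′ * (sgn (b2n ε′) * sgn (b2n τ)) * z)))
      (≤ᵇ-shift (b2n ε) (b2n τ) a≤t) (≤ᵇ-shift (b2n τ) (b2n ε′) t≤b) (pow-∸ y y′ (inv-*ˡ y y≢0) t≤b)
      where
      cong₃ : ∀ {A B C D : Set} (f : A → B → C → D) {x x′ y y′ z z′} → x ≡ x′ → y ≡ y′ → z ≡ z′ → f x y z ≡ f x′ y′ z′
      cong₃ f refl refl refl = refl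

    sum-of-vanishing : ∀ t → weight t ≡ 0ℚ → weight t * (last t false + last t true) ≡ weight t * lastSum ε ε′ (height b ∸ height a) y
    sum-of-vanishing t w≡0 = trans (cong (_* (last t false + last t true)) w≡0)
      (trans (ℚP.*-zeroˡ (last t false + last t true))
        (sym (trans (cong (_* lastSum ε ε′ (height b ∸ height a) y) w≡0) (ℚP.*-zeroˡ (lastSum ε ε′ (height b ∸ height a) y)))))

    weight-last-sum : ∀ t → weight t * (last t false + last t true) ≡ weight t * lastSum ε ε′ (height b ∸ height a) y
    weight-last-sum t = by-cases (leP a t) (leP t b) refl refl
      where
      by-cases : ∀ c d → leP a t ≡ c → leP t b ≡ d → weight t * (last t false + last t true) ≡ weight t * lastSum ε ε′ (height b ∸ height a) y
      by-cases true  true  a≤t t≤b = cong (weight t *_) (begin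
        last t false + last t true
          ≡⟨ cong₂ _+_ (last≡lastTerm t a≤ₕt t≤ₕb false) (last≡lastTerm t a≤ₕt t≤ₕb true) ⟩
        lastTerm ε ε′ false (height t ∸ height a) (height b ∸ height t) y y′ + lastTerm ε ε′ true (height t ∸ height a) (height b ∸ height t) y y′
          ≡⟨ lastTerm-sum ε ε′ _ _ y y′ (inv-*ˡ y y≢0) ⟩
        lastSum ε ε′ ((height t ∸ height a) ℕ.+ (height b ∸ height t)) y
          ≡⟨ cong (λ d → lastSum ε ε′ d y) (sym (∸-split a≤ₕt t≤ₕb)) ⟩
        lastSum ε ε′ (height b ∸ height a) y ∎)
        where
        a≤ₕt = leP⇒height-≤ a t a≤t
        t≤ₕb = leP⇒height-≤ t b t≤b
      by-cases true  false _ t≰b = sum-of-vanishing t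
        (trans (cong (λ z → w₁ a t Y * (twist b Y * twist⁻ t Y * z)) (w₁-≰ t b Y′ t≰b))
          (trans (cong (w₁ a t Y *_) (ℚP.*-zeroʳ (twist b Y * twist⁻ t Y))) (ℚP.*-zeroʳ (w₁ a t Y))))
      by-cases false _ a≰t _ = sum-of-vanishing t
        (trans (cong (_* w₁⁻ t b Y) (w₁-≰ a t Y a≰t)) (ℚP.*-zeroˡ (w₁⁻ t b Y)))

  ∑-w₁w₁⁻-snocP : (∑[ t ∈ allP (suc n) r ] w₁ (snocP a ε) t (Y ∷ʳ y) * w₁⁻ t (snocP b ε′) (Y ∷ʳ y))
                  ≡ (∑[ t ∈ allP n r ] w₁ a t Y * w₁⁻ t b Y) * lastSum ε ε′ (height b ∸ height a) y
  ∑-w₁w₁⁻-snocP = begin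
    (∑[ t ∈ allP (suc n) r ] w₁ (snocP a ε) t (Y ∷ʳ y) * w₁⁻ t (snocP b ε′) (Y ∷ʳ y))
      ≡⟨ ∑-allP-snocP n r _ ⟩
    (∑[ t ∈ allP n r ] (w₁ (snocP a ε) (snocP t false) (Y ∷ʳ y) * w₁⁻ (snocP t false) (snocP b ε′) (Y ∷ʳ y)
                      + w₁ (snocP a ε) (snocP t true) (Y ∷ʳ y) * w₁⁻ (snocP t true) (snocP b ε′) (Y ∷ʳ y)))
      ≡⟨ ∑-cong (allP n r) (λ t → trans (cong₂ _+_ (w₁w₁⁻-snocP t false) (w₁w₁⁻-snocP t true))
                                         (trans (sym (ℚP.*-distribˡ-+ (weight t) _ _)) (weight-last-sum t))) ⟩
    (∑[ t ∈ allP n r ] weight t * lastSum ε ε′ (height b ∸ height a) y)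
      ≡⟨ ∑-*ʳ (allP n r) _ weight ⟩
    (∑[ t ∈ allP n r ] weight t) * lastSum ε ε′ (height b ∸ height a) y ∎

rightInverse₁-base : ∀ r → RightInverse₁ 0 r
rightInverse₁-base r (q ∷ []) (q≢0 , q≢1 , q≢-1 , tt) (a₀ , []) (b₀ , []) = begin
  ∑ (allP 0 r) f                                              ≡⟨ ∑-pairs (allFin (suc r)) (allBoolVecs 0) f ⟩
  (∑[ t₀ ∈ allFin (suc r) ] (f (t₀ , []) + 0ℚ))               ≡⟨ ∑-cong (allFin (suc r)) (λ t₀ → summand (toℕ a₀) (toℕ t₀) (toℕ b₀)) ⟩
  (∑[ t₀ ∈ allFin (suc r) ] orthoTerm (toℕ a₀) (toℕ b₀) (toℕ t₀)) ≡⟨ ∑-allFin-toℕ (suc r) (orthoTerm (toℕ a₀) (toℕ b₀)) ⟩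
  ∑ (upTo (suc r)) (orthoTerm (toℕ a₀) (toℕ b₀))              ≡⟨ qbinom-orthogonality (toℕ a₀) (toℕ b₀) r (ℕP.≤-pred (FinP.toℕ<n a₀)) (ℕP.≤-pred (FinP.toℕ<n b₀)) ⟩
  when (toℕ a₀ ≡ᵇ toℕ b₀) 1ℚ                                  ≡⟨ cong (λ c → when c 1ℚ) (sym (∧-identityʳ (toℕ a₀ ≡ᵇ toℕ b₀))) ⟩
  when (eqP (a₀ , []) (b₀ , [])) 1ℚ                           ∎
  where
  open QBinomial q (inv q) (inv-*ˡ q q≢0) (pow-≢1 q q≢1 q≢-1)
  f : P 0 r → ℚ
  f t = w₁ (a₀ , []) t (q ∷ []) * w₁⁻ t (b₀ , []) (q ∷ [])
  summand : ∀ a t b →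
    (qbinom q t a * when ((a ≤ᵇ t) ∧ true) 1ℚ)
      * (((sgn (b ℕ.+ 0) * (pow q (b C 2) * 1ℚ)) * (sgn (t ℕ.+ 0) * (pow (inv q) (t C 2) * 1ℚ)))
         * (qbinom (inv q) b t * when ((t ≤ᵇ b) ∧ true) 1ℚ)) + 0ℚ
    ≡ orthoTerm a b t
  summand a t b rewrite ℕP.+-identityʳ b | ℕP.+-identityʳ t | ∧-identityʳ (a ≤ᵇ t) | ∧-identityʳ (t ≤ᵇ b) =
    by-cases (a ≤ᵇ t) (t ≤ᵇ b)
    where
    A = qbinom q t a
    B = qbinom (inv q) b t
    s = sgn b * (pow q (b C 2) * 1ℚ)
    s′ = sgn t * (pow (inv q) (t C 2) * 1ℚ)
    by-cases : ∀ c d → (A * when c 1ℚ) * ((s * s′) * (B * when d 1ℚ)) + 0ℚ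
                       ≡ when (c ∧ d) (A * B * ((sgn b * sgn t) * (pow q (b C 2) * pow (inv q) (t C 2))))
    by-cases true  true  = solve 6 (λ A B sb st cb ct → (A :* con 1ℚ) :* (((sb :* (cb :* con 1ℚ)) :* (st :* (ct :* con 1ℚ))) :* (B :* con 1ℚ)) :+ con 0ℚ
                                                       := A :* B :* ((sb :* st) :* (cb :* ct))) refl A B (sgn b) (sgn t) (pow q (b C 2)) (pow (inv q) (t C 2))
    by-cases true  false = trans (ℚP.+-identityʳ _) (trans (cong ((A * 1ℚ) *_) (trans (cong ((s * s′) *_) (ℚP.*-zeroʳ B)) (ℚP.*-zeroʳ (s * s′)))) (ℚP.*-zeroʳ (A * 1ℚ)))
    by-cases false d     = trans (ℚP.+-identityʳ _) (trans (cong (_* ((s * s′) * (B * when d 1ℚ))) (ℚP.*-zeroʳ A)) (ℚP.*-zeroˡ ((s * s′) * (B * when d 1ℚ))))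

rightInverse₁ : ∀ n r → RightInverse₁ n r
rightInverse₁ zero    r = rightInverse₁-base r
rightInverse₁ (suc n) r Yy gen a b with Vec.initLast Yy | snocP-view a | snocP-view b
... | Y , y , refl | a′ , ε , refl | b′ , ε′ , refl = begin
  (∑[ t ∈ allP (suc n) r ] w₁ (snocP a′ ε) t (Y ∷ʳ y) * w₁⁻ t (snocP b′ ε′) (Y ∷ʳ y))
    ≡⟨ InversionStep.∑-w₁w₁⁻-snocP a′ b′ ε ε′ Y y y≢0 ⟩
  (∑[ t ∈ allP n r ] w₁ a′ t Y * w₁⁻ t b′ Y) * lastSum ε ε′ (height b′ ∸ height a′) y
    ≡⟨ cong (_* lastSum ε ε′ (height b′ ∸ height a′) y) (rightInverse₁ n r Y genY a′ b′) ⟩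
  when (eqP a′ b′) 1ℚ * lastSum ε ε′ (height b′ ∸ height a′) y
    ≡⟨ lastSum-diagonal y (eqP a′ b′) (height b′ ∸ height a′) ε ε′ (λ a′≡b′ → trans (cong (λ z → height b′ ∸ height z) (eqP⇒≡ a′ b′ a′≡b′)) (ℕP.n∸n≡0 (height b′))) ⟩
  when (eqP a′ b′ ∧ (b2n ε ≡ᵇ b2n ε′)) 1ℚ
    ≡⟨ cong (λ c → when c 1ℚ) (sym (eqP-snocP a′ b′ ε ε′)) ⟩
  when (eqP (snocP a′ ε) (snocP b′ ε′)) 1ℚ ∎
  where
  genY = proj₁ (GenericVec-∷ʳ⁻ Y y gen)
  y≢0  = proj₂ (GenericVec-∷ʳ⁻ Y y gen)

-- Inverting w on the product

twistE : ∀ {g} {ns rs : Vec ℕ g} → Elt ns rs → Vars ns → ℚ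
twistE {ns = []}    {[]}    _        _        = 1ℚ
twistE {ns = _ ∷ _} {_ ∷ _} (a , as) (Y , Ys) = twist a Y * twistE as Ys

twist⁻E : ∀ {g} {ns rs : Vec ℕ g} → Elt ns rs → Vars ns → ℚ
twist⁻E {ns = []}    {[]}    _        _        = 1ℚ
twist⁻E {ns = _ ∷ _} {_ ∷ _} (a , as) (Y , Ys) = twist⁻ a Y * twist⁻E as Ys

w⁻ : ∀ {g} {ns rs : Vec ℕ g} → Elt ns rs → Elt ns rs → Vars ns → ℚ
w⁻ t b Y = twistE b Y * twist⁻E t Y * w t b (invVars Y)

w-w⁻-inverse : ∀ {g} {ns rs : Vec ℕ g} (Y : Vars ns) → Generic Y → ∀ (a b : Elt ns rs) →
  (∑[ t ∈ allE ns rs ] w a t Y * w⁻ t b Y) ≡ when (eqE a b) 1ℚ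
w-w⁻-inverse {ns = []}     {[]}     Y         gen         tt       tt       = refl
w-w⁻-inverse {ns = n ∷ ns} {r ∷ rs} (Y , Ys) (gen , gens) (a , as) (b , bs) = begin
  (∑[ t ∈ allE (n ∷ ns) (r ∷ rs) ] w (a , as) t (Y , Ys) * w⁻ t (b , bs) (Y , Ys))
    ≡⟨ ∑-pairs (allP n r) (allE ns rs) _ ⟩
  (∑[ t ∈ allP n r ] ∑[ ts ∈ allE ns rs ] w (a , as) (t , ts) (Y , Ys) * w⁻ (t , ts) (b , bs) (Y , Ys))
    ≡⟨ ∑-cong (allP n r) (λ t → trans (∑-cong (allE ns rs) (separate t)) (∑-*ˡ (allE ns rs) (w₁ a t Y * w₁⁻ t b Y) _)) ⟩
  (∑[ t ∈ allP n r ] (w₁ a t Y * w₁⁻ t b Y) * (∑[ ts ∈ allE ns rs ] w as ts Ys * w⁻ ts bs Ys))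
    ≡⟨ ∑-cong (allP n r) (λ t → cong ((w₁ a t Y * w₁⁻ t b Y) *_) (w-w⁻-inverse Ys gens as bs)) ⟩
  (∑[ t ∈ allP n r ] (w₁ a t Y * w₁⁻ t b Y) * when (eqE as bs) 1ℚ)
    ≡⟨ ∑-*ʳ (allP n r) _ _ ⟩
  (∑[ t ∈ allP n r ] w₁ a t Y * w₁⁻ t b Y) * when (eqE as bs) 1ℚ
    ≡⟨ cong (_* when (eqE as bs) 1ℚ) (rightInverse₁ n r Y gen a b) ⟩
  when (eqP a b) 1ℚ * when (eqE as bs) 1ℚ
    ≡⟨ when-1-* (eqP a b) _ ⟩
  when (eqP a b) (when (eqE as bs) 1ℚ)
    ≡⟨ sym (when-∧ (eqP a b) (eqE as bs) 1ℚ) ⟩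
  when (eqP a b ∧ eqE as bs) 1ℚ ∎
  where
  separate : ∀ t ts → w (a , as) (t , ts) (Y , Ys) * w⁻ (t , ts) (b , bs) (Y , Ys)
                    ≡ (w₁ a t Y * w₁⁻ t b Y) * (w as ts Ys * w⁻ ts bs Ys)
  separate t ts = solve 8 (λ w₁ w c cs c′ c′s w₁′ w′ → (w₁ :* w) :* ((c :* cs) :* (c′ :* c′s) :* (w₁′ :* w′))
                                                     := (w₁ :* ((c :* c′) :* w₁′)) :* (w :* ((cs :* c′s) :* w′)))
    refl (w₁ a t Y) (w as ts Ys) (twist b Y) (twistE bs Ys) (twist⁻ t Y) (twist⁻E ts Ys) (w₁ t b (Vec.map inv Y)) (w ts bs (invVars Ys))

GenericVec⇒≢0 : ∀ {m} (Y : Vec ℚ m) → GenericVec Y → ∀ i → lookup Y i ≢ 0ℚ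
GenericVec⇒≢0 (y ∷ Y) (y≢0 , _ , _ , _) Fin.zero    = y≢0
GenericVec⇒≢0 (y ∷ Y) (_ , _ , _ , gen) (Fin.suc i) = GenericVec⇒≢0 Y gen i

monomial-inverse : ∀ {n r} (a : P n r) (Y : Vec ℚ (suc n)) → (∀ i → lookup Y i ≢ 0ℚ) → monomial a (Vec.map inv Y) * monomial a Y ≡ 1ℚ
monomial-inverse {n} a Y Y≢0 = begin
  (pow (lookup Y′ Fin.zero) m * prodFin n M′) * (pow (lookup Y Fin.zero) m * prodFin n M)
    ≡⟨ solve 4 (λ a b c d → (a :* b) :* (c :* d) := (a :* c) :* (b :* d)) refl (pow (lookup Y′ Fin.zero) m) (prodFin n M′) (pow (lookup Y Fin.zero) m) (prodFin n M) ⟩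
  (pow (lookup Y′ Fin.zero) m * pow (lookup Y Fin.zero) m) * (prodFin n M′ * prodFin n M)
    ≡⟨ cong₂ _*_ (pow-inv Fin.zero m) (trans (sym (prodFin-* n M′ M)) (trans (prodFin-cong n (λ j → pow-inv (Fin.suc j) (lookup (psums (digits a)) (inject₁ j)))) (prodFin-1 n))) ⟩
  1ℚ ∎
  where
  Y′ = Vec.map inv Y
  m = toℕ (proj₁ a) C 2
  M′ M : Fin n → ℚ
  M′ j = pow (lookup Y′ (Fin.suc j)) (lookup (psums (digits a)) (inject₁ j))
  M  j = pow (lookup Y (Fin.suc j)) (lookup (psums (digits a)) (inject₁ j))
  pow-inv : ∀ i e → pow (lookup Y′ i) e * pow (lookup Y i) e ≡ 1ℚ
  pow-inv i e = trans (cong (λ z → pow z e * pow (lookup Y i) e) (VecP.lookup-map i inv Y))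
                      (pow-inverse (lookup Y i) (inv (lookup Y i)) (inv-*ˡ _ (Y≢0 i)) e)

twist⁻E-twistE : ∀ {g} {ns rs : Vec ℕ g} (s : Elt ns rs) (Y : Vars ns) → Generic Y → twist⁻E s Y * twistE s Y ≡ 1ℚ
twist⁻E-twistE {ns = []}    {[]}    s        Y        gen          = refl
twist⁻E-twistE {ns = _ ∷ _} {_ ∷ _} (a , as) (Y , Ys) (gen , gens) = begin
  (twist⁻ a Y * twist⁻E as Ys) * (twist a Y * twistE as Ys)
    ≡⟨ solve 4 (λ a b c d → (a :* b) :* (c :* d) := (a :* c) :* (b :* d)) refl (twist⁻ a Y) (twist⁻E as Ys) (twist a Y) (twistE as Ys) ⟩
  (twist⁻ a Y * twist a Y) * (twist⁻E as Ys * twistE as Ys)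
    ≡⟨ cong₂ _*_ twist⁻-twist (twist⁻E-twistE as Ys gens) ⟩
  1ℚ ∎
  where
  twist⁻-twist : twist⁻ a Y * twist a Y ≡ 1ℚ
  twist⁻-twist = begin
    (sgn (height a) * monomial a (Vec.map inv Y)) * (sgn (height a) * monomial a Y)
      ≡⟨ solve 3 (λ s k′ k → (s :* k′) :* (s :* k) := (s :* s) :* (k′ :* k)) refl (sgn (height a)) (monomial a (Vec.map inv Y)) (monomial a Y) ⟩
    (sgn (height a) * sgn (height a)) * (monomial a (Vec.map inv Y) * monomial a Y)
      ≡⟨ cong₂ _*_ (sgn-square (height a)) (monomial-inverse a Y (GenericVec⇒≢0 Y gen)) ⟩
    1ℚ ∎

DiagonalDefined : ∀ {g} (ns : Vec ℕ g) → Vars ns → Set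
DiagonalDefined []       _        = ⊤
DiagonalDefined (n ∷ ns) (Y , Ys) = (∀ i → 1ℚ + - pow (lookup Y Fin.zero) (suc i) ≢ 0ℚ) × DiagonalDefined ns Ys

Generic⇒DiagonalDefined : ∀ {g} (ns : Vec ℕ g) (Y : Vars ns) → Generic Y → DiagonalDefined ns Y
Generic⇒DiagonalDefined []       Y                 gen = tt
Generic⇒DiagonalDefined (n ∷ ns) (y ∷ Y , Ys) ((_ , y≢1 , y≢-1 , _) , gens) =
  (λ i → 1-x≢0 _ (pow-≢1 y y≢1 y≢-1 i)) , Generic⇒DiagonalDefined ns Ys gens

Generic⇒DiagonalDefined⁻ : ∀ {g} (ns : Vec ℕ g) (Y : Vars ns) → Generic Y → DiagonalDefined ns (invVars Y)
Generic⇒DiagonalDefined⁻ []       Y                 gen = tt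
Generic⇒DiagonalDefined⁻ (n ∷ ns) (y ∷ Y , Ys) ((y≢0 , y≢1 , y≢-1 , _) , gens) =
  (λ i → 1-x≢0 _ (QBinomial.q′ⁱ⁺¹≢1 y (inv y) (inv-*ˡ y y≢0) (pow-≢1 y y≢1 y≢-1) i)) , Generic⇒DiagonalDefined⁻ ns Ys gens

φ-diag : ∀ {n r} (a : P n r) (Y : Vec ℚ (suc n)) → φ a a Y ≡ 1ℚ
φ-diag {n} (a₀ , va) Y rewrite leP-refl (a₀ , va) = trans (prodFin-cong n (λ i → x∧¬x (lookup va i) _)) (prodFin-1 n)
  where
  x∧¬x : ∀ x z → (if x ∧ not x then z else 1ℚ) ≡ 1ℚ
  x∧¬x true  z = refl
  x∧¬x false z = refl

w-diag : ∀ {g} {ns rs : Vec ℕ g} (x : Elt ns rs) (Y : Vars ns) → DiagonalDefined ns Y → w x x Y ≡ 1ℚ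
w-diag {ns = []}    {[]}    x        Y        _          = refl
w-diag {ns = _ ∷ _} {_ ∷ _} (a , as) (Y , Ys) (θ-ok , ok) = begin
  θ a a (lookup Y Fin.zero) * φ a a Y * w as as Ys  ≡⟨ cong₂ (λ u v → u * φ a a Y * v) (qbinom-diag′ (lookup Y Fin.zero) (toℕ (proj₁ a)) θ-ok) (w-diag as Ys ok) ⟩
  1ℚ * φ a a Y * 1ℚ                                 ≡⟨ cong (λ z → 1ℚ * z * 1ℚ) (φ-diag a Y) ⟩
  1ℚ                                                ∎

w-≰E : ∀ {g} {ns rs : Vec ℕ g} (x t : Elt ns rs) (Y : Vars ns) → leE x t ≡ false → w x t Y ≡ 0ℚ
w-≰E {ns = []}    {[]}    x        t        Y        ()
w-≰E {ns = _ ∷ _} {_ ∷ _} (a , as) (b , bs) (Y , Ys) x≰t = by-cases (leP a b) refl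
  where
  by-cases : ∀ c → leP a b ≡ c → w (a , as) (b , bs) (Y , Ys) ≡ 0ℚ
  by-cases false a≰b = trans (cong (_* w as bs Ys) (w₁-≰ a b Y a≰b)) (ℚP.*-zeroˡ (w as bs Ys))
  by-cases true  a≤b = trans (cong (w₁ a b Y *_) (w-≰E as bs Ys (trans (cong (_∧ leE as bs) (sym a≤b)) x≰t)))
                             (ℚP.*-zeroʳ (w₁ a b Y))

w⁻-diag : ∀ {g} {ns rs : Vec ℕ g} (x : Elt ns rs) (Y : Vars ns) → Generic Y → w⁻ x x Y ≡ 1ℚ
w⁻-diag {ns = ns} x Y gen = begin
  twistE x Y * twist⁻E x Y * w x x (invVars Y)  ≡⟨ cong (twistE x Y * twist⁻E x Y *_) (w-diag x (invVars Y) (Generic⇒DiagonalDefined⁻ ns Y gen)) ⟩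
  twistE x Y * twist⁻E x Y * 1ℚ                 ≡⟨ ℚP.*-identityʳ _ ⟩
  twistE x Y * twist⁻E x Y                      ≡⟨ ℚP.*-comm (twistE x Y) _ ⟩
  twist⁻E x Y * twistE x Y                      ≡⟨ twist⁻E-twistE x Y gen ⟩
  1ℚ                                            ∎

w⁻-≰ : ∀ {g} {ns rs : Vec ℕ g} (x t : Elt ns rs) (Y : Vars ns) → leE x t ≡ false → w⁻ x t Y ≡ 0ℚ
w⁻-≰ x t Y x≰t = trans (cong (twistE t Y * twist⁻E x Y *_) (w-≰E x t (invVars Y) x≰t)) (ℚP.*-zeroʳ (twistE t Y * twist⁻E x Y))

-- The chain sums of the theorem as path sums

List-elim : ∀ {A : Set} (Q : List A → Set) → Q [] → (∀ x xs → Q xs → Q (x ∷ xs)) → ∀ xs → Q xs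
List-elim Q q[] q∷ []       = q[]
List-elim Q q[] q∷ (x ∷ xs) = q∷ x xs (List-elim Q q[] q∷ xs)

sumList-filter-step : ∀ {A : Set} (F : A → ℚ) b x (l : List A) R → sumList (List.map F l) ≡ R →
  sumList (List.map F (if b then x ∷ l else l)) ≡ when b (F x) + R
sumList-filter-step F true  x l R e = cong (F x +_) e
sumList-filter-step F false x l R e = trans e (sym (ℚP.+-identityˡ R))

∑-listsOfLength-length : ∀ {A : Set} k (xs : List A) (h : List A → ℕ → ℚ) →
  (∑[ l ∈ listsOfLength k xs ] h l (List.length l)) ≡ ∑[ l ∈ listsOfLength k xs ] h l k
∑-listsOfLength-length zero    xs h = refl
∑-listsOfLength-length (suc k) xs h = begin
  (∑[ l ∈ listsOfLength (suc k) xs ] h l (List.length l))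
    ≡⟨ ∑-concatMap _ xs _ ⟩
  (∑[ x ∈ xs ] ∑[ l ∈ List.map (x ∷_) (listsOfLength k xs) ] h l (List.length l))
    ≡⟨ ∑-cong xs (λ x → trans (∑-map (x ∷_) (listsOfLength k xs) _)
         (trans (∑-listsOfLength-length k xs (λ l m → h (x ∷ l) (suc m))) (sym (∑-map (x ∷_) (listsOfLength k xs) _)))) ⟩
  (∑[ x ∈ xs ] ∑[ l ∈ List.map (x ∷_) (listsOfLength k xs) ] h l (suc k))
    ≡⟨ sym (∑-concatMap _ xs _) ⟩
  (∑[ l ∈ listsOfLength (suc k) xs ] h l (suc k)) ∎

module Chains {g} (ns rs : Vec ℕ g) where

  E : Set
  E = Elt ns rs

  open ChainSums (allE ns rs) ∈-allE ltE ltE-irrefl ltE-trans public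

  0̂ 1̂ : E
  0̂ = bot
  1̂ = top

  unitriangular : (f : E → E → ℚ) → (∀ x → f x x ≡ 1ℚ) → (∀ x t → leE x t ≡ false → f x t ≡ 0ℚ) →
    ∀ x t → f x t ≡ strict f x t + when (eqE x t) 1ℚ
  unitriangular f f-diag f-≰ x t = by-cases (leE x t) (eqE x t) refl refl
    where
    by-cases : ∀ l e → leE x t ≡ l → eqE x t ≡ e → f x t ≡ when (l ∧ not e) (f x t) + when e 1ℚ
    by-cases true  false _   _   = sym (ℚP.+-identityʳ _)
    by-cases l     true  _   x≡t rewrite eqE⇒≡ x t x≡t | ∧-zeroʳ l = trans (f-diag t) (sym (ℚP.+-identityˡ 1ℚ))
    by-cases false false x≰t _   = f-≰ x t x≰t

  -- (1 + u)(1 + v) = 1 restricted to x < y, for the strict parts u, v of two inverse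
  -- unitriangular functions f, g.
  strict-inverse : (f g : E → E → ℚ) →
    (∀ x → f x x ≡ 1ℚ) → (∀ x t → leE x t ≡ false → f x t ≡ 0ℚ) →
    (∀ x → g x x ≡ 1ℚ) → (∀ x t → leE x t ≡ false → g x t ≡ 0ℚ) →
    (∀ x y → (∑[ t ∈ allE ns rs ] f x t * g t y) ≡ when (eqE x y) 1ℚ) →
    ∀ x y → ltE x y ≡ true → strict g x y + (∑[ t ∈ allE ns rs ] strict f x t * strict g t y) ≡ - strict f x y
  strict-inverse f g f-diag f-≰ g-diag g-≰ fg≡δ x y x<y = begin
    v x y + Σuv                    ≡⟨ solve 3 (λ a b c → a :+ b := (a :+ b :+ c) :+ :- c) refl (v x y) Σuv (u x y) ⟩
    (v x y + Σuv + u x y) + - u x y  ≡⟨ cong (_+ - u x y) expand-fg ⟩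
    0ℚ + - u x y                   ≡⟨ ℚP.+-identityˡ _ ⟩
    - u x y                        ∎
    where
    Es = allE ns rs
    u = strict f
    v = strict g
    δ : E → E → ℚ
    δ a b = when (eqE a b) 1ℚ
    Σuv = ∑[ t ∈ Es ] u x t * v t y
    x≢y : eqE x y ≡ false
    x≢y = by-cases (eqE x y) refl
      where
      by-cases : ∀ b → eqE x y ≡ b → eqE x y ≡ false
      by-cases false x≢y = x≢y
      by-cases true  x≡y = ⊥-elim (ltE⇒≢ x y x<y (eqE⇒≡ x y x≡y))
    ∑δδ : (∑[ t ∈ Es ] δ x t * δ t y) ≡ 0ℚ
    ∑δδ = trans (∑-δ-* x (λ t → δ t y)) (cong (λ c → when c 1ℚ) x≢y)
    expand-fg : v x y + Σuv + u x y ≡ 0ℚ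
    expand-fg = begin
      v x y + Σuv + u x y
        ≡⟨ cong₂ (λ p q → q + Σuv + p) (sym (∑-*-δ y (u x))) (sym (∑-δ-* x (λ t → v t y))) ⟩
      (∑[ t ∈ Es ] δ x t * v t y) + Σuv + (∑[ t ∈ Es ] u x t * δ t y)
        ≡⟨ solve 3 (λ a b c → a :+ b :+ c := (b :+ c) :+ (a :+ con 0ℚ)) refl (∑[ t ∈ Es ] δ x t * v t y) Σuv (∑[ t ∈ Es ] u x t * δ t y) ⟩
      (Σuv + (∑[ t ∈ Es ] u x t * δ t y)) + ((∑[ t ∈ Es ] δ x t * v t y) + 0ℚ)
        ≡⟨ cong (λ p → (Σuv + (∑[ t ∈ Es ] u x t * δ t y)) + ((∑[ t ∈ Es ] δ x t * v t y) + p)) (sym ∑δδ) ⟩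
      (Σuv + (∑[ t ∈ Es ] u x t * δ t y)) + ((∑[ t ∈ Es ] δ x t * v t y) + (∑[ t ∈ Es ] δ x t * δ t y))
        ≡⟨ sym (trans (∑-+ Es _ _) (cong₂ _+_ (∑-+ Es _ _) (∑-+ Es _ _))) ⟩
      (∑[ t ∈ Es ] ((u x t * v t y + u x t * δ t y) + (δ x t * v t y + δ x t * δ t y)))
        ≡⟨ ∑-cong Es (λ t → sym (trans (cong₂ _*_ (unitriangular f f-diag f-≰ x t) (unitriangular g g-diag g-≰ t y))
             (solve 4 (λ a b c d → (a :+ c) :* (b :+ d) := (a :* b :+ a :* d) :+ (c :* b :+ c :* d)) refl (u x t) (v t y) (δ x t) (δ t y)))) ⟩
      (∑[ t ∈ Es ] f x t * g t y)
        ≡⟨ fg≡δ x y ⟩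
      δ x y
        ≡⟨ cong (λ c → when c 1ℚ) x≢y ⟩
      0ℚ ∎

  sequences : List (List E)
  sequences = concatMap (λ k → listsOfLength k (allE ns rs)) (upTo (suc L))

  -- The filter in chainsIn is local to Defs: the list it filters is generalised
  -- with `with`, and the motive of the induction is left to unification.
  chainSum-as-∑ : ∀ S Y → chainSum S Y ≡ ∑[ ch ∈ sequences ] when (increasing ch ∧ allᵇ S ch) (sgn (List.length ch) * W ch Y)
  chainSum-as-∑ S Y = expand
    where
    F : List E → ℚ
    F ch = sgn (List.length ch) * W ch Y
    Motive : List (List E) → Set
    Motive = _
    expand : chainSum S Y ≡ ∑[ ch ∈ sequences ] when (increasing ch ∧ allᵇ S ch) (F ch)
    expand with concatMap (λ k → listsOfLength k (allE ns rs)) (applyUpTo suc L)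
    ... | longer = List-elim Motive refl
      (λ ch chs ih → cong (F [] +_) (sumList-filter-step F (increasing ch ∧ allᵇ S ch) ch _ _ (+-cancelˡ (F []) _ _ ih))) longer

  wPath≡pathWeight : ∀ (p : List E) Y → wPath p Y ≡ pathWeight (λ a b → w a b Y) p
  wPath≡pathWeight []          Y = refl
  wPath≡pathWeight (x ∷ [])    Y = refl
  wPath≡pathWeight (x ∷ y ∷ p) Y = cong (w x y Y *_) (wPath≡pathWeight (y ∷ p) Y)

  pathWeight-strict : ∀ (f : E → E → ℚ) (p : List E) → pathWeight (strict f) p ≡ when (increasing p) (pathWeight f p)
  pathWeight-strict f []          = refl
  pathWeight-strict f (x ∷ [])    = refl
  pathWeight-strict f (x ∷ y ∷ p) = when-*-when (ltE x y) (increasing (y ∷ p)) (pathWeight-strict f (y ∷ p))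
    where
    when-*-when : ∀ b c {z z′} → z ≡ when c z′ → when b (f x y) * z ≡ when (b ∧ c) (f x y * z′)
    when-*-when true  c z≡ = trans (cong (f x y *_) z≡) (*-when c (f x y) _)
    when-*-when false c {z} _ = ℚP.*-zeroˡ z

  module _ (S : E → Bool) (S⊆ : ∀ c → S c ≡ true → inInterval c ≡ true) where

    private
      increasing-to-top : ∀ c l → ltE c 1̂ ≡ true → allᵇ S l ≡ true → increasing (c ∷ l ++ 1̂ ∷ []) ≡ increasing (c ∷ l)
      increasing-to-top c []      c<1̂ _    rewrite c<1̂ = refl
      increasing-to-top c (d ∷ l) c<1̂ S-dl with ∧-true⁻ {S d} S-dl
      ... | Sd , Sl = cong (ltE c d ∧_) (increasing-to-top d l (proj₂ (∧-true⁻ {ltE 0̂ d} (S⊆ d Sd))) Sl)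

      increasing-bot-top : ∀ l → allᵇ S l ≡ true → ltE 0̂ 1̂ ≡ true → increasing (0̂ ∷ l ++ 1̂ ∷ []) ≡ increasing l
      increasing-bot-top []      _   0̂<1̂ rewrite 0̂<1̂ = refl
      increasing-bot-top (c ∷ l) S-cl _ with ∧-true⁻ {S c} S-cl
      ... | Sc , Sl with ∧-true⁻ {ltE 0̂ c} (S⊆ c Sc)
      ... | 0̂<c , c<1̂ rewrite 0̂<c = increasing-to-top c l c<1̂ Sl

    chainSum≡pathSum : ∀ Y → ltE 0̂ 1̂ ≡ true → chainSum S Y ≡ pathSum (strict (λ a b → w a b Y)) S 0̂ 1̂
    chainSum≡pathSum Y 0̂<1̂ = begin
      chainSum S Y
        ≡⟨ chainSum-as-∑ S Y ⟩
      (∑[ ch ∈ sequences ] when (increasing ch ∧ allᵇ S ch) (sgn (List.length ch) * W ch Y))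
        ≡⟨ ∑-concatMap (λ k → listsOfLength k (allE ns rs)) (upTo (suc L)) (λ ch → when (increasing ch ∧ allᵇ S ch) (sgn (List.length ch) * W ch Y)) ⟩
      (∑[ k ∈ upTo (suc L) ] ∑[ ch ∈ listsOfLength k (allE ns rs) ] when (increasing ch ∧ allᵇ S ch) (sgn (List.length ch) * W ch Y))
        ≡⟨ ∑-cong (upTo (suc L)) (λ k → ∑-listsOfLength-length k (allE ns rs) (λ ch m → when (increasing ch ∧ allᵇ S ch) (sgn m * W ch Y))) ⟩
      (∑[ k ∈ upTo (suc L) ] ∑[ ch ∈ listsOfLength k (allE ns rs) ] when (increasing ch ∧ allᵇ S ch) (sgn k * W ch Y))
        ≡⟨ ∑-cong (upTo (suc L)) (λ k → ∑-cong (listsOfLength k (allE ns rs)) (term k)) ⟩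
      pathSum (strict (λ a b → w a b Y)) S 0̂ 1̂ ∎
      where
      term : ∀ k ch → when (increasing ch ∧ allᵇ S ch) (sgn k * W ch Y)
                    ≡ when (allᵇ S ch) (sgn k * pathWeight (strict (λ a b → w a b Y)) (0̂ ∷ ch ++ 1̂ ∷ []))
      term k ch with allᵇ S ch in S-ch
      ... | false = cong (λ c → when c (sgn k * W ch Y)) (∧-zeroʳ (increasing ch))
      ... | true  = begin
        when (increasing ch ∧ true) (sgn k * W ch Y)
          ≡⟨ cong (λ c → when c (sgn k * W ch Y)) (∧-identityʳ (increasing ch)) ⟩
        when (increasing ch) (sgn k * W ch Y)
          ≡⟨ sym (*-when (increasing ch) (sgn k) (W ch Y)) ⟩
        sgn k * when (increasing ch) (W ch Y)
          ≡⟨ cong₂ (λ c z → sgn k * when c z) (sym (increasing-bot-top ch S-ch 0̂<1̂)) (wPath≡pathWeight (0̂ ∷ ch ++ 1̂ ∷ []) Y) ⟩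
        sgn k * when (increasing (0̂ ∷ ch ++ 1̂ ∷ [])) (pathWeight (λ a b → w a b Y) (0̂ ∷ ch ++ 1̂ ∷ []))
          ≡⟨ cong (sgn k *_) (sym (pathWeight-strict (λ a b → w a b Y) (0̂ ∷ ch ++ 1̂ ∷ []))) ⟩
        sgn k * pathWeight (strict (λ a b → w a b Y)) (0̂ ∷ ch ++ 1̂ ∷ []) ∎

  chainSum-∅ : ∀ (S : E → Bool) → (∀ c → S c ≡ false) → ∀ Y → chainSum S Y ≡ w 0̂ 1̂ Y
  chainSum-∅ S S≡∅ Y = begin
    chainSum S Y
      ≡⟨ chainSum-as-∑ S Y ⟩
    ∑ sequences h
      ≡⟨ ∑-concatMap (λ k → listsOfLength k (allE ns rs)) (upTo (suc L)) h ⟩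
    (∑[ k ∈ upTo (suc L) ] ∑ (listsOfLength k (allE ns rs)) h)
      ≡⟨ ∑-upTo-suc L (λ k → ∑ (listsOfLength k (allE ns rs)) h) ⟩
    (h [] + 0ℚ) + (∑[ k ∈ upTo L ] ∑ (listsOfLength (suc k) (allE ns rs)) h)
      ≡⟨ cong ((h [] + 0ℚ) +_) (∑-zero (upTo L) nonempty) ⟩
    (h [] + 0ℚ) + 0ℚ
      ≡⟨ solve 1 (λ z → (con 1ℚ :* (z :* con 1ℚ) :+ con 0ℚ) :+ con 0ℚ := z) refl (w 0̂ 1̂ Y) ⟩
    w 0̂ 1̂ Y ∎
    where
    h : List E → ℚ
    h ch = when (increasing ch ∧ allᵇ S ch) (sgn (List.length ch) * W ch Y)
    nonempty : ∀ k → ∑ (listsOfLength (suc k) (allE ns rs)) h ≡ 0ℚ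
    nonempty k = trans (∑-concatMap _ (allE ns rs) h) (∑-zero (allE ns rs) (λ x →
      trans (∑-map (x ∷_) (listsOfLength k (allE ns rs)) h) (∑-zero (listsOfLength k (allE ns rs)) (λ l →
        trans (cong (λ c → when (increasing (x ∷ l) ∧ (c ∧ allᵇ S l)) (sgn (suc (List.length l)) * W (x ∷ l) Y)) (S≡∅ x))
              (cong (λ c → when c (sgn (suc (List.length l)) * W (x ∷ l) Y)) (∧-zeroʳ (increasing (x ∷ l))))))))

-- The endpoints 0̂ and 1̂

height-zeroP : ∀ {n r} → height (zeroP {n} {r}) ≡ 0
height-zeroP {n} = sum-falses n
  where
  sum-falses : ∀ n → Vec.sum (Vec.map b2n (Vec.replicate n false)) ≡ 0
  sum-falses zero    = refl
  sum-falses (suc n) = sum-falses n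

height-oneP : ∀ {n r} → height (oneP {n} {r}) ≡ r ℕ.+ n
height-oneP {n} {r} = cong₂ ℕ._+_ (FinP.toℕ-fromℕ r) (sum-trues n)
  where
  sum-trues : ∀ n → Vec.sum (Vec.map b2n (Vec.replicate n true)) ≡ n
  sum-trues zero    = refl
  sum-trues (suc n) = cong suc (sum-trues n)

monomial-zeroP : ∀ {n r} (Y : Vec ℚ (suc n)) → monomial (zeroP {n} {r}) Y ≡ 1ℚ
monomial-zeroP {n} {r} Y = trans (cong (1ℚ *_) (trans (prodFin-cong n (λ j → cong (pow (lookup Y (Fin.suc j))) (s≡0 j))) (prodFin-1 n)))
                                 (ℚP.*-identityˡ 1ℚ)
  where
  s≡0 : ∀ j → lookup (psums (digits (zeroP {n} {r}))) (inject₁ j) ≡ 0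
  s≡0 j = trans (cong (λ v → lookup v (inject₁ j)) (psums-digits-zeroP {n} {r})) (VecP.lookup-replicate (inject₁ j) 0)

monomial-oneP : ∀ {n r} (Y : Vec ℚ (suc n)) →
  monomial (oneP {n} {r}) Y ≡ pow (lookup Y Fin.zero) (r C 2) * prodFin n (λ j → pow (lookup Y (Fin.suc j)) (r ℕ.+ toℕ j))
monomial-oneP {n} {r} Y = cong₂ _*_ (cong (λ z → pow (lookup Y Fin.zero) (z C 2)) (FinP.toℕ-fromℕ r))
  (prodFin-cong n (λ j → cong (pow (lookup Y (Fin.suc j))) (trans (s≡ n (toℕ (fromℕ r)) j) (cong (ℕ._+ toℕ j) (FinP.toℕ-fromℕ r)))))
  where
  s≡ : ∀ m x (j : Fin m) → lookup (psums (x ∷ Vec.map b2n (Vec.replicate m true))) (inject₁ j) ≡ x ℕ.+ toℕ j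
  s≡ (suc m) x Fin.zero    = sym (ℕP.+-identityʳ x)
  s≡ (suc m) x (Fin.suc j) = trans (VecP.lookup-map (inject₁ j) (x ℕ.+_) (psums (1 ∷ Vec.map b2n (Vec.replicate m true))))
                                   (cong (x ℕ.+_) (s≡ m 1 j))

private
  +-interchange : ∀ a b c d → (a ℕ.+ b) ℕ.+ (c ℕ.+ d) ≡ (b ℕ.+ c) ℕ.+ (a ℕ.+ d)
  +-interchange = solveℕ 4 (λ a b c d → (a ⊕ b) ⊕ (c ⊕ d) ≐ (b ⊕ c) ⊕ (a ⊕ d)) refl
    where open ℕSolver.+-*-Solver using () renaming (solve to solveℕ; _:+_ to _⊕_; _:=_ to _≐_)

twistE-top : ∀ {g} (ns rs : Vec ℕ g) (Y : Vars ns) → twistE (top {ns = ns} {rs}) Y ≡ sgn (Ntot ns rs) * K ns rs Y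
twistE-top []       []       Y        = refl
twistE-top (n ∷ ns) (r ∷ rs) (Y , Ys) = begin
  (sgn (height (oneP {n} {r})) * monomial (oneP {n} {r}) Y) * twistE (top {ns = ns} {rs}) Ys
    ≡⟨ cong₂ _*_ (cong₂ _*_ (cong sgn (height-oneP {n} {r})) (monomial-oneP {n} {r} Y)) (twistE-top ns rs Ys) ⟩
  (sgn (r ℕ.+ n) * k) * (sgn (Ntot ns rs) * K ns rs Ys)
    ≡⟨ solve 4 (λ a b c d → (a :* b) :* (c :* d) := (a :* c) :* (b :* d)) refl (sgn (r ℕ.+ n)) k (sgn (Ntot ns rs)) (K ns rs Ys) ⟩
  (sgn (r ℕ.+ n) * sgn (Ntot ns rs)) * (k * K ns rs Ys)
    ≡⟨ cong (_* (k * K ns rs Ys)) (trans (sym (sgn-+ (r ℕ.+ n) (Ntot ns rs))) (cong sgn (+-interchange r n (Vec.sum ns) (Vec.sum rs)))) ⟩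
  sgn (Ntot (n ∷ ns) (r ∷ rs)) * K (n ∷ ns) (r ∷ rs) (Y , Ys) ∎
  where
  k = pow (lookup Y Fin.zero) (r C 2) * prodFin n (λ j → pow (lookup Y (Fin.suc j)) (r ℕ.+ toℕ j))

twist⁻E-bot : ∀ {g} (ns rs : Vec ℕ g) (Y : Vars ns) → twist⁻E (bot {ns = ns} {rs}) Y ≡ 1ℚ
twist⁻E-bot []       []       Y        = refl
twist⁻E-bot (n ∷ ns) (r ∷ rs) (Y , Ys) =
  cong₂ _*_ (cong₂ _*_ (cong sgn (height-zeroP {n} {r})) (monomial-zeroP {n} {r} (Vec.map inv Y))) (twist⁻E-bot ns rs Ys)

heightE : ∀ {g} {ns rs : Vec ℕ g} → Elt ns rs → ℕ
heightE {ns = []}    {[]}    _        = 0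
heightE {ns = _ ∷ _} {_ ∷ _} (a , as) = height a ℕ.+ heightE as

heightE-bot : ∀ {g} (ns rs : Vec ℕ g) → heightE (bot {ns = ns} {rs}) ≡ 0
heightE-bot []       []       = refl
heightE-bot (n ∷ ns) (r ∷ rs) = cong₂ ℕ._+_ (height-zeroP {n} {r}) (heightE-bot ns rs)

heightE-top : ∀ {g} (ns rs : Vec ℕ g) → heightE (top {ns = ns} {rs}) ≡ Ntot ns rs
heightE-top []       []       = refl
heightE-top (n ∷ ns) (r ∷ rs) = trans (cong₂ ℕ._+_ (height-oneP {n} {r}) (heightE-top ns rs)) (+-interchange r n (Vec.sum ns) (Vec.sum rs))

bot≡top : ∀ {g} (ns rs : Vec ℕ g) → Ntot ns rs ≡ 0 → bot {ns = ns} {rs} ≡ top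
bot≡top []           []           _ = refl
bot≡top (zero ∷ ns)  (zero ∷ rs)  N≡0 = cong (zeroP ,_) (bot≡top ns rs N≡0)
bot≡top (suc n ∷ ns) (r ∷ rs)     ()
bot≡top (zero ∷ ns)  (suc r ∷ rs) N≡0 = ⊥-elim (ℕP.1+n≢0 (trans (sym (ℕP.+-suc (Vec.sum ns) _)) N≡0))

K≡1 : ∀ {g} (ns rs : Vec ℕ g) (Y : Vars ns) → Ntot ns rs ≡ 0 → K ns rs Y ≡ 1ℚ
K≡1 []           []           Y        _   = refl
K≡1 (zero ∷ ns)  (zero ∷ rs)  (Y , Ys) N≡0 = trans (cong (1ℚ * 1ℚ *_) (K≡1 ns rs Ys N≡0)) (ℚP.*-identityˡ 1ℚ)
K≡1 (suc n ∷ ns) (r ∷ rs)     Y        ()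
K≡1 (zero ∷ ns)  (suc r ∷ rs) Y        N≡0 = ⊥-elim (ℕP.1+n≢0 (trans (sym (ℕP.+-suc (Vec.sum ns) _)) N≡0))

bot<top : ∀ {g} (ns rs : Vec ℕ g) {N} → Ntot ns rs ≡ suc N → ltE (bot {ns = ns} {rs}) top ≡ true
bot<top ns rs N≡1+N = leE∧≢⇒ltE 0̂ 1̂ (leE-bot 1̂) 0̂≢1̂
  where
  0̂ 1̂ : Elt ns rs
  0̂ = bot
  1̂ = top
  0̂≢1̂ : 0̂ ≢ 1̂
  0̂≢1̂ 0̂≡1̂ = ℕP.1+n≢0 (trans (sym N≡1+N)
    (trans (sym (heightE-top ns rs)) (trans (cong heightE (sym 0̂≡1̂)) (heightE-bot ns rs))))

complIn⊆inInterval : ∀ {g} {ns rs : Vec ℕ g} (S : Elt ns rs → Bool) c → complIn S c ≡ true → inInterval c ≡ true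
complIn⊆inInterval S c Sᶜc = proj₁ (∧-true⁻ {inInterval c} Sᶜc)

module Reciprocity {g} (ns rs : Vec ℕ g) where

  open Chains ns rs

  chainSum-trivial : 0̂ ≡ 1̂ → ∀ S → (∀ c → S c ≡ true → inInterval c ≡ true) →
    ∀ Y → DiagonalDefined ns Y → chainSum S Y ≡ 1ℚ
  chainSum-trivial 0̂≡1̂ S S⊆ Y ok = begin
    chainSum S Y  ≡⟨ chainSum-∅ S S≡∅ Y ⟩
    w 0̂ 1̂ Y       ≡⟨ cong (λ t → w 0̂ t Y) (sym 0̂≡1̂) ⟩
    w 0̂ 0̂ Y       ≡⟨ w-diag 0̂ Y ok ⟩
    1ℚ            ∎
    where
    outside : ∀ c → inInterval c ≡ false
    outside c with ltE 0̂ c in 0̂<c | ltE c 1̂ in c<1̂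
    ... | false | _     = refl
    ... | true  | false = refl
    ... | true  | true  with () ← trans (sym (ltE-trans 0̂ c 1̂ 0̂<c c<1̂)) (trans (cong (ltE 0̂) (sym 0̂≡1̂)) (ltE-irrefl 0̂))
    S≡∅ : ∀ c → S c ≡ false
    S≡∅ c with S c in Sc
    ... | false = refl
    ... | true  with () ← trans (sym (S⊆ c Sc)) (outside c)

  module _ (Y : Vars ns) (gen : Generic Y) where

    private
      u v z : E → E → ℚ
      u = strict (λ a b → w a b Y)
      v = strict (λ a b → w⁻ a b Y)
      z = strict (λ a b → w a b (invVars Y))

      uv-inverse : ∀ x y → ltE x y ≡ true → v x y + (∑[ t ∈ allE ns rs ] u x t * v t y) ≡ - u x y
      uv-inverse = strict-inverse (λ a b → w a b Y) (λ a b → w⁻ a b Y)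
        (λ (x : E) → w-diag x Y (Generic⇒DiagonalDefined ns Y gen)) (λ (x t : E) → w-≰E x t Y)
        (λ (x : E) → w⁻-diag x Y gen) (λ (x t : E) → w⁻-≰ x t Y) (w-w⁻-inverse Y gen)

    chainSum-reciprocity : ∀ S → (∀ c → S c ≡ true → inInterval c ≡ true) → ltE 0̂ 1̂ ≡ true →
      chainSum S Y ≡ - (twistE 1̂ Y * chainSum (complIn S) (invVars Y))
    chainSum-reciprocity S S⊆ 0̂<1̂ = begin
      chainSum S Y
        ≡⟨ chainSum≡pathSum S S⊆ Y 0̂<1̂ ⟩
      pathSum u S 0̂ 1̂
        ≡⟨ +≡0⇒≡- _ _ pathSum-complement ⟩
      - pathSum v Sᶜ 0̂ 1̂
        ≡⟨ cong -_ (pathSum-conjugate v z (λ a → twistE a Y) (λ a → twist⁻E a Y) (λ m → twist⁻E-twistE m Y gen)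
                     (λ x y → sym (*-when (ltE x y) (twistE y Y * twist⁻E x Y) _)) Sᶜ 0̂ 1̂) ⟩
      - ((twistE 1̂ Y * twist⁻E 0̂ Y) * pathSum z Sᶜ 0̂ 1̂)
        ≡⟨ cong₂ (λ c p → - ((twistE 1̂ Y * c) * p)) (twist⁻E-bot ns rs Y) (sym (chainSum≡pathSum Sᶜ (complIn⊆inInterval S) (invVars Y) 0̂<1̂)) ⟩
      - ((twistE 1̂ Y * 1ℚ) * chainSum Sᶜ (invVars Y))
        ≡⟨ cong (λ c → - (c * chainSum Sᶜ (invVars Y))) (ℚP.*-identityʳ (twistE 1̂ Y)) ⟩
      - (twistE 1̂ Y * chainSum (complIn S) (invVars Y)) ∎
      where
      open Complement u v (strict-supported _) (strict-supported _) uv-inverse 0̂ 1̂ bot-least S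

corollary6p1 : (g : ℕ) → 1 ≤ g → (ns rs : Vec ℕ g)
    → (S : Elt ns rs → Bool) → (∀ c → S c ≡ true → inInterval c ≡ true)
    → (Y : Vars ns) → Generic Y
    → chainSum S Y ≡ sgn (Ntot ns rs ∸ 1) * K ns rs Y * chainSum (complIn S) (invVars Y)
corollary6p1 g _ ns rs S S⊆ Y gen with Ntot ns rs in N≡
... | zero  = begin
  chainSum S Y
    ≡⟨ chainSum-trivial (bot≡top ns rs N≡) S S⊆ Y (Generic⇒DiagonalDefined ns Y gen) ⟩
  1ℚ
    ≡⟨ cong₂ (λ k c → 1ℚ * k * c) (sym (K≡1 ns rs Y N≡))
         (sym (chainSum-trivial (bot≡top ns rs N≡) (complIn S) (complIn⊆inInterval S) (invVars Y) (Generic⇒DiagonalDefined⁻ ns Y gen))) ⟩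
  1ℚ * K ns rs Y * chainSum (complIn S) (invVars Y) ∎
  where open Reciprocity ns rs
... | suc N = begin
  chainSum S Y                     ≡⟨ chainSum-reciprocity Y gen S S⊆ (bot<top ns rs N≡) ⟩
  - (twistE top Y * X)             ≡⟨ cong (λ c → - (c * X)) (trans (twistE-top ns rs Y) (cong (λ n → sgn n * K ns rs Y) N≡)) ⟩
  - (sgn (suc N) * K ns rs Y * X)  ≡⟨ solve 3 (λ s k x → :- ((:- con 1ℚ :* s) :* k :* x) := s :* k :* x) refl (sgn N) (K ns rs Y) X ⟩
  sgn N * K ns rs Y * X            ∎
  where
  open Reciprocity ns rs
  X = chainSum (complIn S) (invVars Y)
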